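{- Let $k,t\ge1$ and $\lambda=(k^t)=(k,k,\dots,k)$ ($t$ parts), with length $\ell(\lambda)=t$. Then for $n\ge0$, \[ \mathrm{ehr}(\mathcal{O}(P_\lambda),n)=s_\lambda(1^{n+\ell(\lambda)})=\prod_{u\in\lambda}\frac{n+\ell(\lambda)+c(u)}{h(u)}, \] where for a cell $u=(i,j)$ of $\lambda$, $h(u)=\lambda_i+\lambda'_j-i-j+1$ is its hook length and $c(u)=j-i$ its content.
   Context: For a partition $\lambda=(\lambda_1\ge\cdots\ge\lambda_t>0)$, the Ferrers poset $P_\lambda$ has as elements the cells $(i,j)$, $1\le j\le\lambda_i$, ordered by $(i,j)\preceq(i',j')$ iff $i'\le i$ and $j'\le j$. For a finite poset $P$, the order polytope $\mathcal{O}(P)\subset\mathbb{R}^P$ is defined by $0\le x_s\le1$ and $x_s\le x_{s'}$ whenever $s\prec s'$; $\mathrm{ehr}(\mathcal{O}(P),n)=|n\mathcal{O}(P)\cap\mathbb{Z}^P|$ for $n\ge1$, $=1$ for $n=0$. $\lambda'$ is the conjugate partition. $s_\lambda(1^N)$ is the Schur function $s_\lambda$ evaluated at $x_1=\cdots=x_N=1$ and all other variables $0$, i.e. the number of semistandard Young tableaux of shape $\lambda$ (rows weakly increasing, columns strictly increasing) with entries in $\{1,\dots,N\}$. -}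

module Defs where

open import Data.Bool using (Bool; true; false; _∧_; _∨_; not; if_then_else_)
open import Data.Nat using (ℕ; zero; suc; _+_; _∸_; _≤ᵇ_; _<ᵇ_; _≡ᵇ_)
open import Data.Integer as ℤ using (ℤ; +_)
open import Data.Rational as ℚ using (ℚ; 1ℚ)
open import Data.List using (List; []; _∷_; map; concatMap; length; foldr; upTo; replicate; zip)
open import Data.Product using (_×_; _,_)

-- A partition is a weakly decreasing list of positive parts λ₁ ≥ … ≥ λₜ.
Partition : Set
Partition = List ℕ

-- Cells are pairs (i , j), 1-indexed (row i, column j).
Cell : Set
Cell = ℕ × ℕ

range1 : ℕ → List ℕ
range1 m = map suc (upTo m)

cellsFrom : ℕ → Partition → List Cell
cellsFrom i [] = []
cellsFrom i (r ∷ rs) = map (λ j → (i , j)) (range1 r) ++′ cellsFrom (suc i) rs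
  where
  _++′_ : List Cell → List Cell → List Cell
  [] ++′ ys = ys
  (x ∷ xs) ++′ ys = x ∷ (xs ++′ ys)

cells : Partition → List Cell
cells λ′ = cellsFrom 1 λ′

_⪯ᵇ_ : Cell → Cell → Bool
(i , j) ⪯ᵇ (i′ , j′) = (i′ ≤ᵇ i) ∧ (j′ ≤ᵇ j)

cellEqᵇ : Cell → Cell → Bool
cellEqᵇ (i , j) (i′ , j′) = (i ≡ᵇ i′) ∧ (j ≡ᵇ j′)

_≺ᵇ_ : Cell → Cell → Bool
s ≺ᵇ s′ = (s ⪯ᵇ s′) ∧ not (cellEqᵇ s s′)

count : {A : Set} → (A → Bool) → List A → ℕ
count p [] = 0
count p (x ∷ xs) = if p x then suc (count p xs) else count p xs

allAssign : ℕ → List ℕ → List (List ℕ)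
allAssign zero vals = [] ∷ []
allAssign (suc m) vals = concatMap (λ v → map (v ∷_) (allAssign m vals)) vals

allᵇ : {A : Set} → (A → Bool) → List A → Bool
allᵇ p [] = true
allᵇ p (x ∷ xs) = p x ∧ allᵇ p xs

allPairs : List (Cell × ℕ) → (Cell × ℕ → Cell × ℕ → Bool) → Bool
allPairs xs p = allᵇ (λ a → allᵇ (λ b → p a b) xs) xs

-- x (labels of cells, aligned with 'cells λ') lies in n·O(P_λ) ∩ ℤ^{P_λ}
-- (the bounds 0 ≤ x_s ≤ n are enforced by the enumeration of values in {0..n}):
-- x_s ≤ x_{s'} whenever s ≺ s'
orderOK : List (Cell × ℕ) → Bool
orderOK xs = allPairs xs (λ { (s , a) (s′ , b) → not (s ≺ᵇ s′) ∨ (a ≤ᵇ b) })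

ehrFerrers : Partition → ℕ → ℕ
ehrFerrers λ′ n =
  count (λ x → orderOK (zip (cells λ′) x)) (allAssign (length (cells λ′)) (upTo (suc n)))

ssytOK : List (Cell × ℕ) → Bool
ssytOK xs = allPairs xs (λ { ((i , j) , a) ((i′ , j′) , b) →
  (not ((i ≡ᵇ i′) ∧ (j <ᵇ j′)) ∨ (a ≤ᵇ b)) ∧
  (not ((j ≡ᵇ j′) ∧ (i <ᵇ i′)) ∨ (a <ᵇ b)) })

-- s_λ(1^N) = number of SSYT of shape λ with entries in {1, …, N}
schur1 : Partition → ℕ → ℕ
schur1 λ′ N =
  count (λ T → ssytOK (zip (cells λ′) T)) (allAssign (length (cells λ′)) (range1 N))

-- λᵢ (1-indexed; 0 outside the partition)
part : Partition → ℕ → ℕ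
part [] i = 0
part (r ∷ rs) zero = 0
part (r ∷ rs) (suc zero) = r
part (r ∷ rs) (suc (suc i)) = part rs (suc i)

conj : Partition → ℕ → ℕ
conj λ′ j = count (λ r → j ≤ᵇ r) λ′

-- hook length h(u) = λᵢ + λ'ⱼ - i - j + 1, written as suc ((λᵢ + λ'ⱼ) ∸ (i + j));
-- for cells u of λ one has λᵢ ≥ j and λ'ⱼ ≥ i, so this equals the usual hook length.
hook : Partition → Cell → ℕ
hook λ′ (i , j) = suc ((part λ′ i + conj λ′ j) ∸ (i + j))

content : Cell → ℤ
content (i , j) = + j ℤ.- + i

hookContent : Partition → ℕ → ℚ
hookContent λ′ N =
  foldr (λ u acc → ((+ N ℤ.+ content u) ℚ./ hook λ′ u) ℚ.* acc) 1ℚ (cells λ′)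

rect : ℕ → ℕ → Partition
rect k t = replicate t k

ℕtoℚ : ℕ → ℚ
ℕtoℚ m = + m ℚ./ 1

-- Lattice points x of n·O(P_(k^t)) are labellings of the cells by 0 … n that weakly decrease along rows
-- and columns. Replacing x(i, j) by n + i - x(i, j) turns them into semistandard tableaux of shape (k^t)
-- with entries ≤ n + t, and back: since every column has t cells, the entries of row i of such a tableau
-- lie in [i, n + i].
--
-- For the hook-content formula pad λ = (k^t) with zeros to length N = n + t. Deleting the entries N from
-- a tableau with entries ≤ N leaves a tableau of a shape μ interlacing λ, so s_λ(1^N) = Σ_μ s_μ(1^(N-1)).
-- Up to sign, the determinant det (C(λᵢ + N - i, c)) obeys the same recursion: it is multilinear in the
-- rows, and summing a row over μᵢ ∈ [λᵢ₊₁, λᵢ] telescopes by the hockey-stick identity. Scaling column c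
-- by c! turns C(x, c) into a monic polynomial of degree c, so the determinant is a Vandermonde product,
-- which for (k^t, 0^n) is evaluated explicitly and matched with the product of (N + c(u)) / h(u).

module Submission where

module Determinant where

  open import Data.Nat as ℕ using (ℕ; zero; suc; z≤n; s≤s) renaming (_<_ to _<ℕ_; _≤_ to _≤ℕ_)
  import Data.Nat.Properties as ℕₚ
  open import Data.Integer using (ℤ; +_; +[1+_]; -[1+_]; _+_; _*_; -_; _-_; 0ℤ; 1ℤ)
  import Data.Integer.Properties as ℤₚ
  open import Data.Integer.Tactic.RingSolver using (solve-∀)
  open import Data.Empty using (⊥-elim)
  open import Data.Product using (Σ; _×_; _,_; proj₁; proj₂)
  open import Data.Sum using (_⊎_; inj₁; inj₂)
  open import Function using (_∘_)
  open import Relation.Binary using (tri<; tri≈; tri>)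
  open import Relation.Binary.PropositionalEquality
  open import Relation.Nullary using (Dec; yes; no)

  -- det n only reads the leading n × n block of a matrix.
  Matrix : Set
  Matrix = ℕ → ℕ → ℤ

  ∑ : ℕ → (ℕ → ℤ) → ℤ
  ∑ zero f = 0ℤ
  ∑ (suc n) f = f 0 + ∑ n (λ i → f (suc i))

  ∏ : ℕ → (ℕ → ℤ) → ℤ
  ∏ zero f = 1ℤ
  ∏ (suc n) f = f 0 * ∏ n (λ i → f (suc i))

  sign : ℕ → ℤ
  sign zero = 1ℤ
  sign (suc i) = - sign i

  -- ℕ versions of Data.Fin.punchIn and punchOut; punchOut i i is junk.
  punchIn : ℕ → ℕ → ℕ
  punchIn zero r = suc r
  punchIn (suc i) zero = zero
  punchIn (suc i) (suc r) = suc (punchIn i r)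

  punchOut : ℕ → ℕ → ℕ
  punchOut zero zero = zero
  punchOut zero (suc p) = p
  punchOut (suc i) zero = zero
  punchOut (suc i) (suc p) = suc (punchOut i p)

  minor : ℕ → Matrix → Matrix
  minor i A r c = A (punchIn i r) (suc c)

  det : ℕ → Matrix → ℤ
  det zero A = 1ℤ
  det (suc n) A = ∑ (suc n) (λ i → sign i * (A i 0 * det n (minor i A)))

  punchIn-≢ : ∀ i r → punchIn i r ≢ i
  punchIn-≢ zero r ()
  punchIn-≢ (suc i) zero ()
  punchIn-≢ (suc i) (suc r) e = punchIn-≢ i r (ℕₚ.suc-injective e)

  punchIn-injective : ∀ i r s → punchIn i r ≡ punchIn i s → r ≡ s
  punchIn-injective zero r s e = ℕₚ.suc-injective e
  punchIn-injective (suc i) zero zero e = refl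
  punchIn-injective (suc i) (suc r) (suc s) e = cong suc (punchIn-injective i r s (ℕₚ.suc-injective e))

  punchIn-punchOut : ∀ {i p} → i ≢ p → punchIn i (punchOut i p) ≡ p
  punchIn-punchOut {zero} {zero} i≢p = ⊥-elim (i≢p refl)
  punchIn-punchOut {zero} {suc p} i≢p = refl
  punchIn-punchOut {suc i} {zero} i≢p = refl
  punchIn-punchOut {suc i} {suc p} i≢p = cong suc (punchIn-punchOut (i≢p ∘ cong suc))

  punchIn-< : ∀ i {r n} → r <ℕ n → punchIn i r <ℕ suc n
  punchIn-< zero r<n = s≤s r<n
  punchIn-< (suc i) {zero} r<n = s≤s z≤n
  punchIn-< (suc i) {suc r} (s≤s r<n) = s≤s (punchIn-< i r<n)

  punchOut-< : ∀ {i p m} → i <ℕ suc m → p <ℕ suc m → i ≢ p → punchOut i p <ℕ m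
  punchOut-< {zero} {zero} _ _ i≢p = ⊥-elim (i≢p refl)
  punchOut-< {zero} {suc p} _ (s≤s p<m) _ = p<m
  punchOut-< {suc i} {zero} {suc m} _ _ _ = s≤s z≤n
  punchOut-< {suc i} {zero} {zero} (s≤s ()) _ _
  punchOut-< {suc i} {suc p} {suc m} (s≤s i<m) (s≤s p<m) i≢p = s≤s (punchOut-< i<m p<m (i≢p ∘ cong suc))
  punchOut-< {suc i} {suc p} {zero} (s≤s ()) _ _

  punchIn-below : ∀ {i r} → r <ℕ i → punchIn i r ≡ r
  punchIn-below {suc i} {zero} _ = refl
  punchIn-below {suc i} {suc r} (s≤s r<i) = cong suc (punchIn-below r<i)

  punchIn-≢-punchOut : ∀ {i p r} → i ≢ p → r ≢ punchOut i p → punchIn i r ≢ p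
  punchIn-≢-punchOut {i} {p} {r} i≢p r≢ e =
    r≢ (punchIn-injective i r (punchOut i p) (trans e (sym (punchIn-punchOut i≢p))))

  punchOut-suc : ∀ {i p} → i ≢ p → i ≢ suc p → punchOut i (suc p) ≡ suc (punchOut i p)
  punchOut-suc {zero} {zero} i≢p _ = ⊥-elim (i≢p refl)
  punchOut-suc {zero} {suc p} _ _ = refl
  punchOut-suc {suc zero} {zero} _ i≢sp = ⊥-elim (i≢sp refl)
  punchOut-suc {suc (suc i)} {zero} _ _ = refl
  punchOut-suc {suc i} {suc p} i≢p i≢sp = cong suc (punchOut-suc (i≢p ∘ cong suc) (i≢sp ∘ cong suc))

  punchIn-adjacent : ∀ p r → punchIn p r ≡ punchIn (suc p) r ⊎ (punchIn p r ≡ suc p × punchIn (suc p) r ≡ p)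
  punchIn-adjacent zero zero = inj₂ (refl , refl)
  punchIn-adjacent zero (suc r) = inj₁ refl
  punchIn-adjacent (suc p) zero = inj₁ refl
  punchIn-adjacent (suc p) (suc r) with punchIn-adjacent p r
  ... | inj₁ e = inj₁ (cong suc e)
  ... | inj₂ (e , e′) = inj₂ (cong suc e , cong suc e′)

  ∑-cong : ∀ n {f g} → (∀ i → i <ℕ n → f i ≡ g i) → ∑ n f ≡ ∑ n g
  ∑-cong zero h = refl
  ∑-cong (suc n) h = cong₂ _+_ (h 0 (s≤s z≤n)) (∑-cong n (λ i i<n → h (suc i) (s≤s i<n)))

  ∑-+ : ∀ n f g → ∑ n (λ i → f i + g i) ≡ ∑ n f + ∑ n g
  ∑-+ zero f g = refl
  ∑-+ (suc n) f g rewrite ∑-+ n (f ∘ suc) (g ∘ suc) = lemma (f 0) (g 0) (∑ n (f ∘ suc)) (∑ n (g ∘ suc))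
    where
    lemma : ∀ a b c d → a + b + (c + d) ≡ a + c + (b + d)
    lemma = solve-∀

  ∑-* : ∀ n s f → ∑ n (λ i → s * f i) ≡ s * ∑ n f
  ∑-* zero s f = sym (ℤₚ.*-zeroʳ s)
  ∑-* (suc n) s f rewrite ∑-* n s (f ∘ suc) = sym (ℤₚ.*-distribˡ-+ s (f 0) _)

  ∑-neg : ∀ n f → ∑ n (λ i → - f i) ≡ - ∑ n f
  ∑-neg zero f = refl
  ∑-neg (suc n) f rewrite ∑-neg n (f ∘ suc) = sym (ℤₚ.neg-distrib-+ (f 0) _)

  ∑-single : ∀ n f p → p <ℕ n → (∀ i → i <ℕ n → i ≢ p → f i ≡ 0ℤ) → ∑ n f ≡ f p
  ∑-single (suc n) f zero _ h =
    trans (cong (λ z → f 0 + z) (∑-cong n (λ i i<n → h (suc i) (s≤s i<n) (λ ())))) (trans (cong (λ z → f 0 + z) (∑-zero n)) (ℤₚ.+-identityʳ (f 0)))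
    where
    ∑-zero : ∀ n → ∑ n (λ _ → 0ℤ) ≡ 0ℤ
    ∑-zero zero = refl
    ∑-zero (suc n) = trans (ℤₚ.+-identityˡ _) (∑-zero n)
  ∑-single (suc n) f (suc p) (s≤s p<n) h =
    trans (cong (_+ ∑ n (f ∘ suc)) (h 0 (s≤s z≤n) (λ ())))
      (trans (ℤₚ.+-identityˡ _) (∑-single n (f ∘ suc) p p<n (λ i i<n i≢p → h (suc i) (s≤s i<n) (i≢p ∘ ℕₚ.suc-injective))))

  ∑-swapAdjacent : ∀ n p f g → suc p <ℕ n →
    (∀ i → i <ℕ n → i ≢ p → i ≢ suc p → f i ≡ g i) → f p ≡ g (suc p) → f (suc p) ≡ g p → ∑ n f ≡ ∑ n g
  ∑-swapAdjacent (suc (suc n)) zero f g _ same fp fsp =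
    trans (cong₂ (λ x y → x + y) fp (cong₂ _+_ fsp (∑-cong n (λ i i<n → same (suc (suc i)) (s≤s (s≤s i<n)) (λ ()) (λ ())))))
      (exchange (g 1) (g 0) _)
    where
    exchange : ∀ a b r → a + (b + r) ≡ b + (a + r)
    exchange = solve-∀
  ∑-swapAdjacent (suc n) (suc p) f g (s≤s sp<n) same fp fsp =
    cong₂ _+_ (same 0 (s≤s z≤n) (λ ()) (λ ()))
      (∑-swapAdjacent n p (f ∘ suc) (g ∘ suc) sp<n
        (λ i i<n i≢p i≢sp → same (suc i) (s≤s i<n) (i≢p ∘ ℕₚ.suc-injective) (i≢sp ∘ ℕₚ.suc-injective)) fp fsp)

  ∏-cong : ∀ n {f g} → (∀ i → i <ℕ n → f i ≡ g i) → ∏ n f ≡ ∏ n g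
  ∏-cong zero h = refl
  ∏-cong (suc n) h = cong₂ _*_ (h 0 (s≤s z≤n)) (∏-cong n (λ i i<n → h (suc i) (s≤s i<n)))

  ∏-∷ʳ : ∀ n f → ∏ (suc n) f ≡ ∏ n f * f n
  ∏-∷ʳ zero f = trans (ℤₚ.*-identityʳ (f 0)) (sym (ℤₚ.*-identityˡ (f 0)))
  ∏-∷ʳ (suc n) f rewrite ∏-∷ʳ n (f ∘ suc) = sym (ℤₚ.*-assoc (f 0) _ _)

  ∏-neg : ∀ n f → ∏ n (λ r → - f r) ≡ sign n * ∏ n f
  ∏-neg zero f = refl
  ∏-neg (suc n) f rewrite ∏-neg n (f ∘ suc) = exchange (f 0) (sign n) (∏ n (f ∘ suc))
    where
    exchange : ∀ a s p → - a * (s * p) ≡ - s * (a * p)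
    exchange = solve-∀

  ∏-one : ∀ n → ∏ n (λ _ → 1ℤ) ≡ 1ℤ
  ∏-one zero = refl
  ∏-one (suc n) = trans (ℤₚ.*-identityˡ _) (∏-one n)

  ∏-punchIn : ∀ n s i → i <ℕ suc n → s i * ∏ n (s ∘ punchIn i) ≡ ∏ (suc n) s
  ∏-punchIn n s zero _ = refl
  ∏-punchIn zero s (suc i) (s≤s ())
  ∏-punchIn (suc n) s (suc i) (s≤s i<sn) =
    trans (exchange (s (suc i)) (s 0) _) (cong (s 0 *_) (∏-punchIn n (s ∘ suc) i i<sn))
    where
    exchange : ∀ a b r → a * (b * r) ≡ b * (a * r)
    exchange = solve-∀

  det-cong : ∀ n {A B} → (∀ i c → i <ℕ n → c <ℕ n → A i c ≡ B i c) → det n A ≡ det n B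
  det-cong zero h = refl
  det-cong (suc n) {A} {B} h = ∑-cong (suc n) λ i i<n →
    cong₂ (λ x y → sign i * (x * y)) (h i 0 i<n (s≤s z≤n))
      (det-cong n (λ r c r<n c<n → h (punchIn i r) (suc c) (punchIn-< i r<n) (s≤s c<n)))

  det-+-row : ∀ n A B C p → p <ℕ n →
    (∀ i → i ≢ p → ∀ c → A i c ≡ C i c) → (∀ i → i ≢ p → ∀ c → B i c ≡ C i c) →
    (∀ c → C p c ≡ A p c + B p c) → det n C ≡ det n A + det n B
  det-+-row (suc n) A B C p p<n hA hB hC = trans (∑-cong (suc n) term) (∑-+ (suc n) (term′ A) (term′ B))
    where
    term′ : Matrix → ℕ → ℤ
    term′ M i = sign i * (M i 0 * det n (minor i M))
    term : ∀ i → i <ℕ suc n → term′ C i ≡ term′ A i + term′ B i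
    term i i<n with i ℕ.≟ p
    ... | yes refl =
      trans (cong (λ x → sign i * (x * det n (minor i C))) (hC 0))
        (trans (distrib (sign i) (A i 0) (B i 0) _)
          (cong₂ (λ x y → sign i * (A i 0 * x) + sign i * (B i 0 * y))
            (det-cong n (λ r c _ _ → sym (hA (punchIn i r) (punchIn-≢ i r) (suc c))))
            (det-cong n (λ r c _ _ → sym (hB (punchIn i r) (punchIn-≢ i r) (suc c))))))
      where
      distrib : ∀ s a b d → s * ((a + b) * d) ≡ s * (a * d) + s * (b * d)
      distrib = solve-∀
    ... | no i≢p =
      trans (cong (λ x → sign i * (C i 0 * x))
              (det-+-row n (minor i A) (minor i B) (minor i C) (punchOut i p) (punchOut-< i<n p<n i≢p)
                (λ r r≢ c → hA (punchIn i r) (punchIn-≢-punchOut i≢p r≢) (suc c))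
                (λ r r≢ c → hB (punchIn i r) (punchIn-≢-punchOut i≢p r≢) (suc c))
                (λ c → subst (λ j → C j (suc c) ≡ A j (suc c) + B j (suc c)) (sym (punchIn-punchOut i≢p)) (hC (suc c)))))
        (trans (distrib (sign i) (C i 0) _ _)
          (cong₂ (λ x y → sign i * (x * det n (minor i A)) + sign i * (y * det n (minor i B))) (sym (hA i i≢p 0)) (sym (hB i i≢p 0))))
      where
      distrib : ∀ s a x y → s * (a * (x + y)) ≡ s * (a * x) + s * (a * y)
      distrib = solve-∀

  det-*-row : ∀ n A C p s → p <ℕ n →
    (∀ i → i ≢ p → ∀ c → A i c ≡ C i c) → (∀ c → C p c ≡ s * A p c) → det n C ≡ s * det n A
  det-*-row (suc n) A C p s p<n hA hC = trans (∑-cong (suc n) term) (∑-* (suc n) s (λ i → sign i * (A i 0 * det n (minor i A))))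
    where
    term : ∀ i → i <ℕ suc n → sign i * (C i 0 * det n (minor i C)) ≡ s * (sign i * (A i 0 * det n (minor i A)))
    term i i<n with i ℕ.≟ p
    ... | yes refl =
      trans (cong₂ (λ x y → sign i * (x * y)) (hC 0) (det-cong n (λ r c _ _ → sym (hA (punchIn i r) (punchIn-≢ i r) (suc c)))))
        (exchange (sign i) s (A i 0) _)
      where
      exchange : ∀ g s a d → g * ((s * a) * d) ≡ s * (g * (a * d))
      exchange = solve-∀
    ... | no i≢p =
      trans (cong₂ (λ x y → sign i * (x * y)) (sym (hA i i≢p 0))
              (det-*-row n (minor i A) (minor i C) (punchOut i p) s (punchOut-< i<n p<n i≢p)
                (λ r r≢ c → hA (punchIn i r) (punchIn-≢-punchOut i≢p r≢) (suc c))
                (λ c → subst (λ j → C j (suc c) ≡ s * A j (suc c)) (sym (punchIn-punchOut i≢p)) (hC (suc c)))))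
        (exchange (sign i) s (A i 0) _)
      where
      exchange : ∀ g s a d → g * (a * (s * d)) ≡ s * (g * (a * d))
      exchange = solve-∀

  det-zeroRow : ∀ n A p → p <ℕ n → (∀ c → A p c ≡ 0ℤ) → det n A ≡ 0ℤ
  det-zeroRow n A p p<n h = det-*-row n A A p 0ℤ p<n (λ _ _ _ → refl) h

  minor-adjacent : ∀ A B p → (∀ i → i ≢ p → i ≢ suc p → ∀ c → B i c ≡ A i c) → (∀ c → B (suc p) c ≡ A p c) →
    ∀ r c → minor p B r c ≡ minor (suc p) A r c
  minor-adjacent A B p others at-suc r c with punchIn-adjacent p r
  ... | inj₁ e =
    trans (others (punchIn p r) (punchIn-≢ p r) (λ e′ → punchIn-≢ (suc p) r (trans (sym e) e′)) (suc c)) (cong (λ j → A j (suc c)) e)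
  ... | inj₂ (e , e′) = trans (cong (λ j → B j (suc c)) e) (trans (at-suc (suc c)) (cong (λ j → A j (suc c)) (sym e′)))

  -- Terms of the expansion not involving the two rows change sign by induction, the other two trade places.
  det-swap : ∀ n A B p → suc p <ℕ n →
    (∀ i → i ≢ p → i ≢ suc p → ∀ c → B i c ≡ A i c) → (∀ c → B p c ≡ A (suc p) c) → (∀ c → B (suc p) c ≡ A p c) →
    det n B ≡ - det n A
  det-swap (suc n) A B p sp<n others at-p at-suc =
    trans (∑-swapAdjacent (suc n) p (term B) (λ i → - term A i) sp<n other-term p-term suc-p-term) (∑-neg (suc n) (term A))
    where
    term : Matrix → ℕ → ℤ
    term M i = sign i * (M i 0 * det n (minor i M))
    p-term : term B p ≡ - term A (suc p)
    p-term = trans (cong₂ (λ x y → sign p * (x * y)) (at-p 0) (det-cong n (λ r c _ _ → minor-adjacent A B p others at-suc r c)))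
      (flip (sign p) (A (suc p) 0) _)
      where
      flip : ∀ s a d → s * (a * d) ≡ - (- s * (a * d))
      flip = solve-∀
    suc-p-term : term B (suc p) ≡ - term A p
    suc-p-term =
      trans (cong₂ (λ x y → - sign p * (x * y)) (at-suc 0)
              (sym (det-cong n (λ r c _ _ → minor-adjacent B A p (λ i i≢p i≢sp c → sym (others i i≢p i≢sp c)) (sym ∘ at-p) r c))))
        (flip (sign p) (A p 0) _)
      where
      flip : ∀ s a d → - s * (a * d) ≡ - (s * (a * d))
      flip = solve-∀
    other-term : ∀ i → i <ℕ suc n → i ≢ p → i ≢ suc p → term B i ≡ - term A i
    other-term i i<n i≢p i≢sp =
      trans (cong₂ (λ x y → sign i * (x * y)) (others i i≢p i≢sp 0)
              (det-swap n (minor i A) (minor i B) q (subst (_<ℕ n) q+1 (punchOut-< i<n sp<n i≢sp))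
                (λ r r≢q r≢q+1 c → others (punchIn i r) (punchIn-≢-punchOut i≢p r≢q)
                                     (punchIn-≢-punchOut i≢sp (λ e → r≢q+1 (trans e q+1))) (suc c))
                (λ c → trans (cong (λ j → B j (suc c)) (punchIn-punchOut i≢p))
                         (trans (at-p (suc c)) (cong (λ j → A j (suc c)) (sym at-q+1))))
                (λ c → trans (cong (λ j → B j (suc c)) at-q+1)
                         (trans (at-suc (suc c)) (cong (λ j → A j (suc c)) (sym (punchIn-punchOut i≢p)))))))
        (flip (sign i) (A i 0) _)
      where
      q : ℕ
      q = punchOut i p
      q+1 : punchOut i (suc p) ≡ suc q
      q+1 = punchOut-suc i≢p i≢sp
      at-q+1 : punchIn i (suc q) ≡ suc p
      at-q+1 = trans (cong (punchIn i) (sym q+1)) (punchIn-punchOut i≢sp)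
      flip : ∀ s a d → s * (a * - d) ≡ - (s * (a * d))
      flip = solve-∀

  self-negating : ∀ a → a ≡ - a → a ≡ 0ℤ
  self-negating (+ zero) _ = refl
  self-negating +[1+ n ] ()
  self-negating -[1+ n ] ()

  _[_]≔_ : Matrix → ℕ → (ℕ → ℤ) → Matrix
  (A [ q ]≔ v) i c with i ℕ.≟ q
  ... | yes _ = v c
  ... | no _ = A i c

  []≔-at : ∀ A q v c → (A [ q ]≔ v) q c ≡ v c
  []≔-at A q v c with q ℕ.≟ q
  ... | yes _ = refl
  ... | no q≢q = ⊥-elim (q≢q refl)

  []≔-off : ∀ A q v i c → i ≢ q → (A [ q ]≔ v) i c ≡ A i c
  []≔-off A q v i c i≢q with i ℕ.≟ q
  ... | yes i≡q = ⊥-elim (i≢q i≡q)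
  ... | no _ = refl

  det-equalRows< : ∀ n A p q → p <ℕ q → q <ℕ n → (∀ c → A p c ≡ A q c) → det n A ≡ 0ℤ
  det-equalRows< n A p (suc q) (s≤s p≤q) sq<n h with p ℕ.≟ q
  ... | yes refl = self-negating _ (det-swap n A A p sq<n (λ _ _ _ _ → refl) h (sym ∘ h))
  ... | no p≢q =
    trans (sym (ℤₚ.neg-involutive _))
      (cong -_ (trans (sym (det-swap n A B q sq<n others at-q at-suc))
        (det-equalRows< n B p q (ℕₚ.≤∧≢⇒< p≤q p≢q) (ℕₚ.<-trans (ℕₚ.n<1+n q) sq<n)
          (λ c → trans (others p p≢q p≢sq c) (trans (h c) (sym (at-q c)))))))
    where
    B : Matrix
    B = (A [ q ]≔ A (suc q)) [ suc q ]≔ A q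
    p≢sq : p ≢ suc q
    p≢sq p≡sq = ℕₚ.<-irrefl p≡sq (s≤s p≤q)
    others : ∀ i → i ≢ q → i ≢ suc q → ∀ c → B i c ≡ A i c
    others i i≢q i≢sq c = trans ([]≔-off (A [ q ]≔ A (suc q)) (suc q) (A q) i c i≢sq) ([]≔-off A q (A (suc q)) i c i≢q)
    at-q : ∀ c → B q c ≡ A (suc q) c
    at-q c = trans ([]≔-off (A [ q ]≔ A (suc q)) (suc q) (A q) q c (λ q≡sq → ℕₚ.1+n≢n (sym q≡sq))) ([]≔-at A q (A (suc q)) c)
    at-suc : ∀ c → B (suc q) c ≡ A q c
    at-suc c = []≔-at (A [ q ]≔ A (suc q)) (suc q) (A q) c

  det-equalRows : ∀ n A p q → p <ℕ n → q <ℕ n → p ≢ q → (∀ c → A p c ≡ A q c) → det n A ≡ 0ℤ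
  det-equalRows n A p q p<n q<n p≢q h with ℕₚ.<-cmp p q
  ... | tri< p<q _ _ = det-equalRows< n A p q p<q q<n h
  ... | tri≈ _ p≡q _ = ⊥-elim (p≢q p≡q)
  ... | tri> _ _ q<p = det-equalRows< n A q p q<p p<n (sym ∘ h)

  addRow : Matrix → ℕ → ℤ → ℕ → Matrix
  addRow A q s p = A [ q ]≔ (λ c → A q c + s * A p c)

  addRow-off : ∀ A q s p i c → i ≢ q → addRow A q s p i c ≡ A i c
  addRow-off A q s p = []≔-off A q (λ c → A q c + s * A p c)

  det-addRow : ∀ n A q s p → q <ℕ n → p <ℕ n → p ≢ q → det n (addRow A q s p) ≡ det n A
  det-addRow n A q s p q<n p<n p≢q =
    begin
      det n (addRow A q s p)
    ≡⟨ det-+-row n A (A [ q ]≔ (λ c → s * A p c)) (addRow A q s p) q q<n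
         (λ i i≢q c → sym ([]≔-off A q _ i c i≢q)) (λ i i≢q c → trans ([]≔-off A q _ i c i≢q) (sym ([]≔-off A q _ i c i≢q)))
         (λ c → trans ([]≔-at A q _ c) (cong (λ z → A q c + z) (sym ([]≔-at A q _ c)))) ⟩
      det n A + det n (A [ q ]≔ (λ c → s * A p c))
    ≡⟨ cong (λ z → det n A + z) (det-*-row n (A [ q ]≔ A p) _ q s q<n
         (λ i i≢q c → trans ([]≔-off A q _ i c i≢q) (sym ([]≔-off A q _ i c i≢q)))
         (λ c → trans ([]≔-at A q _ c) (cong (s *_) (sym ([]≔-at A q _ c))))) ⟩
      det n A + s * det n (A [ q ]≔ A p)
    ≡⟨ cong (λ x → det n A + s * x)
         (det-equalRows n _ p q p<n q<n p≢q (λ c → trans ([]≔-off A q _ p c p≢q) (sym ([]≔-at A q _ c)))) ⟩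
      det n A + s * 0ℤ
    ≡⟨ trans (cong (λ z → det n A + z) (ℤₚ.*-zeroʳ s)) (ℤₚ.+-identityʳ _) ⟩
      det n A
    ∎
    where open ≡-Reasoning

  det-pivot-last : ∀ n A → (∀ i → i <ℕ n → A i 0 ≡ 0ℤ) → det (suc n) A ≡ sign n * (A n 0 * det n (λ r c → A r (suc c)))
  det-pivot-last n A h =
    trans (∑-single (suc n) _ n ℕₚ.≤-refl vanish)
      (cong (λ x → sign n * (A n 0 * x)) (det-cong n (λ r c r<n _ → cong (λ j → A j (suc c)) (punchIn-below r<n))))
    where
    vanish : ∀ i → i <ℕ suc n → i ≢ n → sign i * (A i 0 * det n (minor i A)) ≡ 0ℤ
    vanish i i<sn i≢n rewrite h i (ℕₚ.≤∧≢⇒< (ℕₚ.≤-pred i<sn) i≢n) = ℤₚ.*-zeroʳ (sign i)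

  det-pivot-first : ∀ n A → (∀ i → i <ℕ n → A (suc i) 0 ≡ 0ℤ) → det (suc n) A ≡ A 0 0 * det n (λ r c → A (suc r) (suc c))
  det-pivot-first n A h = trans (∑-single (suc n) _ 0 (s≤s z≤n) vanish) (ℤₚ.*-identityˡ _)
    where
    vanish : ∀ i → i <ℕ suc n → i ≢ 0 → sign i * (A i 0 * det n (minor i A)) ≡ 0ℤ
    vanish zero _ i≢0 = ⊥-elim (i≢0 refl)
    vanish (suc i) (s≤s i<n) _ rewrite h i i<n = ℤₚ.*-zeroʳ (sign (suc i))

  det-scaleRows : ∀ n s A → det n (λ i c → s i * A i c) ≡ ∏ n s * det n A
  det-scaleRows zero s A = sym (ℤₚ.*-identityˡ _)
  det-scaleRows (suc n) s A = trans (∑-cong (suc n) term) (∑-* (suc n) (∏ (suc n) s) (λ i → sign i * (A i 0 * det n (minor i A))))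
    where
    term : ∀ i → i <ℕ suc n →
      sign i * ((s i * A i 0) * det n (minor i (λ i c → s i * A i c))) ≡ ∏ (suc n) s * (sign i * (A i 0 * det n (minor i A)))
    term i i<n rewrite det-scaleRows n (s ∘ punchIn i) (minor i A) | sym (∏-punchIn n s i i<n) =
      regroup (sign i) (s i) (A i 0) _ _
      where
      regroup : ∀ g s a p d → g * ((s * a) * (p * d)) ≡ (s * p) * (g * (a * d))
      regroup = solve-∀

  det-scaleColumns : ∀ n s A → det n (λ i c → A i c * s c) ≡ ∏ n s * det n A
  det-scaleColumns zero s A = refl
  det-scaleColumns (suc n) s A = trans (∑-cong (suc n) term) (∑-* (suc n) (∏ (suc n) s) (λ i → sign i * (A i 0 * det n (minor i A))))
    where
    term : ∀ i → i <ℕ suc n →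
      sign i * ((A i 0 * s 0) * det n (minor i (λ i c → A i c * s c))) ≡ ∏ (suc n) s * (sign i * (A i 0 * det n (minor i A)))
    term i _ rewrite det-scaleColumns n (s ∘ suc) (minor i A) = regroup (sign i) (A i 0) (s 0) _ _
      where
      regroup : ∀ g a s₀ p d → g * ((a * s₀) * (p * d)) ≡ (s₀ * p) * (g * (a * d))
      regroup = solve-∀

  differenceRows : ℕ → Matrix → Matrix
  differenceRows zero R = R
  differenceRows (suc q) R = addRow (differenceRows q R) q (- 1ℤ) (suc q)

  differenceRows-below : ∀ q R i c → q ≤ℕ i → differenceRows q R i c ≡ R i c
  differenceRows-below zero R i c _ = refl
  differenceRows-below (suc q) R i c q<i =
    trans (addRow-off (differenceRows q R) q (- 1ℤ) (suc q) i c (λ i≡q → ℕₚ.<-irrefl (sym i≡q) q<i)) (differenceRows-below q R i c (ℕₚ.<⇒≤ q<i))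

  differenceRows-above : ∀ q R i c → i <ℕ q → differenceRows q R i c ≡ R i c - R (suc i) c
  differenceRows-above (suc q) R i c i<sq = case (i ℕ.≟ q)
    where
    minus : ∀ a b → a + - 1ℤ * b ≡ a - b
    minus = solve-∀
    case : Dec (i ≡ q) → differenceRows (suc q) R i c ≡ R i c - R (suc i) c
    case (yes refl) =
      trans ([]≔-at (differenceRows i R) i _ c)
        (trans (cong₂ (λ x y → x + - 1ℤ * y) (differenceRows-below i R i c ℕₚ.≤-refl) (differenceRows-below i R (suc i) c (ℕₚ.n≤1+n i)))
          (minus (R i c) (R (suc i) c)))
    case (no i≢q) = trans (addRow-off (differenceRows q R) q (- 1ℤ) (suc q) i c i≢q) (differenceRows-above q R i c (ℕₚ.≤∧≢⇒< (ℕₚ.≤-pred i<sq) i≢q))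

  det-differenceRows : ∀ n q R → q ≤ℕ n → det (suc n) (differenceRows q R) ≡ det (suc n) R
  det-differenceRows n zero R _ = refl
  det-differenceRows n (suc q) R q<n =
    trans (det-addRow (suc n) (differenceRows q R) q (- 1ℤ) (suc q) (ℕₚ.<-trans (ℕₚ.n<1+n q) (s≤s q<n)) (s≤s q<n) ℕₚ.1+n≢n)
      (det-differenceRows n q R (ℕₚ.<⇒≤ q<n))

  subtractRow0 : ℕ → Matrix → Matrix
  subtractRow0 zero A = A
  subtractRow0 (suc q) A = addRow (subtractRow0 q A) (suc q) (- 1ℤ) 0

  subtractRow0-row0 : ∀ q A c → subtractRow0 q A 0 c ≡ A 0 c
  subtractRow0-row0 zero A c = refl
  subtractRow0-row0 (suc q) A c = trans (addRow-off (subtractRow0 q A) (suc q) (- 1ℤ) 0 0 c (λ ())) (subtractRow0-row0 q A c)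

  subtractRow0-below : ∀ q A i c → q <ℕ i → subtractRow0 q A i c ≡ A i c
  subtractRow0-below zero A i c _ = refl
  subtractRow0-below (suc q) A i c sq<i =
    trans (addRow-off (subtractRow0 q A) (suc q) (- 1ℤ) 0 i c (λ i≡sq → ℕₚ.<-irrefl (sym i≡sq) sq<i)) (subtractRow0-below q A i c (ℕₚ.<-trans (ℕₚ.n<1+n q) sq<i))

  subtractRow0-above : ∀ q A i c → 0 <ℕ i → i ≤ℕ q → subtractRow0 q A i c ≡ A i c - A 0 c
  subtractRow0-above zero A (suc i) c _ ()
  subtractRow0-above (suc q) A i c 0<i i≤sq = case (i ℕ.≟ suc q)
    where
    minus : ∀ a b → a + - 1ℤ * b ≡ a - b
    minus = solve-∀
    case : Dec (i ≡ suc q) → subtractRow0 (suc q) A i c ≡ A i c - A 0 c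
    case (yes refl) =
      trans ([]≔-at (subtractRow0 q A) i _ c)
        (trans (cong₂ (λ x y → x + - 1ℤ * y) (subtractRow0-below q A i c ℕₚ.≤-refl) (subtractRow0-row0 q A c)) (minus (A i c) (A 0 c)))
    case (no i≢sq) = trans (addRow-off (subtractRow0 q A) (suc q) (- 1ℤ) 0 i c i≢sq) (subtractRow0-above q A i c 0<i (ℕₚ.≤-pred (ℕₚ.≤∧≢⇒< i≤sq i≢sq)))

  det-subtractRow0 : ∀ n q A → q ≤ℕ n → det (suc n) (subtractRow0 q A) ≡ det (suc n) A
  det-subtractRow0 n zero A _ = refl
  det-subtractRow0 n (suc q) A q<n =
    trans (det-addRow (suc n) (subtractRow0 q A) (suc q) (- 1ℤ) 0 (s≤s q<n) (s≤s z≤n) (λ ())) (det-subtractRow0 n q A (ℕₚ.<⇒≤ q<n))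

  -- Polynomial functions of degree d with leading coefficient c, described through their divided differences.
  PolyOfDegree : ℕ → ℤ → (ℤ → ℤ) → Set
  PolyOfDegree zero c f = ∀ x → f x ≡ c
  PolyOfDegree (suc d) c f = ∀ a → Σ (ℤ → ℤ) λ g → PolyOfDegree d c g × (∀ x → f x - f a ≡ (x - a) * g x)

  PolyOfDegree-+const : ∀ d c f k → PolyOfDegree (suc d) c f → PolyOfDegree (suc d) c (λ x → f x + k)
  PolyOfDegree-+const d c f k poly a =
    let (g , g-poly , g-quot) = poly a in g , g-poly , λ x → trans (cancel (f x) (f a) k) (g-quot x)
    where
    cancel : ∀ u v k → (u + k) - (v + k) ≡ u - v
    cancel = solve-∀

  PolyOfDegree-*linear : ∀ d c f b → PolyOfDegree d c f → PolyOfDegree (suc d) c (λ x → f x * (x - b))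
  PolyOfDegree-*linear zero c f b const a =
    (λ _ → c) , (λ _ → refl) , λ x → trans (cong₂ (λ u v → u * (x - b) - v * (a - b)) (const x) (const a)) (factor c x a b)
    where
    factor : ∀ c x a b → c * (x - b) - c * (a - b) ≡ (x - a) * c
    factor = solve-∀
  PolyOfDegree-*linear (suc d) c f b poly a =
    let (g , g-poly , g-quot) = poly a in
    (λ x → g x * (x - b) + f a) ,
    PolyOfDegree-+const d c (λ x → g x * (x - b)) (f a) (PolyOfDegree-*linear d c g b g-poly) ,
    λ x → trans (split (f x) (f a) x a b)
            (trans (cong (λ z → z * (x - b) + (x - a) * f a) (g-quot x)) (factor x a (g x) b (f a)))
    where
    split : ∀ fx fa x a b → fx * (x - b) - fa * (a - b) ≡ (fx - fa) * (x - b) + (x - a) * fa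
    split = solve-∀
    factor : ∀ x a gx b fa → (x - a) * gx * (x - b) + (x - a) * fa ≡ (x - a) * (gx * (x - b) + fa)
    factor = solve-∀

  vandermonde : ℕ → (ℕ → ℤ) → ℤ
  vandermonde zero x = 1ℤ
  vandermonde (suc n) x = ∏ n (λ r → x (suc r) - x 0) * vandermonde n (x ∘ suc)

  det-poly≡vandermonde : ∀ n (x : ℕ → ℤ) (p : ℕ → ℤ → ℤ) (c : ℕ → ℤ) → (∀ j → PolyOfDegree j (c j) (p j)) →
    det n (λ i j → p j (x i)) ≡ ∏ n c * vandermonde n x
  det-poly≡vandermonde zero x p c poly = refl
  det-poly≡vandermonde (suc m) x p c poly =
    begin
      det (suc m) A
    ≡⟨ sym (det-subtractRow0 m m A ℕₚ.≤-refl) ⟩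
      det (suc m) (subtractRow0 m A)
    ≡⟨ det-pivot-first m (subtractRow0 m A) column0 ⟩
      subtractRow0 m A 0 0 * det m (λ r j → subtractRow0 m A (suc r) (suc j))
    ≡⟨ cong₂ _*_ (trans (subtractRow0-row0 m A 0) (poly 0 (x 0))) (det-cong m (λ r j r<m _ → quotient-row r j r<m)) ⟩
      c 0 * det m (λ r j → (x (suc r) - x 0) * q j (x (suc r)))
    ≡⟨ cong (c 0 *_) (det-scaleRows m (λ r → x (suc r) - x 0) (λ r j → q j (x (suc r)))) ⟩
      c 0 * (∏ m (λ r → x (suc r) - x 0) * det m (λ r j → q j (x (suc r))))
    ≡⟨ cong (λ z → c 0 * (∏ m (λ r → x (suc r) - x 0) * z))
         (det-poly≡vandermonde m (x ∘ suc) q (c ∘ suc) (λ j → proj₁ (proj₂ (poly (suc j) (x 0))))) ⟩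
      c 0 * (∏ m (λ r → x (suc r) - x 0) * (∏ m (c ∘ suc) * vandermonde m (x ∘ suc)))
    ≡⟨ regroup (c 0) (∏ m (λ r → x (suc r) - x 0)) (∏ m (c ∘ suc)) (vandermonde m (x ∘ suc)) ⟩
      ∏ (suc m) c * vandermonde (suc m) x
    ∎
    where
    open ≡-Reasoning
    A : Matrix
    A i j = p j (x i)
    q : ℕ → ℤ → ℤ
    q j = proj₁ (poly (suc j) (x 0))
    column0 : ∀ i → i <ℕ m → subtractRow0 m A (suc i) 0 ≡ 0ℤ
    column0 i i<m = trans (subtractRow0-above m A (suc i) 0 (s≤s z≤n) i<m)
      (trans (cong₂ _-_ (poly 0 (x (suc i))) (poly 0 (x 0))) (ℤₚ.+-inverseʳ (c 0)))
    quotient-row : ∀ r j → r <ℕ m → subtractRow0 m A (suc r) (suc j) ≡ (x (suc r) - x 0) * q j (x (suc r))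
    quotient-row r j r<m = trans (subtractRow0-above m A (suc r) (suc j) (s≤s z≤n) r<m) (proj₂ (proj₂ (poly (suc j) (x 0))) (x (suc r)))
    regroup : ∀ a b c d → a * (b * (c * d)) ≡ (a * c) * (b * d)
    regroup = solve-∀

module ListSums where

  open import Data.Nat as ℕ using (ℕ; zero; suc; z≤n; s≤s; _≤_; _<_) renaming (_+_ to _+ℕ_)
  import Data.Nat.Properties as ℕₚ
  open import Data.Integer using (ℤ; +_; _+_; _*_; 0ℤ)
  import Data.Integer.Properties as ℤₚ
  open import Data.List using (List; []; _∷_; _++_; map; concatMap)
  open import Data.List.Membership.Propositional using (_∈_)
  open import Data.List.Relation.Unary.Any using (here; there)
  open import Data.List.Relation.Unary.AllPairs using ([]; _∷_)
  import Data.List.Relation.Unary.All as All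
  open import Data.List.Relation.Unary.Unique.Propositional using (Unique)
  open import Data.Product using (_×_; _,_; proj₁)
  open import Data.Empty using (⊥-elim)
  open import Relation.Binary.PropositionalEquality
  open import Relation.Nullary using (yes; no)

  sumℕ : {A : Set} → List A → (A → ℕ) → ℕ
  sumℕ [] f = 0
  sumℕ (x ∷ xs) f = f x +ℕ sumℕ xs f

  sumℤ : {A : Set} → List A → (A → ℤ) → ℤ
  sumℤ [] f = 0ℤ
  sumℤ (x ∷ xs) f = f x + sumℤ xs f

  module _ {A : Set} where

    sumℤ-pos : ∀ (xs : List A) f → sumℤ xs (λ x → + f x) ≡ + sumℕ xs f
    sumℤ-pos [] f = refl
    sumℤ-pos (x ∷ xs) f = trans (cong (λ z → + f x + z) (sumℤ-pos xs f)) (sym (ℤₚ.pos-+ (f x) (sumℕ xs f)))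

    sumℕ-cong∈ : ∀ (xs : List A) {f g} → (∀ x → x ∈ xs → f x ≡ g x) → sumℕ xs f ≡ sumℕ xs g
    sumℕ-cong∈ [] h = refl
    sumℕ-cong∈ (x ∷ xs) h = cong₂ _+ℕ_ (h x (here refl)) (sumℕ-cong∈ xs (λ y y∈xs → h y (there y∈xs)))

    sumℤ-cong∈ : ∀ (xs : List A) {f g} → (∀ x → x ∈ xs → f x ≡ g x) → sumℤ xs f ≡ sumℤ xs g
    sumℤ-cong∈ [] h = refl
    sumℤ-cong∈ (x ∷ xs) h = cong₂ _+_ (h x (here refl)) (sumℤ-cong∈ xs (λ y y∈xs → h y (there y∈xs)))

    sumℤ-++ : ∀ (xs ys : List A) f → sumℤ (xs ++ ys) f ≡ sumℤ xs f + sumℤ ys f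
    sumℤ-++ [] ys f = sym (ℤₚ.+-identityˡ _)
    sumℤ-++ (x ∷ xs) ys f = trans (cong (λ z → f x + z) (sumℤ-++ xs ys f)) (sym (ℤₚ.+-assoc (f x) _ _))

    sumℤ-* : ∀ (xs : List A) s f → sumℤ xs (λ x → s * f x) ≡ s * sumℤ xs f
    sumℤ-* [] s f = sym (ℤₚ.*-zeroʳ s)
    sumℤ-* (x ∷ xs) s f = trans (cong (λ z → s * f x + z) (sumℤ-* xs s f)) (sym (ℤₚ.*-distribˡ-+ s (f x) _))

  module _ {A B : Set} where

    sumℤ-map : ∀ (xs : List A) (g : A → B) f → sumℤ (map g xs) f ≡ sumℤ xs (λ x → f (g x))
    sumℤ-map [] g f = refl
    sumℤ-map (x ∷ xs) g f = cong (λ z → f (g x) + z) (sumℤ-map xs g f)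

    sumℤ-concatMap : ∀ (xs : List A) (g : A → List B) f → sumℤ (concatMap g xs) f ≡ sumℤ xs (λ x → sumℤ (g x) f)
    sumℤ-concatMap [] g f = refl
    sumℤ-concatMap (x ∷ xs) g f = trans (sumℤ-++ (g x) _ f) (cong (λ z → sumℤ (g x) f + z) (sumℤ-concatMap xs g f))

  range : ℕ → ℕ → List ℕ
  range a zero = []
  range a (suc len) = a ∷ range (suc a) len

  ∈-range⁻ : ∀ a len {m} → m ∈ range a len → a ≤ m × m < a +ℕ len
  ∈-range⁻ a (suc len) (here refl) = ℕₚ.≤-refl , ℕₚ.m<m+n a (s≤s z≤n)
  ∈-range⁻ a (suc len) {m} (there m∈) =
    let (a<m , m<) = ∈-range⁻ (suc a) len m∈ in ℕₚ.<⇒≤ a<m , subst (m <_) (sym (ℕₚ.+-suc a len)) m<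

  ∈-range⁺ : ∀ a len {m} → a ≤ m → m < a +ℕ len → m ∈ range a len
  ∈-range⁺ a zero a≤m m< = ⊥-elim (ℕₚ.<-irrefl refl (ℕₚ.≤-trans (subst (_ <_) (ℕₚ.+-identityʳ a) m<) a≤m))
  ∈-range⁺ a (suc len) {m} a≤m m< with a ℕ.≟ m
  ... | yes refl = here refl
  ... | no a≢m = there (∈-range⁺ (suc a) len (ℕₚ.≤∧≢⇒< a≤m a≢m) (subst (m <_) (ℕₚ.+-suc a len) m<))

  Unique-range : ∀ a len → Unique (range a len)
  Unique-range a zero = []
  Unique-range a (suc len) =
    All.tabulate (λ m∈ a≡m → ℕₚ.<-irrefl a≡m (proj₁ (∈-range⁻ (suc a) len m∈))) ∷ Unique-range (suc a) len

module Binomial where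

  open import Data.Nat as ℕ using (ℕ; zero; suc; _!) renaming (_+_ to _+ℕ_; _*_ to _*ℕ_)
  import Data.Nat.Properties as ℕₚ
  import Data.Nat.Tactic.RingSolver as ℕ-Solver
  open import Data.Integer using (ℤ; +_; _+_; _*_; _-_; 1ℤ)
  import Data.Integer.Properties as ℤₚ
  open import Data.Integer.Tactic.RingSolver using (solve-∀)
  open import Relation.Binary.PropositionalEquality
  open Determinant using (PolyOfDegree; PolyOfDegree-*linear)
  open ListSums using (sumℕ; range)

  -- Pascal's rule as the definition: Data.Nat.Combinatorics._C_ is defined through division.
  binomial : ℕ → ℕ → ℕ
  binomial n zero = 1
  binomial zero (suc k) = 0
  binomial (suc n) (suc k) = binomial n k +ℕ binomial n (suc k)

  fallingFactorial : ℕ → ℤ → ℤ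
  fallingFactorial zero x = 1ℤ
  fallingFactorial (suc j) x = fallingFactorial j x * (x - + j)

  fallingFactorial-poly : ∀ j → PolyOfDegree j 1ℤ (fallingFactorial j)
  fallingFactorial-poly zero x = refl
  fallingFactorial-poly (suc j) = PolyOfDegree-*linear j 1ℤ (fallingFactorial j) (+ j) (fallingFactorial-poly j)

  -- (j + 1) C(m, j + 1) = (m - j) C(m, j), with the subtraction moved to the other side.
  suc-*-binomial : ∀ m j → suc j *ℕ binomial m (suc j) +ℕ j *ℕ binomial m j ≡ m *ℕ binomial m j
  suc-*-binomial zero zero = refl
  suc-*-binomial zero (suc j) = trans (cong (_+ℕ suc j *ℕ 0) (ℕₚ.*-zeroʳ (suc (suc j)))) (ℕₚ.*-zeroʳ (suc j))
  suc-*-binomial (suc m) zero = trans (normalise (binomial m 1)) (cong (λ x → suc x *ℕ 1) (binomial-1 m))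
    where
    binomial-1 : ∀ m → binomial m 1 ≡ m
    binomial-1 zero = refl
    binomial-1 (suc m) = cong suc (binomial-1 m)
    normalise : ∀ x → 1 *ℕ suc x +ℕ 0 *ℕ 1 ≡ suc x *ℕ 1
    normalise = ℕ-Solver.solve-∀
  suc-*-binomial (suc m) (suc j) =
    begin
      suc (suc j) *ℕ (b +ℕ c) +ℕ suc j *ℕ (a +ℕ b)
    ≡⟨ regroup₁ j a b c ⟩
      (suc (suc j) *ℕ c +ℕ suc j *ℕ b) +ℕ (suc j *ℕ a +ℕ suc (suc j) *ℕ b)
    ≡⟨ cong (_+ℕ (suc j *ℕ a +ℕ suc (suc j) *ℕ b)) (suc-*-binomial m (suc j)) ⟩
      m *ℕ b +ℕ (suc j *ℕ a +ℕ suc (suc j) *ℕ b)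
    ≡⟨ regroup₂ m j a b ⟩
      m *ℕ b +ℕ a +ℕ b +ℕ (suc j *ℕ b +ℕ j *ℕ a)
    ≡⟨ cong (m *ℕ b +ℕ a +ℕ b +ℕ_) (suc-*-binomial m j) ⟩
      m *ℕ b +ℕ a +ℕ b +ℕ m *ℕ a
    ≡⟨ regroup₃ m a b ⟩
      suc m *ℕ (a +ℕ b)
    ∎
    where
    open ≡-Reasoning
    a b c : ℕ
    a = binomial m j
    b = binomial m (suc j)
    c = binomial m (suc (suc j))
    regroup₁ : ∀ j a b c → suc (suc j) *ℕ (b +ℕ c) +ℕ suc j *ℕ (a +ℕ b) ≡ (suc (suc j) *ℕ c +ℕ suc j *ℕ b) +ℕ (suc j *ℕ a +ℕ suc (suc j) *ℕ b)
    regroup₁ = ℕ-Solver.solve-∀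
    regroup₂ : ∀ m j a b → m *ℕ b +ℕ (suc j *ℕ a +ℕ suc (suc j) *ℕ b) ≡ m *ℕ b +ℕ a +ℕ b +ℕ (suc j *ℕ b +ℕ j *ℕ a)
    regroup₂ = ℕ-Solver.solve-∀
    regroup₃ : ∀ m a b → m *ℕ b +ℕ a +ℕ b +ℕ m *ℕ a ≡ suc m *ℕ (a +ℕ b)
    regroup₃ = ℕ-Solver.solve-∀

  fallingFactorial-binomial : ∀ j m → fallingFactorial j (+ m) ≡ + (j ! *ℕ binomial m j)
  fallingFactorial-binomial zero m = refl
  fallingFactorial-binomial (suc j) m =
    begin
      fallingFactorial j (+ m) * (+ m - + j)
    ≡⟨ cong (_* (+ m - + j)) (trans (fallingFactorial-binomial j m) (ℤₚ.pos-* (j !) a)) ⟩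
      + (j !) * + a * (+ m - + j)
    ≡⟨ expand (+ (j !)) (+ a) (+ m) (+ j) ⟩
      + (j !) * (+ m * + a - + j * + a)
    ≡⟨ cong (λ z → + (j !) * (z - + j * + a)) absorption ⟩
      + (j !) * (+ (suc j) * + b + + j * + a - + j * + a)
    ≡⟨ cancel (+ (j !)) (+ a) (+ b) (+ j) (+ (suc j)) ⟩
      + (suc j) * + (j !) * + b
    ≡⟨ sym (trans (ℤₚ.pos-* (suc j *ℕ j !) b) (cong (_* + b) (ℤₚ.pos-* (suc j) (j !)))) ⟩
      + (suc j ! *ℕ b)
    ∎
    where
    open ≡-Reasoning
    a b : ℕ
    a = binomial m j
    b = binomial m (suc j)
    absorption : + m * + a ≡ + (suc j) * + b + + j * + a
    absorption =
      trans (sym (ℤₚ.pos-* m a))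
        (trans (cong +_ (sym (suc-*-binomial m j)))
          (trans (ℤₚ.pos-+ (suc j *ℕ b) (j *ℕ a)) (cong₂ _+_ (ℤₚ.pos-* (suc j) b) (ℤₚ.pos-* j a))))
    expand : ∀ f a m j → f * a * (m - j) ≡ f * (m * a - j * a)
    expand = solve-∀
    cancel : ∀ f a b j sj → f * (sj * b + j * a - j * a) ≡ sj * f * b
    cancel = solve-∀

  hockey-stick : ∀ len a c → sumℕ (range a len) (λ m → binomial m c) +ℕ binomial a (suc c) ≡ binomial (a +ℕ len) (suc c)
  hockey-stick zero a c = cong (λ z → binomial z (suc c)) (sym (ℕₚ.+-identityʳ a))
  hockey-stick (suc len) a c =
    begin
      binomial a c +ℕ sumℕ (range (suc a) len) (λ m → binomial m c) +ℕ binomial a (suc c)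
    ≡⟨ regroup (binomial a c) (sumℕ (range (suc a) len) (λ m → binomial m c)) (binomial a (suc c)) ⟩
      sumℕ (range (suc a) len) (λ m → binomial m c) +ℕ binomial (suc a) (suc c)
    ≡⟨ hockey-stick len (suc a) c ⟩
      binomial (suc a +ℕ len) (suc c)
    ≡⟨ cong (λ z → binomial z (suc c)) (sym (ℕₚ.+-suc a len)) ⟩
      binomial (a +ℕ suc len) (suc c)
    ∎
    where
    open ≡-Reasoning
    regroup : ∀ x s y → x +ℕ s +ℕ y ≡ s +ℕ (x +ℕ y)
    regroup = ℕ-Solver.solve-∀

module Enumeration where

  open import Data.Bool using (Bool; true; false; T)
  open import Data.Bool.Properties using (T-∧)
  open import Data.Nat as ℕ using (ℕ; zero; suc; z≤n; s≤s; _+_; _≤_)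
  import Data.Nat.Properties as ℕₚ
  open import Data.List using (List; []; _∷_; _++_; [_]; map; concatMap; length; filterᵇ; replicate; zip)
  import Data.List.Properties as Listₚ
  open import Data.List.Membership.Propositional using (_∈_; find; lose)
  open import Data.List.Membership.Propositional.Properties
    using (∈-map⁺; ∈-map⁻; ∈-++⁺ˡ; ∈-++⁺ʳ; ∈-++⁻; ∈-∃++; ∈-filter⁺; ∈-filter⁻; ∈-concatMap⁺; ∈-concatMap⁻; ∈-upTo⁺; ∈-upTo⁻)
  open import Data.List.Relation.Binary.Pointwise using (Pointwise; []; _∷_)
  open import Data.List.Relation.Binary.Subset.Propositional using (_⊆_)
  open import Data.List.Relation.Unary.All as All using (All; []; _∷_)
  open import Data.List.Relation.Unary.AllPairs using ([]; _∷_)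
  open import Data.List.Relation.Unary.Any using (here; there)
  open import Data.List.Relation.Unary.Unique.Propositional using (Unique)
  import Data.List.Relation.Unary.Unique.Propositional.Properties as Uniqueₚ
  open import Data.Product using (_×_; _,_; proj₁; proj₂)
  open import Data.Product.Properties using (≡-dec)
  open import Data.Sum using (inj₁; inj₂)
  open import Data.Empty using (⊥-elim)
  open import Function using (_∘_; Equivalence)
  open import Relation.Binary.PropositionalEquality hiding ([_])
  open import Relation.Nullary using (Dec; yes; no)
  open import Relation.Nullary.Decidable using (T?)
  open import Defs using (Cell; count; allAssign; allᵇ; allPairs; range1)
  open ListSums using (sumℕ)

  module _ {A : Set} (p : A → Bool) where

    count-++ : ∀ xs ys → count p (xs ++ ys) ≡ count p xs + count p ys
    count-++ [] ys = refl
    count-++ (x ∷ xs) ys with p x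
    ... | true = cong suc (count-++ xs ys)
    ... | false = count-++ xs ys

    count≡length-filter : ∀ xs → count p xs ≡ length (filterᵇ p xs)
    count≡length-filter [] = refl
    count≡length-filter (x ∷ xs) with p x
    ... | true = cong suc (count≡length-filter xs)
    ... | false = count≡length-filter xs

    count-cong∈ : ∀ {q} xs → (∀ x → x ∈ xs → p x ≡ q x) → count p xs ≡ count q xs
    count-cong∈ [] h = refl
    count-cong∈ {q} (x ∷ xs) h rewrite h x (here refl) with q x
    ... | true = cong suc (count-cong∈ xs (λ y y∈ → h y (there y∈)))
    ... | false = count-cong∈ xs (λ y y∈ → h y (there y∈))

  module _ {A B : Set} (p : B → Bool) where

    count-map : ∀ (f : A → B) xs → count p (map f xs) ≡ count (p ∘ f) xs
    count-map f [] = refl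
    count-map f (x ∷ xs) with p (f x)
    ... | true = cong suc (count-map f xs)
    ... | false = count-map f xs

    count-concatMap : ∀ (f : A → List B) xs → count p (concatMap f xs) ≡ sumℕ xs (λ x → count p (f x))
    count-concatMap f [] = refl
    count-concatMap f (x ∷ xs) = trans (count-++ p (f x) (concatMap f xs)) (cong (count p (f x) +_) (count-concatMap f xs))

  module _ {A : Set} where

    Unique-length-≤ : ∀ {xs ys : List A} → Unique xs → xs ⊆ ys → length xs ≤ length ys
    Unique-length-≤ {[]} _ _ = z≤n
    Unique-length-≤ {x ∷ xs} (x∉xs ∷ u) xs⊆ys with ∈-∃++ (xs⊆ys (here refl))
    ... | ys₁ , ys₂ , refl =
      subst (suc (length xs) ≤_) (sym (Listₚ.length-++-sucʳ ys₁ x ys₂))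
        (s≤s (Unique-length-≤ u λ {z} z∈xs → remove (xs⊆ys (there z∈xs)) (λ z≡x → All.lookup x∉xs z∈xs (sym z≡x))))
      where
      remove : ∀ {z} → z ∈ ys₁ ++ x ∷ ys₂ → z ≢ x → z ∈ ys₁ ++ ys₂
      remove z∈ z≢x with ∈-++⁻ ys₁ z∈
      ... | inj₁ z∈ys₁ = ∈-++⁺ˡ z∈ys₁
      ... | inj₂ (here z≡x) = ⊥-elim (z≢x z≡x)
      ... | inj₂ (there z∈ys₂) = ∈-++⁺ʳ ys₁ z∈ys₂

  module _ {A B : Set} where

    Unique-map-injectiveOn : ∀ (f : A → B) {xs} → (∀ {x y} → x ∈ xs → y ∈ xs → f x ≡ f y → x ≡ y) → Unique xs → Unique (map f xs)
    Unique-map-injectiveOn f injective [] = []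
    Unique-map-injectiveOn f {x ∷ xs} injective (x∉xs ∷ u) =
      All.tabulate (λ fy∈ fx≡ → let (y , y∈xs , fy≡) = ∈-map⁻ f fy∈ in
                     All.lookup x∉xs y∈xs (injective (here refl) (there y∈xs) (trans fx≡ fy≡))) ∷
      Unique-map-injectiveOn f (λ x∈ y∈ → injective (there x∈) (there y∈)) u

    Unique-concatMap : ∀ (f : A → List B) {xs} → Unique xs → (∀ {x} → x ∈ xs → Unique (f x)) →
      (∀ {x x′ z} → z ∈ f x → z ∈ f x′ → x ≡ x′) → Unique (concatMap f xs)
    Unique-concatMap f [] _ _ = []
    Unique-concatMap f {x ∷ xs} (x∉xs ∷ u) unique-f separated =
      Uniqueₚ.++⁺ (unique-f (here refl)) (Unique-concatMap f u (unique-f ∘ there) separated)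
        λ (z∈fx , z∈rest) → let (x′ , x′∈xs , z∈fx′) = find (∈-concatMap⁻ f z∈rest) in
          All.lookup x∉xs x′∈xs (separated z∈fx z∈fx′)

    count-≤ : ∀ (xs : List A) (ys : List B) p q (f : A → B) → Unique xs →
      (∀ {x} → x ∈ xs → T (p x) → f x ∈ ys × T (q (f x))) →
      (∀ {x y} → x ∈ xs → y ∈ xs → T (p x) → T (p y) → f x ≡ f y → x ≡ y) →
      count p xs ≤ count q ys
    count-≤ xs ys p q f u maps-to injective =
      subst₂ _≤_ (trans (Listₚ.length-map f (filterᵇ p xs)) (sym (count≡length-filter p xs))) (sym (count≡length-filter q ys))
        (Unique-length-≤ (Unique-map-injectiveOn f injective′ (Uniqueₚ.filter⁺ (T? ∘ p) u)) image⊆)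
      where
      injective′ : ∀ {x y} → x ∈ filterᵇ p xs → y ∈ filterᵇ p xs → f x ≡ f y → x ≡ y
      injective′ x∈ y∈ = let (x∈xs , px) = ∈-filter⁻ (T? ∘ p) x∈ ; (y∈xs , py) = ∈-filter⁻ (T? ∘ p) y∈ in injective x∈xs y∈xs px py
      image⊆ : map f (filterᵇ p xs) ⊆ filterᵇ q ys
      image⊆ z∈ = let (x , x∈ , z≡) = ∈-map⁻ f z∈ ; (x∈xs , px) = ∈-filter⁻ (T? ∘ p) x∈ ; (fx∈ys , qfx) = maps-to x∈xs px in
        subst (_∈ filterᵇ q ys) (sym z≡) (∈-filter⁺ (T? ∘ q) fx∈ys qfx)

  module _ {A B : Set} where

    count-bijection : ∀ (xs : List A) (ys : List B) p q (f : A → B) (g : B → A) → Unique xs → Unique ys →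
      (∀ {x} → x ∈ xs → T (p x) → f x ∈ ys × T (q (f x)) × g (f x) ≡ x) →
      (∀ {y} → y ∈ ys → T (q y) → g y ∈ xs × T (p (g y)) × f (g y) ≡ y) →
      count p xs ≡ count q ys
    count-bijection xs ys p q f g uxs uys forward backward =
      ℕₚ.≤-antisym
        (count-≤ xs ys p q f uxs (λ x∈ px → let (fx∈ , qfx , _) = forward x∈ px in fx∈ , qfx)
          (λ x∈ y∈ px py fx≡fy → trans (sym (proj₂ (proj₂ (forward x∈ px)))) (trans (cong g fx≡fy) (proj₂ (proj₂ (forward y∈ py))))))
        (count-≤ ys xs q p g uys (λ y∈ qy → let (gy∈ , pgy , _) = backward y∈ qy in gy∈ , pgy)
          (λ x∈ y∈ qx qy gx≡gy → trans (sym (proj₂ (proj₂ (backward x∈ qx)))) (trans (cong f gx≡gy) (proj₂ (proj₂ (backward y∈ qy))))))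

  module _ {A : Set} where

    choices : List (List A) → List (List A)
    choices [] = [ [] ]
    choices (xs ∷ xss) = concatMap (λ x → map (x ∷_) (choices xss)) xs

    ∈-choices⁻ : ∀ xss {ys} → ys ∈ choices xss → Pointwise _∈_ ys xss
    ∈-choices⁻ [] (here refl) = []
    ∈-choices⁻ (xs ∷ xss) ys∈ =
      let (x , x∈xs , ys∈′) = find (∈-concatMap⁻ (λ x → map (x ∷_) (choices xss)) ys∈)
          (zs , zs∈ , ys≡) = ∈-map⁻ (x ∷_) ys∈′
      in subst (λ ys → Pointwise _∈_ ys (xs ∷ xss)) (sym ys≡) (x∈xs ∷ ∈-choices⁻ xss zs∈)

    ∈-choices⁺ : ∀ {xss ys} → Pointwise _∈_ ys xss → ys ∈ choices xss
    ∈-choices⁺ [] = here refl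
    ∈-choices⁺ {xs ∷ xss} {y ∷ ys} (y∈xs ∷ ys∈) = ∈-concatMap⁺ (λ x → map (x ∷_) (choices xss)) (lose y∈xs (∈-map⁺ (y ∷_) (∈-choices⁺ ys∈)))

    Unique-choices : ∀ {xss} → All Unique xss → Unique (choices xss)
    Unique-choices [] = [] ∷ []
    Unique-choices {xs ∷ xss} (u ∷ us) =
      Unique-concatMap (λ x → map (x ∷_) (choices xss)) u
        (λ _ → Uniqueₚ.map⁺ Listₚ.∷-injectiveʳ (Unique-choices us))
        (λ {x} {x′} z∈ z∈′ → let (_ , _ , z≡) = ∈-map⁻ (x ∷_) z∈ ; (_ , _ , z≡′) = ∈-map⁻ (x′ ∷_) z∈′ in
          Listₚ.∷-injectiveˡ (trans (sym z≡) z≡′))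

  allAssign≡choices : ∀ m (vals : List ℕ) → allAssign m vals ≡ choices (replicate m vals)
  allAssign≡choices zero vals = refl
  allAssign≡choices (suc m) vals = cong (λ xss → concatMap (λ v → map (v ∷_) xss) vals) (allAssign≡choices m vals)

  ∈-allAssign⁻ : ∀ m vals {xs} → xs ∈ allAssign m vals → length xs ≡ m × All (_∈ vals) xs
  ∈-allAssign⁻ m vals xs∈ = entries m (∈-choices⁻ (replicate m vals) (subst (_ ∈_) (allAssign≡choices m vals) xs∈))
    where
    entries : ∀ m {xs} → Pointwise _∈_ xs (replicate m vals) → length xs ≡ m × All (_∈ vals) xs
    entries zero [] = refl , []
    entries (suc m) (v∈ ∷ xs∈) = let (len , all) = entries m xs∈ in cong suc len , v∈ ∷ all

  ∈-allAssign⁺ : ∀ m vals {xs} → length xs ≡ m → All (_∈ vals) xs → xs ∈ allAssign m vals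
  ∈-allAssign⁺ m vals len all = subst (_ ∈_) (sym (allAssign≡choices m vals)) (∈-choices⁺ (entries m len all))
    where
    entries : ∀ m {xs} → length xs ≡ m → All (_∈ vals) xs → Pointwise _∈_ xs (replicate m vals)
    entries zero {[]} _ [] = []
    entries (suc m) {v ∷ xs} len (v∈ ∷ all) = v∈ ∷ entries m (ℕₚ.suc-injective len) all

  Unique-allAssign : ∀ m {vals} → Unique vals → Unique (allAssign m vals)
  Unique-allAssign m {vals} u = subst Unique (sym (allAssign≡choices m vals)) (Unique-choices (replicated m))
    where
    replicated : ∀ m → All Unique (replicate m vals)
    replicated zero = []
    replicated (suc m) = u ∷ replicated m

  ∈-range1⁻ : ∀ {n v} → v ∈ range1 n → 1 ≤ v × v ≤ n
  ∈-range1⁻ v∈ with ∈-map⁻ suc v∈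
  ... | u , u∈ , refl = s≤s z≤n , ∈-upTo⁻ u∈

  ∈-range1⁺ : ∀ {n v} → 1 ≤ v → v ≤ n → v ∈ range1 n
  ∈-range1⁺ {v = suc v} _ v≤n = ∈-map⁺ suc (∈-upTo⁺ v≤n)

  Unique-range1 : ∀ n → Unique (range1 n)
  Unique-range1 n = Uniqueₚ.map⁺ ℕₚ.suc-injective (Uniqueₚ.upTo⁺ n)

  allᵇ⁻ : ∀ {A : Set} p (xs : List A) → T (allᵇ p xs) → ∀ {x} → x ∈ xs → T (p x)
  allᵇ⁻ p (y ∷ xs) t (here refl) = proj₁ (Equivalence.to T-∧ t)
  allᵇ⁻ p (y ∷ xs) t (there x∈) = allᵇ⁻ p xs (proj₂ (Equivalence.to T-∧ t)) x∈

  allᵇ⁺ : ∀ {A : Set} p (xs : List A) → (∀ {x} → x ∈ xs → T (p x)) → T (allᵇ p xs)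
  allᵇ⁺ p [] h = _
  allᵇ⁺ p (y ∷ xs) h = Equivalence.from T-∧ (h (here refl) , allᵇ⁺ p xs (h ∘ there))

  _≟ᶜ_ : (c d : Cell) → Dec (c ≡ d)
  _≟ᶜ_ = ≡-dec ℕ._≟_ ℕ._≟_

  -- The label of the cell c in a labelling vs listed along the cells C (0 if c is not among them).
  valueAt : List Cell → List ℕ → Cell → ℕ
  valueAt [] _ c = 0
  valueAt (d ∷ C) [] c = 0
  valueAt (d ∷ C) (v ∷ vs) c with d ≟ᶜ c
  ... | yes _ = v
  ... | no _ = valueAt C vs c

  valueAt-here : ∀ d C v vs → valueAt (d ∷ C) (v ∷ vs) d ≡ v
  valueAt-here d C v vs with d ≟ᶜ d
  ... | yes _ = refl
  ... | no d≢d = ⊥-elim (d≢d refl)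

  valueAt-there : ∀ d C v vs {c} → d ≢ c → valueAt (d ∷ C) (v ∷ vs) c ≡ valueAt C vs c
  valueAt-there d C v vs {c} d≢c with d ≟ᶜ c
  ... | yes d≡c = ⊥-elim (d≢c d≡c)
  ... | no _ = refl

  ∈-zip⁻ˡ : ∀ (C : List Cell) (vs : List ℕ) {c v} → (c , v) ∈ zip C vs → c ∈ C
  ∈-zip⁻ˡ (d ∷ C) (w ∷ vs) (here refl) = here refl
  ∈-zip⁻ˡ (d ∷ C) (w ∷ vs) (there cv∈) = there (∈-zip⁻ˡ C vs cv∈)

  ∈-zip-valueAt : ∀ (C : List Cell) (vs : List ℕ) {c v} → Unique C → (c , v) ∈ zip C vs → v ≡ valueAt C vs c
  ∈-zip-valueAt (d ∷ C) (w ∷ vs) _ (here refl) = sym (valueAt-here d C w vs)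
  ∈-zip-valueAt (d ∷ C) (w ∷ vs) (d∉C ∷ u) (there cv∈) =
    trans (∈-zip-valueAt C vs u cv∈) (sym (valueAt-there d C w vs (All.lookup d∉C (∈-zip⁻ˡ C vs cv∈))))

  valueAt-∈-zip : ∀ (C : List Cell) (vs : List ℕ) {c} → length vs ≡ length C → c ∈ C → (c , valueAt C vs c) ∈ zip C vs
  valueAt-∈-zip (d ∷ C) (w ∷ vs) _ (here refl) = here (cong (d ,_) (valueAt-here d C w vs))
  valueAt-∈-zip (d ∷ C) (w ∷ vs) {c} len (there c∈) with d ≟ᶜ c
  ... | yes refl = here refl
  ... | no _ = there (valueAt-∈-zip C vs (ℕₚ.suc-injective len) c∈)

  valueAt-∈ : ∀ (C : List Cell) (vs : List ℕ) {c} → length vs ≡ length C → c ∈ C → valueAt C vs c ∈ vs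
  valueAt-∈ C vs len c∈ = second (valueAt-∈-zip C vs len c∈)
    where
    second : ∀ {C vs c v} → (c , v) ∈ zip C vs → v ∈ vs
    second {_ ∷ _} {_ ∷ _} (here refl) = here refl
    second {_ ∷ _} {_ ∷ _} (there cv∈) = there (second cv∈)

  valueAt-map : ∀ (C : List Cell) (h : Cell → ℕ) {c} → c ∈ C → valueAt C (map h C) c ≡ h c
  valueAt-map (d ∷ C) h (here refl) = valueAt-here d C (h d) (map h C)
  valueAt-map (d ∷ C) h {c} (there c∈) with d ≟ᶜ c
  ... | yes refl = refl
  ... | no _ = valueAt-map C h c∈

  map-valueAt : ∀ (C : List Cell) (vs : List ℕ) → Unique C → length vs ≡ length C → map (valueAt C vs) C ≡ vs
  map-valueAt [] [] _ _ = refl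
  map-valueAt (d ∷ C) (w ∷ vs) (d∉C ∷ u) len =
    cong₂ _∷_ (valueAt-here d C w vs)
      (trans (Listₚ.map-cong-local (All.map (valueAt-there d C w vs) d∉C)) (map-valueAt C vs u (ℕₚ.suc-injective len)))

  allPairs-zip⁻ : ∀ (C : List Cell) (vs : List ℕ) q → length vs ≡ length C → T (allPairs (zip C vs) q) →
    ∀ {c c′} → c ∈ C → c′ ∈ C → T (q (c , valueAt C vs c) (c′ , valueAt C vs c′))
  allPairs-zip⁻ C vs q len t c∈ c′∈ =
    allᵇ⁻ _ (zip C vs) (allᵇ⁻ _ (zip C vs) t (valueAt-∈-zip C vs len c∈)) (valueAt-∈-zip C vs len c′∈)

  allPairs-zip⁺ : ∀ (C : List Cell) (vs : List ℕ) q → Unique C →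
    (∀ {c c′} → c ∈ C → c′ ∈ C → T (q (c , valueAt C vs c) (c′ , valueAt C vs c′))) → T (allPairs (zip C vs) q)
  allPairs-zip⁺ C vs q u h = allᵇ⁺ _ (zip C vs) λ {(c , v)} cv∈ → allᵇ⁺ _ (zip C vs) λ {(c′ , v′)} cv′∈ →
    subst₂ (λ x y → T (q (c , x) (c′ , y))) (sym (∈-zip-valueAt C vs u cv∈)) (sym (∈-zip-valueAt C vs u cv′∈))
      (h (∈-zip⁻ˡ C vs cv∈) (∈-zip⁻ˡ C vs cv′∈))

module Shapes where

  open import Data.Bool using (Bool; true; false; T; _∧_; _∨_; not)
  open import Data.Bool.Properties using (T-∧; T-≡)
  open import Data.Nat as ℕ using (ℕ; zero; suc; z≤n; s≤s; _∸_; _+_; _≤_; _<_; _≥_; _≤ᵇ_; _<ᵇ_; _≡ᵇ_)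
  import Data.Nat.Properties as ℕₚ
  open import Data.List using (List; []; _∷_; _++_; [_]; map; length; replicate; upTo)
  import Data.List.Properties as Listₚ
  open import Data.List.Membership.Propositional using (_∈_)
  open import Data.List.Membership.Propositional.Properties using (∈-map⁺; ∈-map⁻; ∈-++⁺ˡ; ∈-++⁺ʳ; ∈-++⁻)
  open import Data.List.Relation.Unary.Linked using (Linked; []; [-]; _∷_)
  import Data.List.Relation.Unary.AllPairs as AllPairs
  open import Data.List.Relation.Unary.Unique.Propositional using (Unique)
  import Data.List.Relation.Unary.Unique.Propositional.Properties as Uniqueₚ
  open import Data.Product using (_×_; _,_; proj₁; proj₂)
  open import Data.Sum using (_⊎_; inj₁; inj₂)
  open import Data.Empty using (⊥-elim)
  open import Function using (_∘_; Equivalence)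
  open import Relation.Binary.PropositionalEquality hiding ([_])
  open import Relation.Nullary using (Dec; yes; no)
  open import Defs using (Cell; range1; cellsFrom; cells; count; ssytOK)
  open Enumeration using (count-++; ∈-range1⁻; ∈-range1⁺; Unique-range1; valueAt; allPairs-zip⁻; allPairs-zip⁺)

  nth : List ℕ → ℕ → ℕ
  nth [] i = 0
  nth (x ∷ xs) zero = x
  nth (x ∷ xs) (suc i) = nth xs i

  nth-pos⇒< : ∀ (xs : List ℕ) {k} → 1 ≤ nth xs k → k < length xs
  nth-pos⇒< (x ∷ xs) {zero} _ = s≤s z≤n
  nth-pos⇒< (x ∷ xs) {suc k} pos = s≤s (nth-pos⇒< xs pos)

  ≡-by-nth : ∀ (xs ys : List ℕ) → length xs ≡ length ys → (∀ k → k < length xs → nth xs k ≡ nth ys k) → xs ≡ ys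
  ≡-by-nth [] [] _ _ = refl
  ≡-by-nth (x ∷ xs) (y ∷ ys) len h = cong₂ _∷_ (h 0 (s≤s z≤n)) (≡-by-nth xs ys (ℕₚ.suc-injective len) (λ k k< → h (suc k) (s≤s k<)))

  appendLike≡++ : (F : List Cell → List Cell → List Cell) → (∀ ys → F [] ys ≡ ys) →
    (∀ x xs ys → F (x ∷ xs) ys ≡ x ∷ F xs ys) → ∀ xs ys → F xs ys ≡ xs ++ ys
  appendLike≡++ F []-case ∷-case [] ys = []-case ys
  appendLike≡++ F []-case ∷-case (x ∷ xs) ys = trans (∷-case x xs ys) (cong (x ∷_) (appendLike≡++ F []-case ∷-case xs ys))

  -- Defs appends the rows with a local copy of _++_, identified here through its defining equations.
  cellsFrom-∷ : ∀ i r rs → cellsFrom i (r ∷ rs) ≡ map (i ,_) (range1 r) ++ cellsFrom (suc i) rs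
  cellsFrom-∷ i r rs with appendLike≡++ _ (λ _ → refl) (λ _ _ _ → refl) | map (i ,_) (range1 r) | cellsFrom (suc i) rs
  ... | append≡++ | row | rest = append≡++ row rest

  InShapeFrom : ℕ → List ℕ → Cell → Set
  InShapeFrom s λs (a , b) = s ≤ a × 1 ≤ b × b ≤ nth λs (a ∸ s)

  InShape : List ℕ → Cell → Set
  InShape = InShapeFrom 1

  ∸-suc : ∀ {a s} → s < a → a ∸ s ≡ suc (a ∸ suc s)
  ∸-suc {suc a} {zero} _ = refl
  ∸-suc {suc a} {suc s} (s≤s s<a) = ∸-suc s<a

  ∈-cellsFrom⁻ : ∀ s λs {c} → c ∈ cellsFrom s λs → InShapeFrom s λs c
  ∈-cellsFrom⁻ s (r ∷ rs) {a , b} c∈ with ∈-++⁻ (map (s ,_) (range1 r)) (subst ((a , b) ∈_) (cellsFrom-∷ s r rs) c∈)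
  ... | inj₁ c∈row with ∈-map⁻ (s ,_) c∈row
  ...   | j , j∈ , refl = ℕₚ.≤-refl , proj₁ (∈-range1⁻ j∈) , subst (λ z → b ≤ nth (r ∷ rs) z) (sym (ℕₚ.n∸n≡0 s)) (proj₂ (∈-range1⁻ j∈))
  ∈-cellsFrom⁻ s (r ∷ rs) {a , b} c∈ | inj₂ c∈rest =
    let (s<a , 1≤b , b≤) = ∈-cellsFrom⁻ (suc s) rs c∈rest in
    ℕₚ.<⇒≤ s<a , 1≤b , subst (λ z → b ≤ nth (r ∷ rs) z) (sym (∸-suc s<a)) b≤

  ∈-cellsFrom⁺ : ∀ s λs {c} → InShapeFrom s λs c → c ∈ cellsFrom s λs
  ∈-cellsFrom⁺ s [] (_ , 1≤b , b≤0) = ⊥-elim (ℕₚ.<-irrefl refl (ℕₚ.≤-trans 1≤b b≤0))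
  ∈-cellsFrom⁺ s (r ∷ rs) {a , b} (s≤a , 1≤b , b≤) = subst ((a , b) ∈_) (sym (cellsFrom-∷ s r rs)) (split (a ℕ.≟ s))
    where
    split : Dec (a ≡ s) → (a , b) ∈ map (s ,_) (range1 r) ++ cellsFrom (suc s) rs
    split (yes refl) = ∈-++⁺ˡ (∈-map⁺ (s ,_) (∈-range1⁺ 1≤b (subst (λ z → b ≤ nth (r ∷ rs) z) (ℕₚ.n∸n≡0 s) b≤)))
    split (no a≢s) =
      let s<a = ℕₚ.≤∧≢⇒< s≤a (a≢s ∘ sym) in
      ∈-++⁺ʳ (map (s ,_) (range1 r)) (∈-cellsFrom⁺ (suc s) rs (s<a , 1≤b , subst (λ z → b ≤ nth (r ∷ rs) z) (∸-suc s<a) b≤))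

  Unique-cellsFrom : ∀ s λs → Unique (cellsFrom s λs)
  Unique-cellsFrom s [] = AllPairs.[]
  Unique-cellsFrom s (r ∷ rs) = subst Unique (sym (cellsFrom-∷ s r rs))
    (Uniqueₚ.++⁺ (Uniqueₚ.map⁺ (cong proj₂) (Unique-range1 r)) (Unique-cellsFrom (suc s) rs)
      λ {(a , b)} (c∈row , c∈rest) → let (_ , _ , a≡s) = ∈-map⁻ (s ,_) c∈row in
        ℕₚ.<-irrefl (sym (cong proj₁ a≡s)) (proj₁ (∈-cellsFrom⁻ (suc s) rs c∈rest)))

  cellsFrom-++-zeros : ∀ s λs n → cellsFrom s (λs ++ replicate n 0) ≡ cellsFrom s λs
  cellsFrom-++-zeros s [] zero = refl
  cellsFrom-++-zeros s [] (suc n) = trans (cellsFrom-∷ s 0 (replicate n 0)) (cellsFrom-++-zeros (suc s) [] n)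
  cellsFrom-++-zeros s (r ∷ rs) n =
    trans (cellsFrom-∷ s r (rs ++ replicate n 0))
      (trans (cong (map (s ,_) (range1 r) ++_) (cellsFrom-++-zeros (suc s) rs n)) (sym (cellsFrom-∷ s r rs)))

  Decreasing : List ℕ → Set
  Decreasing = Linked _≥_

  nth-suc-≤ : ∀ {λs} → Decreasing λs → ∀ i → nth λs (suc i) ≤ nth λs i
  nth-suc-≤ [] i = z≤n
  nth-suc-≤ [-] i = z≤n
  nth-suc-≤ (b≤a ∷ _) zero = b≤a
  nth-suc-≤ (_ ∷ dec) (suc i) = nth-suc-≤ dec i

  nth-antitone : ∀ {λs} → Decreasing λs → ∀ {a b} → a ≤ b → nth λs b ≤ nth λs a
  nth-antitone {λs} dec {a} a≤b = subst (λ z → nth λs z ≤ nth λs a) (ℕₚ.m+[n∸m]≡n a≤b) (go (_ ∸ a))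
    where
    go : ∀ k → nth λs (a + k) ≤ nth λs a
    go zero = ℕₚ.≤-reflexive (cong (nth λs) (ℕₚ.+-identityʳ a))
    go (suc k) = ℕₚ.≤-trans (subst (λ z → nth λs z ≤ nth λs (a + k)) (sym (ℕₚ.+-suc a k)) (nth-suc-≤ dec (a + k))) (go k)

  InShape-downward : ∀ {λs i j i′ j′} → Decreasing λs → InShape λs (i , j) → 1 ≤ i′ → i′ ≤ i → 1 ≤ j′ → j′ ≤ j → InShape λs (i′ , j′)
  InShape-downward dec (_ , _ , j≤) 1≤i′ i′≤i 1≤j′ j′≤j =
    1≤i′ , 1≤j′ , ℕₚ.≤-trans j′≤j (ℕₚ.≤-trans j≤ (nth-antitone dec (ℕₚ.∸-monoˡ-≤ 1 i′≤i)))

  record IsSSYT (λs : List ℕ) (F : Cell → ℕ) : Set where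
    field
      rows-weak : ∀ {i j j′} → InShape λs (i , j) → InShape λs (i , j′) → j < j′ → F (i , j) ≤ F (i , j′)
      columns-strict : ∀ {i i′ j} → InShape λs (i , j) → InShape λs (i′ , j) → i < i′ → F (i , j) < F (i′ , j)
  open IsSSYT public

  implies⁻ : ∀ {x y} → T (not x ∨ y) → T x → T y
  implies⁻ {true} {true} _ _ = _

  implies⁺ : ∀ {x y} → (T x → T y) → T (not x ∨ y)
  implies⁺ {true} {true} _ = _
  implies⁺ {true} {false} h = h _
  implies⁺ {false} _ = _

  semistandardᵇ : Cell × ℕ → Cell × ℕ → Bool
  semistandardᵇ ((i , j) , a) ((i′ , j′) , b) =
    (not ((i ≡ᵇ i′) ∧ (j <ᵇ j′)) ∨ (a ≤ᵇ b)) ∧ (not ((j ≡ᵇ j′) ∧ (i <ᵇ i′)) ∨ (a <ᵇ b))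

  semistandardᵇ⁻ : ∀ i j i′ j′ a b → T (semistandardᵇ ((i , j) , a) ((i′ , j′) , b)) →
    (i ≡ i′ → j < j′ → a ≤ b) × (j ≡ j′ → i < i′ → a < b)
  semistandardᵇ⁻ i j i′ j′ a b t =
    let (row , col) = Equivalence.to T-∧ t in
    (λ i≡i′ j<j′ → ℕₚ.≤ᵇ⇒≤ a b (implies⁻ row (Equivalence.from T-∧ (ℕₚ.≡⇒≡ᵇ i i′ i≡i′ , ℕₚ.<⇒<ᵇ j<j′)))) ,
    (λ j≡j′ i<i′ → ℕₚ.<ᵇ⇒< a b (implies⁻ col (Equivalence.from T-∧ (ℕₚ.≡⇒≡ᵇ j j′ j≡j′ , ℕₚ.<⇒<ᵇ i<i′))))

  semistandardᵇ⁺ : ∀ i j i′ j′ a b → (i ≡ i′ → j < j′ → a ≤ b) → (j ≡ j′ → i < i′ → a < b) →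
    T (semistandardᵇ ((i , j) , a) ((i′ , j′) , b))
  semistandardᵇ⁺ i j i′ j′ a b row col = Equivalence.from T-∧
    ( implies⁺ (λ t → let (e , lt) = Equivalence.to T-∧ t in ℕₚ.≤⇒≤ᵇ (row (ℕₚ.≡ᵇ⇒≡ i i′ e) (ℕₚ.<ᵇ⇒< j j′ lt)))
    , implies⁺ (λ t → let (e , lt) = Equivalence.to T-∧ t in ℕₚ.<⇒<ᵇ (col (ℕₚ.≡ᵇ⇒≡ j j′ e) (ℕₚ.<ᵇ⇒< i i′ lt))))

  ssytOK⇒IsSSYT : ∀ λs vs → length vs ≡ length (cells λs) → T (ssytOK (Data.List.zip (cells λs) vs)) → IsSSYT λs (valueAt (cells λs) vs)
  ssytOK⇒IsSSYT λs vs len t = record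
    { rows-weak = λ {i} {j} {j′} c c′ j<j′ → proj₁ (pair c c′) refl j<j′
    ; columns-strict = λ {i} {i′} {j} c c′ i<i′ → proj₂ (pair c c′) refl i<i′ }
    where
    pair : ∀ {i j i′ j′} → InShape λs (i , j) → InShape λs (i′ , j′) → _
    pair {i} {j} {i′} {j′} c c′ = semistandardᵇ⁻ i j i′ j′ _ _
      (allPairs-zip⁻ (cells λs) vs semistandardᵇ len t (∈-cellsFrom⁺ 1 λs c) (∈-cellsFrom⁺ 1 λs c′))

  IsSSYT⇒ssytOK : ∀ λs vs → IsSSYT λs (valueAt (cells λs) vs) → T (ssytOK (Data.List.zip (cells λs) vs))
  IsSSYT⇒ssytOK λs vs ssyt = allPairs-zip⁺ (cells λs) vs semistandardᵇ (Unique-cellsFrom 1 λs) λ {(i , j)} {(i′ , j′)} c∈ c′∈ →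
    let c = ∈-cellsFrom⁻ 1 λs c∈ ; c′ = ∈-cellsFrom⁻ 1 λs c′∈ in
    semistandardᵇ⁺ i j i′ j′ (valueAt (cells λs) vs (i , j)) (valueAt (cells λs) vs (i′ , j′)) (λ { refl → rows-weak ssyt c c′ }) (λ { refl → columns-strict ssyt c c′ })

  ssyt-chain : ∀ {λs F} → Decreasing λs → IsSSYT λs F → ∀ {i j i′ j′} → InShape λs (i , j) →
    1 ≤ i′ → i′ ≤ i → 1 ≤ j′ → j′ ≤ j → F (i′ , j′) + (i ∸ i′) ≤ F (i , j)
  ssyt-chain {λs} {F} dec ssyt {i} {j} {i′} {j′} c 1≤i′ i′≤i 1≤j′ j′≤j =
    subst (λ z → F (i′ , j′) + (z ∸ i′) ≤ F (z , j)) (ℕₚ.m+[n∸m]≡n i′≤i)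
      (down (i ∸ i′) (subst (λ z → InShape λs (z , j)) (sym (ℕₚ.m+[n∸m]≡n i′≤i)) c))
    where
    along : InShape λs (i′ , j) → F (i′ , j′) ≤ F (i′ , j)
    along c′ with ℕₚ.m≤n⇒m<n∨m≡n j′≤j
    ... | inj₁ j′<j = rows-weak ssyt (InShape-downward dec c′ 1≤i′ ℕₚ.≤-refl 1≤j′ j′≤j) c′ j′<j
    ... | inj₂ refl = ℕₚ.≤-refl
    down : ∀ k → InShape λs (i′ + k , j) → F (i′ , j′) + (i′ + k ∸ i′) ≤ F (i′ + k , j)
    down zero c′ rewrite ℕₚ.+-identityʳ i′ | ℕₚ.n∸n≡0 i′ | ℕₚ.+-identityʳ (F (i′ , j′)) = along c′
    down (suc k) c′ =
      let above = InShape-downward dec c′ (ℕₚ.≤-trans 1≤i′ (ℕₚ.m≤m+n i′ k)) (ℕₚ.+-monoʳ-≤ i′ (ℕₚ.n≤1+n k)) (proj₁ (proj₂ c′)) ℕₚ.≤-refl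
      in subst (λ z → F (i′ , j′) + z ≤ F (i′ + suc k , j)) (sym (trans (ℕₚ.m+n∸m≡n i′ (suc k)) (cong suc (sym (ℕₚ.m+n∸m≡n i′ k)))))
           (subst (_≤ F (i′ + suc k , j)) (sym (ℕₚ.+-suc (F (i′ , j′)) (i′ + k ∸ i′)))
             (ℕₚ.≤-trans (s≤s (down k above)) (columns-strict ssyt above c′ (ℕₚ.+-monoʳ-< i′ (ℕₚ.n<1+n k)))))

  DownClosed : (ℕ → Bool) → ℕ → Set
  DownClosed P r = ∀ {b b′} → 1 ≤ b → b ≤ b′ → b′ ≤ r → T (P b′) → T (P b)

  range1-∷ʳ : ∀ r → range1 (suc r) ≡ range1 r ++ [ suc r ]
  range1-∷ʳ r = trans (cong (map suc) (sym (Listₚ.upTo-∷ʳ r))) (Listₚ.map-++ suc (upTo r) [ r ])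

  PrefixCount : (ℕ → Bool) → ℕ → ℕ → Set
  PrefixCount P r c = c ≤ r × (∀ {b} → 1 ≤ b → b ≤ r → (T (P b) → b ≤ c) × (b ≤ c → T (P b)))

  count-downClosed : ∀ r P → DownClosed P r → PrefixCount P r (count P (range1 r))
  count-downClosed zero P _ = z≤n , λ 1≤b b≤0 → ⊥-elim (ℕₚ.<-irrefl refl (ℕₚ.≤-trans 1≤b b≤0))
  count-downClosed (suc r) P closed =
    subst (PrefixCount P (suc r)) (sym (trans (cong (count P) (range1-∷ʳ r)) (count-++ P (range1 r) [ suc r ]))) extend
    where
    c : ℕ
    c = count P (range1 r)
    IH : PrefixCount P r c
    IH = count-downClosed r P (λ 1≤b b≤b′ b′≤r → closed 1≤b b≤b′ (ℕₚ.m≤n⇒m≤1+n b′≤r))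
    extend : PrefixCount P (suc r) (c + count P [ suc r ])
    extend with P (suc r) in eq
    ... | true = subst (_≤ suc r) (sym total) ℕₚ.≤-refl , λ {b} 1≤b b≤sr →
        (λ _ → subst (b ≤_) (sym total) b≤sr) , (λ _ → closed 1≤b b≤sr ℕₚ.≤-refl (Equivalence.from T-≡ eq))
      where
      below : ∀ {b} → b ≤ r → b ≤ c
      below {zero} _ = z≤n
      below {suc b} b≤r = proj₁ (proj₂ IH (s≤s z≤n) b≤r) (closed (s≤s z≤n) (ℕₚ.m≤n⇒m≤1+n b≤r) ℕₚ.≤-refl (Equivalence.from T-≡ eq))
      total : c + 1 ≡ suc r
      total = trans (ℕₚ.+-comm c 1) (cong suc (ℕₚ.≤-antisym (proj₁ IH) (below ℕₚ.≤-refl)))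
    ... | false = subst (PrefixCount P (suc r)) (sym (ℕₚ.+-identityʳ c))
        (ℕₚ.m≤n⇒m≤1+n (proj₁ IH) , λ 1≤b b≤sr → earlier-or-last 1≤b (ℕₚ.m≤n⇒m<n∨m≡n b≤sr))
      where
      earlier-or-last : ∀ {b} → 1 ≤ b → b < suc r ⊎ b ≡ suc r → (T (P b) → b ≤ c) × (b ≤ c → T (P b))
      earlier-or-last 1≤b (inj₁ b<sr) = proj₂ IH 1≤b (ℕₚ.≤-pred b<sr)
      earlier-or-last _ (inj₂ refl) =
        (λ t → ⊥-elim (subst T eq t)) , (λ sr≤c → ⊥-elim (ℕₚ.<-irrefl refl (ℕₚ.≤-trans sr≤c (proj₁ IH))))

  count-≤ᵇ : ∀ r m → m ≤ r → count (_≤ᵇ m) (range1 r) ≡ m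
  count-≤ᵇ r m m≤r = ℕₚ.≤-antisym (upper _ ℕₚ.≤-refl) (lower m ℕₚ.≤-refl)
    where
    prefix : PrefixCount (_≤ᵇ m) r (count (_≤ᵇ m) (range1 r))
    prefix = count-downClosed r (_≤ᵇ m) (λ _ b≤b′ _ t → ℕₚ.≤⇒≤ᵇ (ℕₚ.≤-trans b≤b′ (ℕₚ.≤ᵇ⇒≤ _ m t)))
    c : ℕ
    c = count (_≤ᵇ m) (range1 r)
    upper : ∀ b → b ≤ c → b ≤ m
    upper zero _ = z≤n
    upper (suc b) b≤c = ℕₚ.≤ᵇ⇒≤ (suc b) m (proj₂ (proj₂ prefix (s≤s z≤n) (ℕₚ.≤-trans b≤c (proj₁ prefix))) b≤c)
    lower : ∀ b → b ≤ m → b ≤ c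
    lower zero _ = z≤n
    lower (suc b) b≤m = proj₁ (proj₂ prefix (s≤s z≤n) (ℕₚ.≤-trans b≤m m≤r)) (ℕₚ.≤⇒≤ᵇ b≤m)

  IsSSYT-restrict : ∀ {λs μ F G} → (∀ {c} → InShape μ c → InShape λs c) → (∀ {c} → InShape μ c → F c ≡ G c) → IsSSYT λs F → IsSSYT μ G
  IsSSYT-restrict μ⊆λ F≡G ssyt = record
    { rows-weak = λ c c′ j<j′ → subst₂ _≤_ (F≡G c) (F≡G c′) (rows-weak ssyt (μ⊆λ c) (μ⊆λ c′) j<j′)
    ; columns-strict = λ c c′ i<i′ → subst₂ _<_ (F≡G c) (F≡G c′) (columns-strict ssyt (μ⊆λ c) (μ⊆λ c′) i<i′) }

module Interlacing where

  open import Data.Nat as ℕ using (ℕ; zero; suc; z≤n; s≤s; _∸_) renaming (_<_ to _<ℕ_; _≤_ to _≤ℕ_; _+_ to _+ℕ_)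
  import Data.Nat.Properties as ℕₚ
  open import Data.Integer using (ℤ; +_; _+_; _*_; -_; _-_; 0ℤ; 1ℤ)
  import Data.Integer.Properties as ℤₚ
  open import Data.Integer.Tactic.RingSolver using (solve-∀)
  open import Data.List using (List; []; _∷_; map; length)
  open import Data.List.Membership.Propositional using (_∈_)
  open import Data.List.Relation.Binary.Pointwise as Pointwise using (Pointwise; []; _∷_; Pointwise-length)
  open import Data.List.Relation.Unary.All as All using (All; []; _∷_)
  open import Data.List.Relation.Unary.Linked using ([]; [-]; _∷_)
  open import Data.List.Relation.Unary.Unique.Propositional using (Unique)
  open import Data.Product using (_×_; _,_)
  open import Data.Sum using (inj₁; inj₂)
  open import Data.Empty using (⊥-elim)
  open import Relation.Binary.PropositionalEquality
  open import Relation.Nullary using (yes; no)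
  open Determinant
  open Binomial using (binomial; hockey-stick)
  open ListSums using (sumℕ; sumℤ; sumℤ-pos; sumℤ-map; sumℤ-concatMap; sumℤ-cong∈; sumℤ-*; range; ∈-range⁻; ∈-range⁺; Unique-range)
  open Enumeration using (choices; ∈-choices⁻; ∈-choices⁺; Unique-choices)
  open Shapes using (nth; Decreasing; nth-suc-≤)

  interlacingBounds : List ℕ → List (ℕ × ℕ)
  interlacingBounds [] = []
  interlacingBounds (a ∷ []) = []
  interlacingBounds (a ∷ b ∷ r) = (b , a) ∷ interlacingBounds (b ∷ r)

  interval : ℕ × ℕ → List ℕ
  interval (lo , hi) = range lo (suc hi ∸ lo)

  ∈-interval⁻ : ∀ {lo hi m} → m ∈ interval (lo , hi) → lo ≤ℕ m × m ≤ℕ hi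
  ∈-interval⁻ {lo} {hi} {m} m∈ with ∈-range⁻ lo (suc hi ∸ lo) m∈ | ℕₚ.≤-total lo (suc hi)
  ... | lo≤m , m< | inj₁ lo≤sh = lo≤m , ℕₚ.≤-pred (subst (m <ℕ_) (ℕₚ.m+[n∸m]≡n lo≤sh) m<)
  ... | lo≤m , m< | inj₂ sh≤lo =
    ⊥-elim (ℕₚ.<-irrefl refl (ℕₚ.≤-trans (subst (m <ℕ_) (trans (cong (lo +ℕ_) (ℕₚ.m≤n⇒m∸n≡0 sh≤lo)) (ℕₚ.+-identityʳ lo)) m<) lo≤m))

  ∈-interval⁺ : ∀ {lo hi m} → lo ≤ℕ m → m ≤ℕ hi → m ∈ interval (lo , hi)
  ∈-interval⁺ {lo} {hi} {m} lo≤m m≤hi =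
    ∈-range⁺ lo (suc hi ∸ lo) lo≤m (subst (m <ℕ_) (sym (ℕₚ.m+[n∸m]≡n (ℕₚ.m≤n⇒m≤1+n (ℕₚ.≤-trans lo≤m m≤hi)))) (s≤s m≤hi))

  Interlaces : List ℕ → List ℕ → Set
  Interlaces μ λs = Pointwise (λ m (lo , hi) → lo ≤ℕ m × m ≤ℕ hi) μ (interlacingBounds λs)

  interlacing : List ℕ → List (List ℕ)
  interlacing λs = choices (map interval (interlacingBounds λs))

  ∈-interlacing⁻ : ∀ λs {μ} → μ ∈ interlacing λs → Interlaces μ λs
  ∈-interlacing⁻ λs μ∈ = within (∈-choices⁻ _ μ∈)
    where
    within : ∀ {μ bs} → Pointwise _∈_ μ (map interval bs) → Pointwise (λ m (lo , hi) → lo ≤ℕ m × m ≤ℕ hi) μ bs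
    within {bs = []} [] = []
    within {bs = _ ∷ _} (m∈ ∷ μ∈) = ∈-interval⁻ m∈ ∷ within μ∈

  ∈-interlacing⁺ : ∀ λs {μ} → Interlaces μ λs → μ ∈ interlacing λs
  ∈-interlacing⁺ λs μ≺λ = ∈-choices⁺ (within μ≺λ)
    where
    within : ∀ {μ bs} → Pointwise (λ m (lo , hi) → lo ≤ℕ m × m ≤ℕ hi) μ bs → Pointwise _∈_ μ (map interval bs)
    within [] = []
    within ((lo≤m , m≤hi) ∷ μ≺λ) = ∈-interval⁺ lo≤m m≤hi ∷ within μ≺λ

  Unique-interlacing : ∀ λs → Unique (interlacing λs)
  Unique-interlacing λs = Unique-choices (all-unique (interlacingBounds λs))
    where
    all-unique : ∀ bs → All Unique (map interval bs)
    all-unique [] = []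
    all-unique ((lo , hi) ∷ bs) = Unique-range lo (suc hi ∸ lo) ∷ all-unique bs

  length-interlacingBounds : ∀ λs → length (interlacingBounds λs) ≡ length λs ∸ 1
  length-interlacingBounds [] = refl
  length-interlacingBounds (a ∷ []) = refl
  length-interlacingBounds (a ∷ b ∷ r) = cong suc (length-interlacingBounds (b ∷ r))

  Interlaces-length : ∀ {μ λs} → Interlaces μ λs → length μ ≡ length λs ∸ 1
  Interlaces-length {λs = λs} μ≺λ = trans (Pointwise-length μ≺λ) (length-interlacingBounds λs)

  Interlaces-decreasing : ∀ {μ λs} → Interlaces μ λs → Decreasing μ
  Interlaces-decreasing {[]} _ = []
  Interlaces-decreasing {m ∷ []} _ = [-]
  Interlaces-decreasing {m ∷ m′ ∷ μ} {a ∷ b ∷ c ∷ r} ((b≤m , _) ∷ (c≤m′ , m′≤b) ∷ μ≺λ) =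
    ℕₚ.≤-trans m′≤b b≤m ∷ Interlaces-decreasing {m′ ∷ μ} {b ∷ c ∷ r} ((c≤m′ , m′≤b) ∷ μ≺λ)

  Interlaces-nth : ∀ {μ λs} → Interlaces μ λs → ∀ k → suc k <ℕ length λs → nth λs (suc k) ≤ℕ nth μ k × nth μ k ≤ℕ nth λs k
  Interlaces-nth {λs = a ∷ []} [] k (s≤s ())
  Interlaces-nth {m ∷ μ} {a ∷ b ∷ r} (bounds ∷ _) zero _ = bounds
  Interlaces-nth {m ∷ μ} {a ∷ b ∷ r} (_ ∷ μ≺λ) (suc k) (s≤s k<) = Interlaces-nth {μ} {b ∷ r} μ≺λ k k<

  nth⇒Interlaces : ∀ λs μ → length μ ≡ length λs ∸ 1 →
    (∀ k → suc k <ℕ length λs → nth λs (suc k) ≤ℕ nth μ k × nth μ k ≤ℕ nth λs k) → Interlaces μ λs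
  nth⇒Interlaces [] [] _ _ = []
  nth⇒Interlaces (a ∷ []) [] _ _ = []
  nth⇒Interlaces (a ∷ b ∷ r) (m ∷ μ) len h =
    h 0 (s≤s (s≤s z≤n)) ∷ nth⇒Interlaces (b ∷ r) μ (ℕₚ.suc-injective len) (λ k k< → h (suc k) (s≤s k<))

  sumℤ-choices : ∀ xs xss (f : List ℕ → ℤ) → sumℤ (choices (xs ∷ xss)) f ≡ sumℤ xs (λ x → sumℤ (choices xss) (λ μ → f (x ∷ μ)))
  sumℤ-choices xs xss f = trans (sumℤ-concatMap xs _ f) (sumℤ-cong∈ xs (λ x _ → sumℤ-map (choices xss) (x ∷_) f))

  det-sumRow : ∀ n p {X : Set} (xs : List X) (G : X → ℕ → ℤ) (M : (ℕ → ℤ) → Matrix) → p <ℕ n →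
    (∀ v c → M v p c ≡ v c) → (∀ v w i → i ≢ p → ∀ c → M v i c ≡ M w i c) →
    sumℤ xs (λ x → det n (M (G x))) ≡ det n (M (λ c → sumℤ xs (λ x → G x c)))
  det-sumRow n p [] G M p<n row-p other-rows = sym (det-zeroRow n (M (λ _ → 0ℤ)) p p<n (row-p _))
  det-sumRow n p (x ∷ xs) G M p<n row-p other-rows =
    trans (cong (λ z → det n (M (G x)) + z) (det-sumRow n p xs G M p<n row-p other-rows))
      (sym (det-+-row n (M (G x)) (M rest) (M (λ c → G x c + rest c)) p p<n
        (λ i i≢p c → other-rows _ _ i i≢p c) (λ i i≢p c → other-rows _ _ i i≢p c)
        (λ c → trans (row-p _ c) (sym (cong₂ _+_ (row-p _ c) (row-p _ c))))))
    where
    rest : ℕ → ℤ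
    rest c = sumℤ xs (λ x → G x c)

  setRows : (ℕ → ℕ → ℕ → ℤ) → ℕ → List ℕ → Matrix → Matrix
  setRows F p [] A = A
  setRows F p (m ∷ μ) A = setRows F (suc p) μ (A [ p ]≔ F p m)

  setIntervalSums : (ℕ → ℕ → ℕ → ℤ) → ℕ → List (ℕ × ℕ) → Matrix → Matrix
  setIntervalSums F p [] A = A
  setIntervalSums F p (b ∷ bs) A = setIntervalSums F (suc p) bs (A [ p ]≔ (λ c → sumℤ (interval b) (λ m → F p m c)))

  setRows-below : ∀ F μ p A i c → i <ℕ p → setRows F p μ A i c ≡ A i c
  setRows-below F [] p A i c _ = refl
  setRows-below F (m ∷ μ) p A i c i<p =
    trans (setRows-below F μ (suc p) _ i c (ℕₚ.m≤n⇒m≤1+n i<p)) ([]≔-off A p _ i c (λ i≡p → ℕₚ.<-irrefl i≡p i<p))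

  setIntervalSums-below : ∀ F bs p A i c → i <ℕ p → setIntervalSums F p bs A i c ≡ A i c
  setIntervalSums-below F [] p A i c _ = refl
  setIntervalSums-below F (b ∷ bs) p A i c i<p =
    trans (setIntervalSums-below F bs (suc p) _ i c (ℕₚ.m≤n⇒m≤1+n i<p)) ([]≔-off A p _ i c (λ i≡p → ℕₚ.<-irrefl i≡p i<p))

  setIntervalSums-cong : ∀ F bs p A B i → (∀ c → A i c ≡ B i c) → ∀ c → setIntervalSums F p bs A i c ≡ setIntervalSums F p bs B i c
  setIntervalSums-cong F [] p A B i same c = same c
  setIntervalSums-cong F (b ∷ bs) p A B i same c = setIntervalSums-cong F bs (suc p) _ _ i updated c
    where
    updated : ∀ c → (A [ p ]≔ _) i c ≡ (B [ p ]≔ _) i c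
    updated c with i ℕ.≟ p
    ... | yes _ = refl
    ... | no _ = same c

  det-sum-setRows : ∀ F n bs p A → p +ℕ length bs ≤ℕ n →
    sumℤ (choices (map interval bs)) (λ μ → det n (setRows F p μ A)) ≡ det n (setIntervalSums F p bs A)
  det-sum-setRows F n [] p A _ = ℤₚ.+-identityʳ _
  det-sum-setRows F n (b ∷ bs) p A fits =
    trans (sumℤ-choices (interval b) (map interval bs) _)
      (trans (sumℤ-cong∈ (interval b) (λ m _ → det-sum-setRows F n bs (suc p) (A [ p ]≔ F p m) (subst (_≤ℕ n) (ℕₚ.+-suc p (length bs)) fits)))
        (det-sumRow n p (interval b) (F p) M p<n
          (λ v c → trans (setIntervalSums-below F bs (suc p) _ p c (ℕₚ.n<1+n p)) ([]≔-at A p v c))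
          (λ v w i i≢p c → setIntervalSums-cong F bs (suc p) _ _ i (λ c → trans ([]≔-off A p v i c i≢p) (sym ([]≔-off A p w i c i≢p))) c)))
    where
    M : (ℕ → ℤ) → Matrix
    M v = setIntervalSums F (suc p) bs (A [ p ]≔ v)
    p<n : p <ℕ n
    p<n = ℕₚ.<-≤-trans (ℕₚ.m<m+n p (s≤s z≤n)) fits

  setRows-at : ∀ F μ p A k c → k <ℕ length μ → setRows F p μ A (p +ℕ k) c ≡ F (p +ℕ k) (nth μ k) c
  setRows-at F (m ∷ μ) p A zero c _ rewrite ℕₚ.+-identityʳ p =
    trans (setRows-below F μ (suc p) _ p c (ℕₚ.n<1+n p)) ([]≔-at A p (F p m) c)
  setRows-at F (m ∷ μ) p A (suc k) c (s≤s k<) rewrite ℕₚ.+-suc p k = setRows-at F μ (suc p) _ k c k<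

  nthBound : List (ℕ × ℕ) → ℕ → ℕ × ℕ
  nthBound [] i = (0 , 0)
  nthBound (b ∷ bs) zero = b
  nthBound (b ∷ bs) (suc i) = nthBound bs i

  setIntervalSums-at : ∀ F bs p A k c → k <ℕ length bs →
    setIntervalSums F p bs A (p +ℕ k) c ≡ sumℤ (interval (nthBound bs k)) (λ m → F (p +ℕ k) m c)
  setIntervalSums-at F (b ∷ bs) p A zero c _ rewrite ℕₚ.+-identityʳ p =
    trans (setIntervalSums-below F bs (suc p) _ p c (ℕₚ.n<1+n p)) ([]≔-at A p _ c)
  setIntervalSums-at F (b ∷ bs) p A (suc k) c (s≤s k<) rewrite ℕₚ.+-suc p k = setIntervalSums-at F bs (suc p) _ k c k<

  nthBound-interlacingBounds : ∀ λs k → suc k <ℕ length λs → nthBound (interlacingBounds λs) k ≡ (nth λs (suc k) , nth λs k)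
  nthBound-interlacingBounds (a ∷ []) zero (s≤s ())
  nthBound-interlacingBounds (a ∷ b ∷ r) zero _ = refl
  nthBound-interlacingBounds (a ∷ b ∷ r) (suc k) (s≤s k<) = nthBound-interlacingBounds (b ∷ r) k k<

  -- Subtracting each row from the one above leaves a single 1 in column 0, in the last row.
  det-binomial-differences : ∀ N (L : ℕ → ℕ) → det (suc N) (λ i c → + binomial (L i) c) ≡
    sign N * det N (λ i c → + binomial (L i) (suc c) - + binomial (L (suc i)) (suc c))
  det-binomial-differences N L =
    begin
      det (suc N) R
    ≡⟨ sym (det-differenceRows N N R ℕₚ.≤-refl) ⟩
      det (suc N) (differenceRows N R)
    ≡⟨ det-pivot-last N (differenceRows N R) (λ i i<N → trans (differenceRows-above N R i 0 i<N) (ℤₚ.+-inverseʳ 1ℤ)) ⟩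
      sign N * (differenceRows N R N 0 * det N (λ r c → differenceRows N R r (suc c)))
    ≡⟨ cong₂ (λ x y → sign N * (x * y)) (differenceRows-below N R N 0 ℕₚ.≤-refl)
         (det-cong N (λ r c r<N _ → differenceRows-above N R r (suc c) r<N)) ⟩
      sign N * (1ℤ * det N (λ i c → + binomial (L i) (suc c) - + binomial (L (suc i)) (suc c)))
    ≡⟨ cong (sign N *_) (ℤₚ.*-identityˡ _) ⟩
      sign N * det N (λ i c → + binomial (L i) (suc c) - + binomial (L (suc i)) (suc c))
    ∎
    where
    open ≡-Reasoning
    R : Matrix
    R i c = + binomial (L i) c

  -- The sign of the permutation reversing N rows.
  reversalSign : ℕ → ℤ
  reversalSign zero = 1ℤ
  reversalSign (suc N) = reversalSign N * sign N

  sign-square : ∀ n → sign n * sign n ≡ 1ℤ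
  sign-square zero = refl
  sign-square (suc n) = trans (neg-square (sign n)) (sign-square n)
    where
    neg-square : ∀ a → (- a) * (- a) ≡ a * a
    neg-square = solve-∀

  reversalSign-square : ∀ n → reversalSign n * reversalSign n ≡ 1ℤ
  reversalSign-square zero = refl
  reversalSign-square (suc n) = trans (regroup (reversalSign n) (sign n)) (cong₂ _*_ (reversalSign-square n) (sign-square n))
    where
    regroup : ∀ e s → e * s * (e * s) ≡ (e * e) * (s * s)
    regroup = solve-∀

  strictParts : List ℕ → List ℕ
  strictParts [] = []
  strictParts (a ∷ as) = (a +ℕ length as) ∷ strictParts as

  length-strictParts : ∀ λs → length (strictParts λs) ≡ length λs
  length-strictParts [] = refl
  length-strictParts (a ∷ as) = cong suc (length-strictParts as)

  nth-strictParts : ∀ μ k → k <ℕ length μ → nth (strictParts μ) k ≡ nth μ k +ℕ (length μ ∸ suc k)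
  nth-strictParts (m ∷ μ) zero _ = refl
  nth-strictParts (m ∷ μ) (suc k) (s≤s k<) = nth-strictParts μ k k<

  binomialMatrix : List ℕ → Matrix
  binomialMatrix λs i c = + binomial (nth (strictParts λs) i) c

  sum-binomial-interval : ∀ lo hi s c → lo ≤ℕ suc hi →
    sumℤ (interval (lo , hi)) (λ m → + binomial (m +ℕ s) c) ≡ + binomial (suc hi +ℕ s) (suc c) - + binomial (lo +ℕ s) (suc c)
  sum-binomial-interval lo hi s c lo≤sh =
    trans (sumℤ-pos (interval (lo , hi)) (λ m → binomial (m +ℕ s) c))
      (trans (cong +_ (shift lo (suc hi ∸ lo)))
        (move (sumℕ (range (lo +ℕ s) len) (λ m → binomial m c)) (binomial (lo +ℕ s) (suc c)) (binomial (suc hi +ℕ s) (suc c))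
          (trans (hockey-stick len (lo +ℕ s) c) (cong (λ z → binomial z (suc c)) top))))
    where
    len : ℕ
    len = suc hi ∸ lo
    shift : ∀ a len → sumℕ (range a len) (λ m → binomial (m +ℕ s) c) ≡ sumℕ (range (a +ℕ s) len) (λ m → binomial m c)
    shift a zero = refl
    shift a (suc len) = cong (binomial (a +ℕ s) c +ℕ_) (shift (suc a) len)
    top : lo +ℕ s +ℕ len ≡ suc hi +ℕ s
    top = trans (ℕₚ.+-assoc lo s len) (trans (cong (lo +ℕ_) (ℕₚ.+-comm s len))
            (trans (sym (ℕₚ.+-assoc lo len s)) (cong (_+ℕ s) (ℕₚ.m+[n∸m]≡n lo≤sh))))
    move : ∀ x y z → x +ℕ y ≡ z → + x ≡ + z - + y
    move x y z x+y≡z = trans (cancel (+ x) (+ y)) (cong (_- + y) (trans (sym (ℤₚ.pos-+ x y)) (cong +_ x+y≡z)))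
      where
      cancel : ∀ a b → a ≡ a + b - b
      cancel = solve-∀

  binomialRow : ℕ → ℕ → ℕ → ℕ → ℤ
  binomialRow M i m c = + binomial (m +ℕ (M ∸ suc i)) c

  zeroMatrix : Matrix
  zeroMatrix _ _ = 0ℤ

  binomialMatrix≡setRows : ∀ M μ → length μ ≡ M → det M (binomialMatrix μ) ≡ det M (setRows (binomialRow M) 0 μ zeroMatrix)
  binomialMatrix≡setRows M μ refl = det-cong M λ k c k< _ →
    trans (cong (λ z → + binomial z c) (nth-strictParts μ k k<)) (sym (setRows-at (binomialRow M) μ 0 zeroMatrix k c k<))

  interlacing-rowSums : ∀ M λs → length λs ≡ suc M → Decreasing λs → ∀ k c → k <ℕ M →
    setIntervalSums (binomialRow M) 0 (interlacingBounds λs) zeroMatrix k c ≡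
    + binomial (nth (strictParts λs) k) (suc c) - + binomial (nth (strictParts λs) (suc k)) (suc c)
  interlacing-rowSums M λs len dec k c k<M =
    begin
      setIntervalSums (binomialRow M) 0 (interlacingBounds λs) zeroMatrix k c
    ≡⟨ setIntervalSums-at (binomialRow M) (interlacingBounds λs) 0 zeroMatrix k c (subst (k <ℕ_) (sym bounds-length) k<M) ⟩
      sumℤ (interval (nthBound (interlacingBounds λs) k)) (λ m → binomialRow M k m c)
    ≡⟨ cong (λ b → sumℤ (interval b) (λ m → binomialRow M k m c)) (nthBound-interlacingBounds λs k sk<) ⟩
      sumℤ (interval (nth λs (suc k) , nth λs k)) (λ m → binomialRow M k m c)
    ≡⟨ sum-binomial-interval (nth λs (suc k)) (nth λs k) (M ∸ suc k) c (ℕₚ.m≤n⇒m≤1+n (nth-suc-≤ dec k)) ⟩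
      + binomial (suc (nth λs k) +ℕ (M ∸ suc k)) (suc c) - + binomial (nth λs (suc k) +ℕ (M ∸ suc k)) (suc c)
    ≡⟨ cong₂ (λ x y → + binomial x (suc c) - + binomial y (suc c)) upper lower ⟩
      + binomial (nth (strictParts λs) k) (suc c) - + binomial (nth (strictParts λs) (suc k)) (suc c)
    ∎
    where
    open ≡-Reasoning
    bounds-length : length (interlacingBounds λs) ≡ M
    bounds-length = trans (length-interlacingBounds λs) (cong (_∸ 1) len)
    sk< : suc k <ℕ length λs
    sk< = subst (suc k <ℕ_) (sym len) (s≤s k<M)
    upper : suc (nth λs k) +ℕ (M ∸ suc k) ≡ nth (strictParts λs) k
    upper = trans (sym (ℕₚ.+-suc (nth λs k) (M ∸ suc k)))
      (trans (cong (nth λs k +ℕ_) (trans (sym (ℕₚ.+-∸-assoc 1 k<M)) (cong (_∸ suc k) (sym len))))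
        (sym (nth-strictParts λs k (ℕₚ.<-trans (ℕₚ.n<1+n k) sk<))))
    lower : nth λs (suc k) +ℕ (M ∸ suc k) ≡ nth (strictParts λs) (suc k)
    lower = trans (cong (λ z → nth λs (suc k) +ℕ (z ∸ suc (suc k))) (sym len)) (sym (nth-strictParts λs (suc k) sk<))

  branching⇒det : (S : List ℕ → ℕ) → S [] ≡ 1 →
    (∀ λs → Decreasing λs → 1 ≤ℕ length λs → S λs ≡ sumℕ (interlacing λs) S) →
    ∀ N λs → length λs ≡ N → Decreasing λs → + S λs ≡ reversalSign N * det N (binomialMatrix λs)
  branching⇒det S S[] branching zero [] refl _ = cong +_ S[]
  branching⇒det S S[] branching (suc M) λs len dec =
    begin
      + S λs
    ≡⟨ cong +_ (branching λs dec (subst (1 ≤ℕ_) (sym len) (s≤s z≤n))) ⟩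
      + sumℕ (interlacing λs) S
    ≡⟨ sym (sumℤ-pos (interlacing λs) S) ⟩
      sumℤ (interlacing λs) (λ μ → + S μ)
    ≡⟨ sumℤ-cong∈ (interlacing λs) (λ μ μ∈ → by-induction μ (∈-interlacing⁻ λs μ∈)) ⟩
      sumℤ (interlacing λs) (λ μ → reversalSign M * det M (setRows F 0 μ zeroMatrix))
    ≡⟨ sumℤ-* (interlacing λs) (reversalSign M) _ ⟩
      reversalSign M * sumℤ (interlacing λs) (λ μ → det M (setRows F 0 μ zeroMatrix))
    ≡⟨ cong (reversalSign M *_) (det-sum-setRows F M (interlacingBounds λs) 0 zeroMatrix
         (ℕₚ.≤-reflexive (trans (length-interlacingBounds λs) (cong (_∸ 1) len)))) ⟩
      reversalSign M * det M (setIntervalSums F 0 (interlacingBounds λs) zeroMatrix)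
    ≡⟨ cong (reversalSign M *_) (det-cong M (λ k c k<M _ → interlacing-rowSums M λs len dec k c k<M)) ⟩
      reversalSign M * det M (λ k c → + binomial (L k) (suc c) - + binomial (L (suc k)) (suc c))
    ≡⟨ cong (reversalSign M *_) (unsign (det-binomial-differences M L)) ⟩
      reversalSign M * (sign M * det (suc M) (binomialMatrix λs))
    ≡⟨ sym (ℤₚ.*-assoc (reversalSign M) (sign M) _) ⟩
      reversalSign (suc M) * det (suc M) (binomialMatrix λs)
    ∎
    where
    open ≡-Reasoning
    F : ℕ → ℕ → ℕ → ℤ
    F = binomialRow M
    L : ℕ → ℕ
    L = nth (strictParts λs)
    by-induction : ∀ μ → Interlaces μ λs → + S μ ≡ reversalSign M * det M (setRows F 0 μ zeroMatrix)
    by-induction μ μ≺λ =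
      let μ-length = trans (Interlaces-length μ≺λ) (cong (_∸ 1) len) in
      trans (branching⇒det S S[] branching M μ μ-length (Interlaces-decreasing μ≺λ))
        (cong (reversalSign M *_) (binomialMatrix≡setRows M μ μ-length))
    unsign : ∀ {x y} → x ≡ sign M * y → y ≡ sign M * x
    unsign {x} {y} x≡ = trans (sym (trans (cong (_* y) (sign-square M)) (ℤₚ.*-identityˡ y)))
      (trans (ℤₚ.*-assoc (sign M) (sign M) y) (cong (sign M *_) (sym x≡)))

module Branching where

  open import Data.Bool using (Bool; true; false; T; if_then_else_)
  open import Data.Nat as ℕ using (ℕ; zero; suc; z≤n; s≤s; _∸_; _+_; _≤_; _<_; _≤ᵇ_)
  import Data.Nat.Properties as ℕₚ
  open import Data.List using (List; []; _∷_; map; concatMap; length; zip)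
  import Data.List.Properties as Listₚ
  open import Data.List.Membership.Propositional using (_∈_; find)
  open import Data.List.Membership.Propositional.Properties using (∈-map⁺; ∈-map⁻; ∈-concatMap⁺; ∈-concatMap⁻)
  open import Data.List.Membership.Propositional using (lose)
  open import Data.List.Relation.Unary.All as All using (All)
  open import Data.List.Relation.Unary.Unique.Propositional using (Unique)
  import Data.List.Relation.Unary.Unique.Propositional.Properties as Uniqueₚ
  open import Data.Product using (_×_; _,_; proj₁; proj₂)
  open import Data.Sum using (inj₁; inj₂)
  open import Data.Empty using (⊥-elim)
  open import Function using (_∘_)
  open import Relation.Binary.PropositionalEquality
  open import Relation.Nullary using (¬_)

  ≤ᵇ-cong : ∀ {m n m′ n′} → (m ≤ n → m′ ≤ n′) → (m′ ≤ n′ → m ≤ n) → (m ≤ᵇ n) ≡ (m′ ≤ᵇ n′)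
  ≤ᵇ-cong {m} {n} {m′} {n′} to from with m ≤ᵇ n in e | m′ ≤ᵇ n′ in e′
  ... | true | true = refl
  ... | false | false = refl
  ... | true | false = ⊥-elim (subst T e′ (ℕₚ.≤⇒≤ᵇ (to (ℕₚ.≤ᵇ⇒≤ m n (subst T (sym e) _)))))
  ... | false | true = ⊥-elim (subst T e (ℕₚ.≤⇒≤ᵇ (from (ℕₚ.≤ᵇ⇒≤ m′ n′ (subst T (sym e′) _)))))
  open import Defs using (Cell; cells; count; allAssign; range1; ssytOK; schur1)
  open ListSums using (sumℕ; sumℕ-cong∈)
  open Enumeration
  open Shapes
  open Interlacing using (interlacing; Interlaces; ∈-interlacing⁻; ∈-interlacing⁺; Unique-interlacing;
    Interlaces-length; Interlaces-decreasing; Interlaces-nth; nth⇒Interlaces)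

  trimmedShape : ℕ → (Cell → ℕ) → List ℕ → ℕ → List ℕ
  trimmedShape N F [] a = []
  trimmedShape N F (r ∷ []) a = []
  trimmedShape N F (r ∷ r′ ∷ rs) a = count (λ b → F (a , b) ≤ᵇ N) (range1 r) ∷ trimmedShape N F (r′ ∷ rs) (suc a)

  nth-trimmedShape : ∀ N F λs a k → suc k < length λs →
    nth (trimmedShape N F λs a) k ≡ count (λ b → F (a + k , b) ≤ᵇ N) (range1 (nth λs k))
  nth-trimmedShape N F (r ∷ []) a k (s≤s ())
  nth-trimmedShape N F (r ∷ r′ ∷ rs) a zero _ rewrite ℕₚ.+-identityʳ a = refl
  nth-trimmedShape N F (r ∷ r′ ∷ rs) a (suc k) (s≤s k<) rewrite ℕₚ.+-suc a k = nth-trimmedShape N F (r′ ∷ rs) (suc a) k k<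

  length-trimmedShape : ∀ N F λs a → length (trimmedShape N F λs a) ≡ length λs ∸ 1
  length-trimmedShape N F [] a = refl
  length-trimmedShape N F (r ∷ []) a = refl
  length-trimmedShape N F (r ∷ r′ ∷ rs) a = cong suc (length-trimmedShape N F (r′ ∷ rs) (suc a))

  extendBy : ℕ → List ℕ → List ℕ → Cell → ℕ
  extendBy N μ vs (a , b) = if b ≤ᵇ nth μ (a ∸ 1) then valueAt (cells μ) vs (a , b) else suc N

  tableauxOfShapes : List (List ℕ) → ℕ → List (List ℕ × List ℕ)
  tableauxOfShapes μs N = concatMap (λ μ → map (μ ,_) (allAssign (length (cells μ)) (range1 N))) μs

  isTableau : List ℕ × List ℕ → Bool
  isTableau (μ , vs) = ssytOK (zip (cells μ) vs)

  count-tableauxOfShapes : ∀ μs N → count isTableau (tableauxOfShapes μs N) ≡ sumℕ μs (λ μ → schur1 μ N)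
  count-tableauxOfShapes μs N =
    trans (count-concatMap isTableau _ μs) (sumℕ-cong∈ μs (λ μ _ → count-map isTableau (μ ,_) (allAssign (length (cells μ)) (range1 N))))

  module Bijection (N : ℕ) (λs : List ℕ) (len : length λs ≡ suc N) (dec : Decreasing λs) where

    C : List Cell
    C = cells λs

    restrict : List ℕ → List ℕ × List ℕ
    restrict vs = let μ = trimmedShape N (valueAt C vs) λs 1 in μ , map (valueAt C vs) (cells μ)

    extend : List ℕ × List ℕ → List ℕ
    extend (μ , vs) = map (extendBy N μ vs) C

    row<length : ∀ {a b} → InShape λs (a , b) → a ∸ 1 < suc N
    row<length {a} (_ , 1≤b , b≤) = subst (a ∸ 1 <_) len (nth-pos⇒< λs (ℕₚ.≤-trans 1≤b b≤))

    module Restriction (vs : List ℕ) (vs∈ : vs ∈ allAssign (length C) (range1 (suc N))) (ok : T (ssytOK (zip C vs))) where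
      F : Cell → ℕ
      F = valueAt C vs
      vs-length : length vs ≡ length C
      vs-length = proj₁ (∈-allAssign⁻ (length C) (range1 (suc N)) vs∈)
      entry-bounds : ∀ {c} → InShape λs c → 1 ≤ F c × F c ≤ suc N
      entry-bounds c = ∈-range1⁻ (All.lookup (proj₂ (∈-allAssign⁻ (length C) (range1 (suc N)) vs∈)) (valueAt-∈ C vs vs-length (∈-cellsFrom⁺ 1 λs c)))
      ssyt : IsSSYT λs F
      ssyt = ssytOK⇒IsSSYT λs vs vs-length ok
      μ : List ℕ
      μ = trimmedShape N F λs 1
      μ-length : length μ ≡ N
      μ-length = trans (length-trimmedShape N F λs 1) (cong (_∸ 1) len)
      small : ℕ → ℕ → Bool
      small k b = F (suc k , b) ≤ᵇ N
      small-downClosed : ∀ k → DownClosed (small k) (nth λs k)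
      small-downClosed k {b} {b′} 1≤b b≤b′ b′≤ t =
        ℕₚ.≤⇒≤ᵇ (ℕₚ.≤-trans (ℕₚ.≤-trans (ℕₚ.m≤m+n (F (suc k , b)) (suc k ∸ suc k))
                  (ssyt-chain dec ssyt (s≤s z≤n , ℕₚ.≤-trans 1≤b b≤b′ , b′≤) (s≤s z≤n) ℕₚ.≤-refl 1≤b b≤b′))
                (ℕₚ.≤ᵇ⇒≤ (F (suc k , b′)) N t))
      row-prefix : ∀ k → k < N → PrefixCount (small k) (nth λs k) (nth μ k)
      row-prefix k k<N = subst (PrefixCount (small k) (nth λs k)) (sym (nth-trimmedShape N F λs 1 k (subst (suc k <_) (sym len) (s≤s k<N))))
        (count-downClosed (nth λs k) (small k) (small-downClosed k))
      μ≤λ : ∀ k → k < N → nth μ k ≤ nth λs k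
      μ≤λ k k<N = proj₁ (row-prefix k k<N)
      small⇔ : ∀ {k b} → k < N → 1 ≤ b → b ≤ nth λs k → (F (suc k , b) ≤ N → b ≤ nth μ k) × (b ≤ nth μ k → F (suc k , b) ≤ N)
      small⇔ {k} {b} k<N 1≤b b≤ = let (to , from) = proj₂ (row-prefix k k<N) 1≤b b≤ in
        to ∘ ℕₚ.≤⇒≤ᵇ , ℕₚ.≤ᵇ⇒≤ _ N ∘ from
      λ≤μ : ∀ k → k < N → nth λs (suc k) ≤ nth μ k
      λ≤μ k k<N with nth λs (suc k) in eq
      ... | zero = z≤n
      ... | suc b =
        let below = (s≤s z≤n , s≤s z≤n , ℕₚ.≤-reflexive (sym eq))
            above = (s≤s z≤n , s≤s z≤n , subst (_≤ nth λs k) eq (nth-suc-≤ dec k))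
        in proj₁ (small⇔ k<N (s≤s z≤n) (proj₂ (proj₂ above)))
             (ℕₚ.≤-pred (ℕₚ.≤-trans (columns-strict ssyt above below ℕₚ.≤-refl) (proj₂ (entry-bounds below))))
      last-row : ∀ {b} → InShape λs (suc N , b) → F (suc N , b) ≡ suc N
      last-row {b} c = ℕₚ.≤-antisym (proj₂ (entry-bounds c))
        (ℕₚ.≤-trans (ℕₚ.+-monoˡ-≤ N (proj₁ (entry-bounds top))) (ssyt-chain dec ssyt c (s≤s z≤n) (s≤s z≤n) (proj₁ (proj₂ c)) ℕₚ.≤-refl))
        where
        top : InShape λs (1 , b)
        top = InShape-downward dec c (s≤s z≤n) (s≤s z≤n) (proj₁ (proj₂ c)) ℕₚ.≤-refl
      μ⊆λ : ∀ {c} → InShape μ c → InShape λs c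
      μ⊆λ {a , b} (1≤a , 1≤b , b≤) = 1≤a , 1≤b , ℕₚ.≤-trans b≤ (μ≤λ (a ∸ 1) (subst (a ∸ 1 <_) μ-length (nth-pos⇒< μ (ℕₚ.≤-trans 1≤b b≤))))
      small-on-μ : ∀ {a b} → InShape μ (a , b) → F (a , b) ≤ N
      small-on-μ {suc a} {b} (_ , 1≤b , b≤) =
        let a<N = subst (a <_) μ-length (nth-pos⇒< μ (ℕₚ.≤-trans 1≤b b≤)) in
        proj₂ (small⇔ a<N 1≤b (ℕₚ.≤-trans b≤ (μ≤λ a a<N))) b≤
      μ≺λ : Interlaces μ λs
      μ≺λ = nth⇒Interlaces λs μ (trans μ-length (sym (cong (_∸ 1) len)))
        (λ k sk< → let k<N = ℕₚ.≤-pred (subst (suc k <_) len sk<) in λ≤μ k k<N , μ≤λ k k<N)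
      restriction : List ℕ
      restriction = map F (cells μ)
      restriction∈ : restriction ∈ allAssign (length (cells μ)) (range1 N)
      restriction∈ = ∈-allAssign⁺ _ _ (Listₚ.length-map F (cells μ)) (All.tabulate λ v∈ →
        let (c , c∈ , v≡) = ∈-map⁻ F v∈ ; c′ = ∈-cellsFrom⁻ 1 μ c∈ in
        subst (_∈ range1 N) (sym v≡) (∈-range1⁺ (proj₁ (entry-bounds (μ⊆λ c′))) (small-on-μ c′)))
      restrict∈ : restrict vs ∈ tableauxOfShapes (interlacing λs) N
      restrict∈ = ∈-concatMap⁺ _ (lose (∈-interlacing⁺ λs μ≺λ) (∈-map⁺ (μ ,_) restriction∈))
      restrict-ok : T (isTableau (restrict vs))
      restrict-ok = IsSSYT⇒ssytOK μ restriction
        (IsSSYT-restrict μ⊆λ (λ c → sym (valueAt-map (cells μ) F (∈-cellsFrom⁺ 1 μ c))) ssyt)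
      extend-restrict : extend (restrict vs) ≡ vs
      extend-restrict = trans (Listₚ.map-cong-local (All.tabulate (λ c∈ → same (∈-cellsFrom⁻ 1 λs c∈))))
        (map-valueAt C vs (Unique-cellsFrom 1 λs) vs-length)
        where
        outside : ∀ {a b} → InShape λs (a , b) → ¬ (b ≤ nth μ (a ∸ 1)) → F (a , b) ≡ suc N
        outside {suc a} {b} c b≰ with ℕₚ.m≤n⇒m<n∨m≡n (ℕₚ.≤-pred (row<length c))
        ... | inj₁ a<N = ℕₚ.≤-antisym (proj₂ (entry-bounds c)) (ℕₚ.≰⇒> (b≰ ∘ proj₁ (small⇔ a<N (proj₁ (proj₂ c)) (proj₂ (proj₂ c)))))
        ... | inj₂ refl = last-row c
        same : ∀ {a b} → InShape λs (a , b) → extendBy N μ restriction (a , b) ≡ F (a , b)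
        same {a} {b} c with b ≤ᵇ nth μ (a ∸ 1) in eq
        ... | true = valueAt-map (cells μ) F (∈-cellsFrom⁺ 1 μ (proj₁ c , proj₁ (proj₂ c) , ℕₚ.≤ᵇ⇒≤ b _ (subst T (sym eq) _)))
        ... | false = sym (outside c (λ b≤ → subst T eq (ℕₚ.≤⇒≤ᵇ b≤)))

    module Extension (μ vs : List ℕ) (pair∈ : (μ , vs) ∈ tableauxOfShapes (interlacing λs) N) (ok : T (isTableau (μ , vs))) where
      private
        components : μ ∈ interlacing λs × vs ∈ allAssign (length (cells μ)) (range1 N)
        components with find (∈-concatMap⁻ (λ μ → map (μ ,_) (allAssign (length (cells μ)) (range1 N))) pair∈)
        ... | μ′ , μ′∈ , pair∈′ with ∈-map⁻ (μ′ ,_) pair∈′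
        ...   | vs′ , vs′∈ , refl = μ′∈ , vs′∈
      μ≺λ : Interlaces μ λs
      μ≺λ = ∈-interlacing⁻ λs (proj₁ components)
      μ-length : length μ ≡ N
      μ-length = trans (Interlaces-length μ≺λ) (cong (_∸ 1) len)
      vs-length : length vs ≡ length (cells μ)
      vs-length = proj₁ (∈-allAssign⁻ (length (cells μ)) (range1 N) (proj₂ components))
      F′ : Cell → ℕ
      F′ = valueAt (cells μ) vs
      ssyt′ : IsSSYT μ F′
      ssyt′ = ssytOK⇒IsSSYT μ vs vs-length ok
      entry-bounds′ : ∀ {c} → InShape μ c → 1 ≤ F′ c × F′ c ≤ N
      entry-bounds′ c = ∈-range1⁻ (All.lookup (proj₂ (∈-allAssign⁻ (length (cells μ)) (range1 N) (proj₂ components)))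
        (valueAt-∈ (cells μ) vs vs-length (∈-cellsFrom⁺ 1 μ c)))
      interlaced : ∀ k → k < N → nth λs (suc k) ≤ nth μ k × nth μ k ≤ nth λs k
      interlaced k k<N = Interlaces-nth μ≺λ k (subst (suc k <_) (sym len) (s≤s k<N))
      G : Cell → ℕ
      G = extendBy N μ vs
      data Position (a b : ℕ) : Set where
        inside : InShape μ (a , b) → G (a , b) ≡ F′ (a , b) → Position a b
        outside : nth μ (a ∸ 1) < b → G (a , b) ≡ suc N → Position a b
      G-if : ∀ {a b x} → (b ≤ᵇ nth μ (a ∸ 1)) ≡ x → G (a , b) ≡ (if x then F′ (a , b) else suc N)
      G-if refl = refl
      position : ∀ a b → 1 ≤ a → 1 ≤ b → Position a b
      position a b 1≤a 1≤b with b ≤ᵇ nth μ (a ∸ 1) in eq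
      ... | true = inside (1≤a , 1≤b , ℕₚ.≤ᵇ⇒≤ b _ (subst T (sym eq) _)) (G-if eq)
      ... | false = outside (ℕₚ.≰⇒> (λ b≤ → subst T eq (ℕₚ.≤⇒≤ᵇ b≤))) (G-if eq)
      G-bounds : ∀ {a b} → 1 ≤ a → 1 ≤ b → 1 ≤ G (a , b) × G (a , b) ≤ suc N
      G-bounds {a} {b} 1≤a 1≤b with position a b 1≤a 1≤b
      ... | inside c G≡ = subst (λ z → 1 ≤ z × z ≤ suc N) (sym G≡) (proj₁ (entry-bounds′ c) , ℕₚ.m≤n⇒m≤1+n (proj₂ (entry-bounds′ c)))
      ... | outside _ G≡ = subst (λ z → 1 ≤ z × z ≤ suc N) (sym G≡) (s≤s z≤n , ℕₚ.≤-refl)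
      G-on-μ : ∀ {a b} → InShape μ (a , b) → G (a , b) ≡ F′ (a , b)
      G-on-μ {a} {b} c with position a b (proj₁ c) (proj₁ (proj₂ c))
      ... | inside _ G≡ = G≡
      ... | outside μ<b _ = ⊥-elim (ℕₚ.<-irrefl refl (ℕₚ.<-≤-trans μ<b (proj₂ (proj₂ c))))
      μ⊆λ : ∀ {c} → InShape μ c → InShape λs c
      μ⊆λ {a , b} (1≤a , 1≤b , b≤) =
        1≤a , 1≤b , ℕₚ.≤-trans b≤ (proj₂ (interlaced (a ∸ 1) (subst (a ∸ 1 <_) μ-length (nth-pos⇒< μ (ℕₚ.≤-trans 1≤b b≤)))))
      extension : List ℕ
      extension = extend (μ , vs)
      on-λ : ∀ {c} → InShape λs c → valueAt C extension c ≡ G c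
      on-λ c = valueAt-map C G (∈-cellsFrom⁺ 1 λs c)
      extend∈ : extension ∈ allAssign (length C) (range1 (suc N))
      extend∈ = ∈-allAssign⁺ _ _ (Listₚ.length-map G C) (All.tabulate λ v∈ →
        let ((a , b) , c∈ , v≡) = ∈-map⁻ G v∈ ; (1≤a , 1≤b , _) = ∈-cellsFrom⁻ 1 λs c∈ in
        subst (_∈ range1 (suc N)) (sym v≡) (∈-range1⁺ (proj₁ (G-bounds 1≤a 1≤b)) (proj₂ (G-bounds 1≤a 1≤b))))
      above-λ⇒in-μ : ∀ {i i′ j} → 1 ≤ i → i < i′ → InShape λs (i′ , j) → j ≤ nth μ (i ∸ 1)
      above-λ⇒in-μ {suc k} {i′} {j} _ sk<i′ c′ =
        ℕₚ.≤-trans (proj₂ (proj₂ c′)) (ℕₚ.≤-trans (nth-antitone dec sk≤) (proj₁ (interlaced k (ℕₚ.≤-pred (ℕₚ.≤-<-trans sk≤ (row<length c′))))))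
        where
        sk≤ : suc k ≤ i′ ∸ 1
        sk≤ = ℕₚ.∸-monoˡ-≤ 1 sk<i′
      ssyt : IsSSYT λs G
      rows-weak ssyt {i} {j} {j′} c c′ j<j′ with position i j′ (proj₁ c′) (proj₁ (proj₂ c′))
      ... | outside _ G≡ = subst (G (i , j) ≤_) (sym G≡) (proj₂ (G-bounds (proj₁ c) (proj₁ (proj₂ c))))
      ... | inside c₂ G≡ with position i j (proj₁ c) (proj₁ (proj₂ c))
      ...   | inside c₁ G≡′ = subst₂ _≤_ (sym G≡′) (sym G≡) (rows-weak ssyt′ c₁ c₂ j<j′)
      ...   | outside μ<j _ = ⊥-elim (ℕₚ.<-irrefl refl (ℕₚ.<-trans μ<j (ℕₚ.<-≤-trans j<j′ (proj₂ (proj₂ c₂)))))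
      columns-strict ssyt {i} {i′} {j} c c′ i<i′ with position i′ j (proj₁ c′) (proj₁ (proj₂ c′)) | position i j (proj₁ c) (proj₁ (proj₂ c))
      ... | inside c₂ G≡ | inside c₁ G≡′ = subst₂ _<_ (sym G≡′) (sym G≡) (columns-strict ssyt′ c₁ c₂ i<i′)
      ... | inside c₂ _ | outside μ<j _ =
        ⊥-elim (ℕₚ.<-irrefl refl (ℕₚ.<-≤-trans μ<j (ℕₚ.≤-trans (proj₂ (proj₂ c₂))
          (nth-antitone (Interlaces-decreasing μ≺λ) (ℕₚ.∸-monoˡ-≤ 1 (ℕₚ.<⇒≤ i<i′))))))
      ... | outside _ G≡ | inside c₁ G≡′ = subst₂ _<_ (sym G≡′) (sym G≡) (s≤s (proj₂ (entry-bounds′ c₁)))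
      ... | outside _ _ | outside μ<j _ = ⊥-elim (ℕₚ.<-irrefl refl (ℕₚ.<-≤-trans μ<j (above-λ⇒in-μ (proj₁ c) i<i′ c′)))
      extend-ok : T (ssytOK (zip C extension))
      extend-ok = IsSSYT⇒ssytOK λs extension (IsSSYT-restrict (λ c → c) (λ c → sym (on-λ c)) ssyt)
      small⇔in-μ : ∀ {k b} → 1 ≤ b → (G (suc k , b) ≤ᵇ N) ≡ (b ≤ᵇ nth μ k)
      small⇔in-μ {k} {b} 1≤b with position (suc k) b (s≤s z≤n) 1≤b
      ... | inside c G≡ = ≤ᵇ-cong (λ _ → proj₂ (proj₂ c)) (λ _ → subst (_≤ N) (sym G≡) (proj₂ (entry-bounds′ c)))
      ... | outside μ<b G≡ = ≤ᵇ-cong (λ G≤N → ⊥-elim (ℕₚ.<-irrefl refl (subst (_≤ N) G≡ G≤N))) (λ b≤μ → ⊥-elim (ℕₚ.<-irrefl refl (ℕₚ.<-≤-trans μ<b b≤μ)))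
      trimmed-extension : trimmedShape N (valueAt C extension) λs 1 ≡ μ
      trimmed-extension = ≡-by-nth _ μ (trans (length-trimmedShape N _ λs 1) (trans (cong (_∸ 1) len) (sym μ-length))) λ k k< →
        let k<N = subst (k <_) (trans (length-trimmedShape N _ λs 1) (cong (_∸ 1) len)) k< in
        trans (nth-trimmedShape N (valueAt C extension) λs 1 k (subst (suc k <_) (sym len) (s≤s k<N)))
          (trans (count-cong∈ _ (range1 (nth λs k)) (λ b b∈ → let (1≤b , b≤) = ∈-range1⁻ b∈ in
                    trans (cong (_≤ᵇ N) (on-λ (s≤s z≤n , 1≤b , b≤))) (small⇔in-μ 1≤b)))
            (count-≤ᵇ (nth λs k) (nth μ k) (proj₂ (interlaced k k<N))))
      restrict-extend : restrict extension ≡ (μ , vs)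
      restrict-extend rewrite trimmed-extension =
        cong (μ ,_) (trans (Listₚ.map-cong-local (All.tabulate λ c∈ → let c = ∈-cellsFrom⁻ 1 μ c∈ in trans (on-λ (μ⊆λ c)) (G-on-μ c)))
          (map-valueAt (cells μ) vs (Unique-cellsFrom 1 μ) vs-length))

    tableaux-bijection : count (λ vs → ssytOK (zip C vs)) (allAssign (length C) (range1 (suc N))) ≡
                         count isTableau (tableauxOfShapes (interlacing λs) N)
    tableaux-bijection = count-bijection _ _ _ isTableau restrict extend
      (Unique-allAssign (length C) (Unique-range1 (suc N))) unique-pairs
      (λ {vs} vs∈ ok → let open Restriction vs vs∈ ok in restrict∈ , restrict-ok , extend-restrict)
      (λ {(μ , vs)} pair∈ ok → let open Extension μ vs pair∈ ok in extend∈ , extend-ok , restrict-extend)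
      where
      unique-pairs : Unique (tableauxOfShapes (interlacing λs) N)
      unique-pairs = Unique-concatMap _ (Unique-interlacing λs)
        (λ {μ} _ → Uniqueₚ.map⁺ (cong proj₂) (Unique-allAssign (length (cells μ)) (Unique-range1 N)))
        (λ {μ} {μ′} z∈ z∈′ → let (_ , _ , z≡) = ∈-map⁻ (μ ,_) z∈ ; (_ , _ , z≡′) = ∈-map⁻ (μ′ ,_) z∈′ in cong proj₁ (trans (sym z≡) z≡′))

  schur1-branching : ∀ N λs → length λs ≡ suc N → Decreasing λs → schur1 λs (suc N) ≡ sumℕ (interlacing λs) (λ μ → schur1 μ N)
  schur1-branching N λs len dec = trans (Bijection.tableaux-bijection N λs len dec) (count-tableauxOfShapes (interlacing λs) N)

module SchurDeterminant where

  open import Data.Nat as ℕ using (ℕ; zero; suc; s≤s; _∸_; _!) renaming (_<_ to _<ℕ_; _>_ to _>ℕ_; _≤_ to _≤ℕ_; _+_ to _+ℕ_; _*_ to _*ℕ_)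
  import Data.Nat.Properties as ℕₚ
  open import Data.Nat.ListAction using (product)
  open import Data.Integer using (+_; _+_; _*_; -_; _-_; 1ℤ)
  import Data.Integer.Properties as ℤₚ
  open import Data.Integer.Tactic.RingSolver using (solve-∀)
  open import Data.List using (List; []; _∷_; map; length)
  open import Data.List.Relation.Unary.All as All using (All; []; _∷_)
  open import Data.List.Relation.Unary.Linked using (Linked; []; [-]; _∷_)
  open import Data.List.Relation.Unary.Linked.Properties using (Linked⇒All)
  open import Relation.Binary.PropositionalEquality
  open import Defs using (schur1)
  open Determinant
  open Binomial using (binomial; fallingFactorial; fallingFactorial-poly; fallingFactorial-binomial)
  open ListSums using (sumℕ; sumℕ-cong∈)
  open Shapes using (nth; Decreasing)
  open Interlacing
  open Branching using (schur1-branching)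

  schurAtLength : List ℕ → ℕ
  schurAtLength λs = schur1 λs (length λs)

  schurAtLength-branching : ∀ λs → Decreasing λs → 1 ≤ℕ length λs → schurAtLength λs ≡ sumℕ (interlacing λs) schurAtLength
  schurAtLength-branching (a ∷ as) dec _ =
    trans (schur1-branching (length as) (a ∷ as) refl dec)
      (sumℕ-cong∈ (interlacing (a ∷ as)) (λ μ μ∈ → cong (schur1 μ) (sym (Interlaces-length (∈-interlacing⁻ (a ∷ as) μ∈)))))

  schurAtLength-det : ∀ λs → Decreasing λs → + schurAtLength λs ≡ reversalSign (length λs) * det (length λs) (binomialMatrix λs)
  schurAtLength-det λs dec = branching⇒det schurAtLength refl schurAtLength-branching (length λs) λs refl dec

  ∏ℕ : ℕ → (ℕ → ℕ) → ℕ
  ∏ℕ zero f = 1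
  ∏ℕ (suc m) f = f m *ℕ ∏ℕ m f

  ∏-pos : ∀ n f → ∏ n (λ i → + f i) ≡ + ∏ℕ n f
  ∏-pos zero f = refl
  ∏-pos (suc n) f =
    trans (∏-∷ʳ n (λ i → + f i))
      (trans (cong (_* + f n) (∏-pos n f)) (trans (sym (ℤₚ.pos-* (∏ℕ n f) (f n))) (cong +_ (ℕₚ.*-comm (∏ℕ n f) (f n)))))

  schurAtLength-vandermonde : ∀ λs → Decreasing λs →
    + schurAtLength λs * + ∏ℕ (length λs) _! ≡ reversalSign (length λs) * vandermonde (length λs) (λ i → + nth (strictParts λs) i)
  schurAtLength-vandermonde λs dec =
    begin
      + schurAtLength λs * + ∏ℕ N _!
    ≡⟨ cong₂ _*_ (schurAtLength-det λs dec) (sym (∏-pos N _!)) ⟩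
      reversalSign N * det N (binomialMatrix λs) * ∏ N (λ c → + (c !))
    ≡⟨ exchange (reversalSign N) (det N (binomialMatrix λs)) (∏ N (λ c → + (c !))) ⟩
      reversalSign N * (∏ N (λ c → + (c !)) * det N (binomialMatrix λs))
    ≡⟨ cong (reversalSign N *_) (sym (det-scaleColumns N (λ c → + (c !)) (binomialMatrix λs))) ⟩
      reversalSign N * det N (λ i c → binomialMatrix λs i c * + (c !))
    ≡⟨ cong (reversalSign N *_) (det-cong N (λ i c _ _ → falling i c)) ⟩
      reversalSign N * det N (λ i c → fallingFactorial c (+ L i))
    ≡⟨ cong (reversalSign N *_) (det-poly≡vandermonde N (λ i → + L i) fallingFactorial (λ _ → 1ℤ) fallingFactorial-poly) ⟩
      reversalSign N * (∏ N (λ _ → 1ℤ) * vandermonde N (λ i → + L i))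
    ≡⟨ cong (λ z → reversalSign N * (z * vandermonde N (λ i → + L i))) (∏-one N) ⟩
      reversalSign N * (1ℤ * vandermonde N (λ i → + L i))
    ≡⟨ cong (reversalSign N *_) (ℤₚ.*-identityˡ _) ⟩
      reversalSign N * vandermonde N (λ i → + L i)
    ∎
    where
    open ≡-Reasoning
    N : ℕ
    N = length λs
    L : ℕ → ℕ
    L = nth (strictParts λs)
    exchange : ∀ a b c → a * b * c ≡ a * (c * b)
    exchange = solve-∀
    falling : ∀ i c → binomialMatrix λs i c * + (c !) ≡ fallingFactorial c (+ L i)
    falling i c = trans (sym (ℤₚ.pos-* (binomial (L i) c) (c !)))
      (trans (cong +_ (ℕₚ.*-comm (binomial (L i) c) (c !))) (sym (fallingFactorial-binomial c (L i))))

  differenceProduct : List ℕ → ℕ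
  differenceProduct [] = 1
  differenceProduct (a ∷ as) = product (map (a ∸_) as) *ℕ differenceProduct as

  ∏-nth : ∀ (as : List ℕ) (g : ℕ → ℕ) → ∏ (length as) (λ r → + g (nth as r)) ≡ + product (map g as)
  ∏-nth [] g = refl
  ∏-nth (a ∷ as) g = trans (cong (+ g a *_) (∏-nth as g)) (sym (ℤₚ.pos-* (g a) _))

  nth-All : ∀ {P : ℕ → Set} {as} → All P as → ∀ {r} → r <ℕ length as → P (nth as r)
  nth-All (p ∷ _) {zero} _ = p
  nth-All (_ ∷ ps) {suc r} (s≤s r<) = nth-All ps r<

  vandermonde-decreasing : ∀ L → Linked _>ℕ_ L → vandermonde (length L) (λ i → + nth L i) ≡ reversalSign (length L) * + differenceProduct L
  vandermonde-decreasing [] _ = refl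
  vandermonde-decreasing (a ∷ as) dec =
    begin
      ∏ M (λ r → + nth as r - + a) * vandermonde M (λ r → + nth as r)
    ≡⟨ cong₂ _*_ (∏-cong M (λ r r<M → difference (nth-All (head-above dec) r<M))) (vandermonde-decreasing as (tail dec)) ⟩
      ∏ M (λ r → - + (a ∸ nth as r)) * (reversalSign M * + differenceProduct as)
    ≡⟨ cong (_* (reversalSign M * + differenceProduct as)) (trans (∏-neg M (λ r → + (a ∸ nth as r))) (cong (sign M *_) (∏-nth as (a ∸_)))) ⟩
      sign M * + product (map (a ∸_) as) * (reversalSign M * + differenceProduct as)
    ≡⟨ regroup (sign M) (+ product (map (a ∸_) as)) (reversalSign M) (+ differenceProduct as) ⟩
      reversalSign M * sign M * (+ product (map (a ∸_) as) * + differenceProduct as)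
    ≡⟨ cong (reversalSign M * sign M *_) (sym (ℤₚ.pos-* (product (map (a ∸_) as)) (differenceProduct as))) ⟩
      reversalSign (suc M) * + differenceProduct (a ∷ as)
    ∎
    where
    open ≡-Reasoning
    M : ℕ
    M = length as
    tail : ∀ {a as} → Linked _>ℕ_ (a ∷ as) → Linked _>ℕ_ as
    tail [-] = []
    tail (_ ∷ dec) = dec
    head-above : ∀ {a as} → Linked _>ℕ_ (a ∷ as) → All (_<ℕ a) as
    head-above [-] = []
    head-above (b<a ∷ dec) = Linked⇒All (λ y<x z<y → ℕₚ.<-trans z<y y<x) b<a dec
    difference : ∀ {b} → b <ℕ a → + b - + a ≡ - + (a ∸ b)
    difference {b} b<a = trans (cong (λ z → + b - z) (trans (cong +_ (sym (ℕₚ.m∸n+n≡m (ℕₚ.<⇒≤ b<a)))) (ℤₚ.pos-+ (a ∸ b) b)))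
      (cancel (+ b) (+ (a ∸ b)))
      where
      cancel : ∀ x y → x - (y + x) ≡ - y
      cancel = solve-∀
    regroup : ∀ s p e v → s * p * (e * v) ≡ e * s * (p * v)
    regroup = solve-∀

  strictParts-decreasing : ∀ {λs} → Decreasing λs → Linked _>ℕ_ (strictParts λs)
  strictParts-decreasing [] = []
  strictParts-decreasing [-] = [-]
  strictParts-decreasing {a ∷ b ∷ r} (b≤a ∷ dec) =
    subst (b +ℕ length r <ℕ_) (sym (ℕₚ.+-suc a (length r))) (s≤s (ℕₚ.+-monoˡ-≤ (length r) b≤a)) ∷ strictParts-decreasing dec

  schurAtLength-differenceProduct : ∀ λs → Decreasing λs → schurAtLength λs *ℕ ∏ℕ (length λs) _! ≡ differenceProduct (strictParts λs)
  schurAtLength-differenceProduct λs dec = ℤₚ.+-injective (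
    begin
      + (schurAtLength λs *ℕ ∏ℕ N _!)
    ≡⟨ ℤₚ.pos-* (schurAtLength λs) _ ⟩
      + schurAtLength λs * + ∏ℕ N _!
    ≡⟨ schurAtLength-vandermonde λs dec ⟩
      reversalSign N * vandermonde N (λ i → + nth (strictParts λs) i)
    ≡⟨ cong (λ m → reversalSign N * vandermonde m (λ i → + nth (strictParts λs) i)) (sym (length-strictParts λs)) ⟩
      reversalSign N * vandermonde (length (strictParts λs)) (λ i → + nth (strictParts λs) i)
    ≡⟨ cong (reversalSign N *_) (vandermonde-decreasing (strictParts λs) (strictParts-decreasing dec)) ⟩
      reversalSign N * (reversalSign (length (strictParts λs)) * + differenceProduct (strictParts λs))
    ≡⟨ cong (λ m → reversalSign N * (reversalSign m * + differenceProduct (strictParts λs))) (length-strictParts λs) ⟩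
      reversalSign N * (reversalSign N * + differenceProduct (strictParts λs))
    ≡⟨ sym (ℤₚ.*-assoc (reversalSign N) (reversalSign N) _) ⟩
      reversalSign N * reversalSign N * + differenceProduct (strictParts λs)
    ≡⟨ trans (cong (_* + differenceProduct (strictParts λs)) (reversalSign-square N)) (ℤₚ.*-identityˡ _) ⟩
      + differenceProduct (strictParts λs)
    ∎)
    where
    open ≡-Reasoning
    N : ℕ
    N = length λs

module Rectangle where

  open import Data.Nat as ℕ using (ℕ; zero; suc; z≤n; _∸_; _+_; _*_; _<_; _!; NonZero)
  import Data.Nat.Properties as ℕₚ
  import Data.Nat.Tactic.RingSolver as ℕ-Solver
  open import Data.Nat.ListAction using (product)
  open import Data.Nat.ListAction.Properties using (product-++)
  open import Data.List using (List; []; _∷_; _++_; map; length; replicate)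
  import Data.List.Properties as Listₚ
  open import Data.List.Relation.Unary.Linked using ([]; [-]; _∷_)
  open import Relation.Binary.PropositionalEquality
  open Shapes using (Decreasing)
  open Interlacing using (strictParts)
  open SchurDeterminant using (schurAtLength; ∏ℕ; differenceProduct; schurAtLength-differenceProduct)

  ∏ℕ-cong : ∀ m {f g} → (∀ s → s < m → f s ≡ g s) → ∏ℕ m f ≡ ∏ℕ m g
  ∏ℕ-cong zero h = refl
  ∏ℕ-cong (suc m) h = cong₂ _*_ (h m ℕₚ.≤-refl) (∏ℕ-cong m (λ s s<m → h s (ℕₚ.m≤n⇒m≤1+n s<m)))

  ∏ℕ-* : ∀ m f g → ∏ℕ m (λ s → f s * g s) ≡ ∏ℕ m f * ∏ℕ m g
  ∏ℕ-* zero f g = refl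
  ∏ℕ-* (suc m) f g rewrite ∏ℕ-* m f g = regroup (f m) (g m) (∏ℕ m f) (∏ℕ m g)
    where
    regroup : ∀ a b c d → a * b * (c * d) ≡ a * c * (b * d)
    regroup = ℕ-Solver.solve-∀

  ∏ℕ-+ : ∀ n t f → ∏ℕ (n + t) f ≡ ∏ℕ n f * ∏ℕ t (λ s → f (n + s))
  ∏ℕ-+ n zero f = trans (cong (λ z → ∏ℕ z f) (ℕₚ.+-identityʳ n)) (sym (ℕₚ.*-identityʳ _))
  ∏ℕ-+ n (suc t) f = trans (cong (λ z → ∏ℕ z f) (ℕₚ.+-suc n t))
    (trans (cong (f (n + t) *_) (∏ℕ-+ n t f)) (exchange (f (n + t)) (∏ℕ n f) (∏ℕ t (λ s → f (n + s)))))
    where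
    exchange : ∀ a b c → a * (b * c) ≡ b * (a * c)
    exchange = ℕ-Solver.solve-∀

  superfactorial : ℕ → ℕ
  superfactorial m = ∏ℕ m _!

  superfactorial-nonZero : ∀ m → NonZero (superfactorial m)
  superfactorial-nonZero zero = _
  superfactorial-nonZero (suc m) = ℕₚ.m*n≢0 (m !) (superfactorial m) {{ℕₚ._!≢0 m}} {{superfactorial-nonZero m}}

  descending : ℕ → ℕ → List ℕ
  descending c zero = []
  descending c (suc m) = (c + m) ∷ descending c m

  product-descending : ∀ c m g → product (map g (descending c m)) ≡ ∏ℕ m (λ s → g (c + s))
  product-descending c zero g = refl
  product-descending c (suc m) g = cong (g (c + m) *_) (product-descending c m g)

  crossDifferences : List ℕ → List ℕ → ℕ
  crossDifferences as bs = product (map (λ a → product (map (a ∸_) bs)) as)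

  differenceProduct-++ : ∀ as bs → differenceProduct (as ++ bs) ≡ differenceProduct as * differenceProduct bs * crossDifferences as bs
  differenceProduct-++ [] bs = sym (trans (ℕₚ.*-identityʳ _) (ℕₚ.+-identityʳ _))
  differenceProduct-++ (a ∷ as) bs
    rewrite Listₚ.map-++ (a ∸_) as bs | product-++ (map (a ∸_) as) (map (a ∸_) bs) | differenceProduct-++ as bs =
    regroup (product (map (a ∸_) as)) (product (map (a ∸_) bs)) (differenceProduct as) (differenceProduct bs) (crossDifferences as bs)
    where
    regroup : ∀ p q v w x → p * q * (v * w * x) ≡ p * v * w * (q * x)
    regroup = ℕ-Solver.solve-∀

  descending-gaps : ∀ c m d → product (map ((c + m + d) ∸_) (descending c m)) * d ! ≡ (m + d) !
  descending-gaps c zero d = ℕₚ.+-identityʳ (d !)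
  descending-gaps c (suc m) d =
    begin
      ((c + suc m + d) ∸ (c + m)) * product (map ((c + suc m + d) ∸_) (descending c m)) * d !
    ≡⟨ cong₂ (λ x y → x * product (map (y ∸_) (descending c m)) * d !) gap shift ⟩
      suc d * product (map ((c + m + suc d) ∸_) (descending c m)) * d !
    ≡⟨ exchange (suc d) (product (map ((c + m + suc d) ∸_) (descending c m))) (d !) ⟩
      product (map ((c + m + suc d) ∸_) (descending c m)) * suc d !
    ≡⟨ descending-gaps c m (suc d) ⟩
      (m + suc d) !
    ≡⟨ cong _! (ℕₚ.+-suc m d) ⟩
      (suc m + d) !
    ∎
    where
    open ≡-Reasoning
    shift : c + suc m + d ≡ c + m + suc d
    shift = reassociate c m d
      where
      reassociate : ∀ c m d → c + suc m + d ≡ c + m + suc d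
      reassociate = ℕ-Solver.solve-∀
    gap : (c + suc m + d) ∸ (c + m) ≡ suc d
    gap = trans (cong (_∸ (c + m)) (trans shift (ℕₚ.+-comm (c + m) (suc d)))) (ℕₚ.m+n∸n≡m (suc d) (c + m))
    exchange : ∀ a p f → a * p * f ≡ p * (a * f)
    exchange = ℕ-Solver.solve-∀

  differenceProduct-descending : ∀ c m → differenceProduct (descending c m) ≡ superfactorial m
  differenceProduct-descending c zero = refl
  differenceProduct-descending c (suc m) =
    cong₂ _*_ (trans (sym (ℕₚ.*-identityʳ (product (map ((c + m) ∸_) (descending c m))))) (trans (cong (λ z → product (map (z ∸_) (descending c m)) * 1) (sym (ℕₚ.+-identityʳ (c + m))))
                (trans (descending-gaps c m 0) (cong _! (ℕₚ.+-identityʳ m)))))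
      (differenceProduct-descending c m)

  paddedRectangle : ℕ → ℕ → ℕ → List ℕ
  paddedRectangle k t n = replicate t k ++ replicate n 0

  length-paddedRectangle : ∀ k t n → length (paddedRectangle k t n) ≡ t + n
  length-paddedRectangle k t n = trans (Listₚ.length-++ (replicate t k)) (cong₂ _+_ (Listₚ.length-replicate t) (Listₚ.length-replicate n))

  paddedRectangle-decreasing : ∀ k t n → Decreasing (paddedRectangle k t n)
  paddedRectangle-decreasing k zero zero = []
  paddedRectangle-decreasing k zero (suc zero) = [-]
  paddedRectangle-decreasing k zero (suc (suc n)) = z≤n ∷ paddedRectangle-decreasing k zero (suc n)
  paddedRectangle-decreasing k (suc zero) zero = [-]
  paddedRectangle-decreasing k (suc zero) (suc n) = z≤n ∷ paddedRectangle-decreasing k zero (suc n)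
  paddedRectangle-decreasing k (suc (suc t)) n = ℕₚ.≤-refl ∷ paddedRectangle-decreasing k (suc t) n

  strictParts-replicate-++ : ∀ m k rs → strictParts (replicate m k ++ rs) ≡ descending (k + length rs) m ++ strictParts rs
  strictParts-replicate-++ zero k rs = refl
  strictParts-replicate-++ (suc m) k rs = cong₂ _∷_ top (strictParts-replicate-++ m k rs)
    where
    top : k + length (replicate m k ++ rs) ≡ k + length rs + m
    top = trans (cong (k +_) (trans (Listₚ.length-++ (replicate m k)) (cong (_+ length rs) (Listₚ.length-replicate m))))
      (trans (cong (k +_) (ℕₚ.+-comm m (length rs))) (sym (ℕₚ.+-assoc k (length rs) m)))

  strictParts-zeros : ∀ n → strictParts (replicate n 0) ≡ descending 0 n
  strictParts-zeros zero = refl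
  strictParts-zeros (suc n) = cong₂ _∷_ (Listₚ.length-replicate n) (strictParts-zeros n)

  factorialQuotient : ℕ → ℕ → ℕ → ℕ
  factorialQuotient k n s = product (map ((k + n + s) ∸_) (descending 0 n))

  factorialQuotient-* : ∀ k n s → factorialQuotient k n s * (k + s) ! ≡ (n + (k + s)) !
  factorialQuotient-* k n s = subst (λ z → product (map (z ∸_) (descending 0 n)) * (k + s) ! ≡ (n + (k + s)) !) (regroup n k s)
    (descending-gaps 0 n (k + s))
    where
    regroup : ∀ n k s → 0 + n + (k + s) ≡ k + n + s
    regroup = ℕ-Solver.solve-∀

  schurAtLength-paddedRectangle : ∀ k t n →
    schurAtLength (paddedRectangle k t n) * superfactorial (t + n) ≡ superfactorial t * superfactorial n * ∏ℕ t (factorialQuotient k n)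
  schurAtLength-paddedRectangle k t n =
    begin
      schurAtLength L * superfactorial (t + n)
    ≡⟨ cong (λ m → schurAtLength L * superfactorial m) (sym (length-paddedRectangle k t n)) ⟩
      schurAtLength L * ∏ℕ (length L) _!
    ≡⟨ schurAtLength-differenceProduct L (paddedRectangle-decreasing k t n) ⟩
      differenceProduct (strictParts L)
    ≡⟨ cong differenceProduct (trans (strictParts-replicate-++ t k (replicate n 0))
         (cong₂ (λ a b → descending (k + a) t ++ b) (Listₚ.length-replicate n) (strictParts-zeros n))) ⟩
      differenceProduct (descending (k + n) t ++ descending 0 n)
    ≡⟨ differenceProduct-++ (descending (k + n) t) (descending 0 n) ⟩
      differenceProduct (descending (k + n) t) * differenceProduct (descending 0 n) * crossDifferences (descending (k + n) t) (descending 0 n)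
    ≡⟨ cong₂ (λ a b → a * b * crossDifferences (descending (k + n) t) (descending 0 n))
         (differenceProduct-descending (k + n) t) (differenceProduct-descending 0 n) ⟩
      superfactorial t * superfactorial n * crossDifferences (descending (k + n) t) (descending 0 n)
    ≡⟨ cong (superfactorial t * superfactorial n *_) (product-descending (k + n) t (λ a → product (map (a ∸_) (descending 0 n)))) ⟩
      superfactorial t * superfactorial n * ∏ℕ t (factorialQuotient k n)
    ∎
    where
    open ≡-Reasoning
    L : List ℕ
    L = paddedRectangle k t n

  factorialQuotient-row : ∀ k n s {d} → d * s ! ≡ (s + k) ! → s ! * factorialQuotient k n s * d ≡ (n + s + k) !
  factorialQuotient-row k n s {d} d-row =
    trans (rotate (s !) (factorialQuotient k n s) d)
      (trans (cong (factorialQuotient k n s *_) (trans d-row (cong _! (ℕₚ.+-comm s k))))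
        (trans (factorialQuotient-* k n s) (cong _! (reassociate n k s))))
    where
    rotate : ∀ a x d → a * x * d ≡ x * (d * a)
    rotate = ℕ-Solver.solve-∀
    reassociate : ∀ n k s → n + (k + s) ≡ n + s + k
    reassociate = ℕ-Solver.solve-∀

  schur-rectangle-rows : ∀ k t n (D U : ℕ → ℕ) → (∀ s → s < t → D s * s ! ≡ (s + k) !) → (∀ s → s < t → U s * (n + s) ! ≡ (n + s + k) !) →
    schurAtLength (paddedRectangle k t n) * ∏ℕ t D ≡ ∏ℕ t U
  schur-rectangle-rows k t n D U D-row U-row =
    ℕₚ.*-cancelʳ-≡ (S * ∏ℕ t D) (∏ℕ t U) (superfactorial (t + n)) {{superfactorial-nonZero (t + n)}} (
    begin
      S * ∏ℕ t D * superfactorial (t + n)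
    ≡⟨ swap₂ S (∏ℕ t D) (superfactorial (t + n)) ⟩
      S * superfactorial (t + n) * ∏ℕ t D
    ≡⟨ cong (_* ∏ℕ t D) (schurAtLength-paddedRectangle k t n) ⟩
      superfactorial t * superfactorial n * ∏ℕ t (factorialQuotient k n) * ∏ℕ t D
    ≡⟨ regroup (superfactorial t) (superfactorial n) (∏ℕ t (factorialQuotient k n)) (∏ℕ t D) ⟩
      superfactorial n * (superfactorial t * ∏ℕ t (factorialQuotient k n) * ∏ℕ t D)
    ≡⟨ cong (superfactorial n *_) (trans (cong (_* ∏ℕ t D) (sym (∏ℕ-* t _! (factorialQuotient k n)))) (sym (∏ℕ-* t _ D))) ⟩
      superfactorial n * ∏ℕ t (λ s → s ! * factorialQuotient k n s * D s)
    ≡⟨ cong (superfactorial n *_) (∏ℕ-cong t (λ s s<t → factorialQuotient-row k n s (D-row s s<t))) ⟩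
      superfactorial n * ∏ℕ t (λ s → (n + s + k) !)
    ≡⟨ cong (superfactorial n *_) (trans (sym (∏ℕ-cong t U-row)) (∏ℕ-* t U (λ s → (n + s) !))) ⟩
      superfactorial n * (∏ℕ t U * ∏ℕ t (λ s → (n + s) !))
    ≡⟨ exchange (superfactorial n) (∏ℕ t U) (∏ℕ t (λ s → (n + s) !)) ⟩
      ∏ℕ t U * (superfactorial n * ∏ℕ t (λ s → (n + s) !))
    ≡⟨ cong (∏ℕ t U *_) (sym (trans (cong superfactorial (ℕₚ.+-comm t n)) (∏ℕ-+ n t _!))) ⟩
      ∏ℕ t U * superfactorial (t + n)
    ∎)
    where
    open ≡-Reasoning
    S : ℕ
    S = schurAtLength (paddedRectangle k t n)
    swap₂ : ∀ a b c → a * b * c ≡ a * c * b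
    swap₂ = ℕ-Solver.solve-∀
    regroup : ∀ a b c d → a * b * c * d ≡ b * (a * c * d)
    regroup = ℕ-Solver.solve-∀
    exchange : ∀ a b c → a * (b * c) ≡ b * (a * c)
    exchange = ℕ-Solver.solve-∀

module HookContent where

  open import Data.Bool using (true; false; T)
  open import Data.Nat as ℕ using (ℕ; zero; suc; z≤n; s≤s; _∸_; _+_; _*_; _≤_; _<_; _≤ᵇ_; _!)
  import Data.Nat.Properties as ℕₚ
  import Data.Nat.Tactic.RingSolver as ℕ-Solver
  open import Data.Nat.ListAction using (product)
  open import Data.Nat.ListAction.Properties using (product-++)
  open import Data.List using (List; []; _∷_; [_]; map; length; replicate; foldr; zip)
  import Data.List.Properties as Listₚ
  open import Data.List.Membership.Propositional using (_∈_)
  open import Data.List.Relation.Unary.Any using (here; there)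
  open import Data.Integer as ℤ using (ℤ; +_)
  import Data.Integer.Properties as ℤₚ
  open import Data.Rational as ℚ using (ℚ; 1ℚ)
  import Data.Rational.Properties as ℚₚ
  open import Data.Rational.Unnormalised as ℚᵘ using (ℚᵘ; mkℚᵘ; *≡*)
  import Data.Rational.Unnormalised.Properties as ℚᵘₚ
  open import Data.Empty using (⊥-elim)
  open import Data.Product using (_,_)
  open import Function using (_∘_)
  open import Relation.Binary.PropositionalEquality hiding ([_])
  open import Defs
  open Shapes using (cellsFrom-∷; ∈-cellsFrom⁻; cellsFrom-++-zeros; range1-∷ʳ; nth-pos⇒<; ∸-suc)
  open SchurDeterminant using (∏ℕ; schurAtLength)
  open Rectangle using (∏ℕ-cong; paddedRectangle; length-paddedRectangle; schur-rectangle-rows)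

  fromℚᵘ-* : ∀ p q → ℚ.fromℚᵘ p ℚ.* ℚ.fromℚᵘ q ≡ ℚ.fromℚᵘ (p ℚᵘ.* q)
  fromℚᵘ-* p q = ℚₚ.toℚᵘ-injective
    (ℚᵘₚ.≃-trans (ℚₚ.toℚᵘ-homo-* (ℚ.fromℚᵘ p) (ℚ.fromℚᵘ q))
      (ℚᵘₚ.≃-trans (ℚᵘₚ.*-cong (ℚₚ.toℚᵘ-fromℚᵘ p) (ℚₚ.toℚᵘ-fromℚᵘ q)) (ℚᵘₚ.≃-sym (ℚₚ.toℚᵘ-fromℚᵘ (p ℚᵘ.* q)))))

  hookContentOver : Partition → ℕ → List Cell → ℚ
  hookContentOver λ′ N us = foldr (λ u acc → ((+ N ℤ.+ content u) ℚ./ hook λ′ u) ℚ.* acc) 1ℚ us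

  product-positive : ∀ (g : Cell → ℕ) us → (∀ u → 1 ≤ g u) → 1 ≤ product (map g us)
  product-positive g [] _ = s≤s z≤n
  product-positive g (u ∷ us) pos = ℕₚ.*-mono-≤ (pos u) (product-positive g us pos)

  suc-pred : ∀ {m} → 1 ≤ m → suc (ℕ.pred m) ≡ m
  suc-pred (s≤s _) = refl

  -- The denominator of a ℚᵘ is stored minus one.
  hookContentOver-fraction : ∀ λ′ N (ν : Cell → ℕ) us → (∀ {u} → u ∈ us → + N ℤ.+ content u ≡ + ν u) →
    hookContentOver λ′ N us ≡ ℚ.fromℚᵘ (mkℚᵘ (+ product (map ν us)) (ℕ.pred (product (map (hook λ′) us))))
  hookContentOver-fraction λ′ N ν [] _ = refl
  hookContentOver-fraction λ′ N ν (u ∷ us) numerators =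
    trans (cong₂ ℚ._*_ (cong (ℚ._/ hook λ′ u) (numerators (here refl))) (hookContentOver-fraction λ′ N ν us (numerators ∘ there)))
      (trans (fromℚᵘ-* (mkℚᵘ (+ ν u) h) (mkℚᵘ (+ P) (ℕ.pred H)))
        (ℚₚ.fromℚᵘ-cong {mkℚᵘ (+ ν u) h ℚᵘ.* mkℚᵘ (+ P) (ℕ.pred H)} {mkℚᵘ (+ (ν u * P)) (ℕ.pred (suc h * H))} (*≡* cross)))
    where
    h P H : ℕ
    h = ℕ.pred (hook λ′ u)
    P = product (map ν us)
    H = product (map (hook λ′) us)
    H-pos : 1 ≤ H
    H-pos = product-positive (hook λ′) us (λ u → s≤s z≤n)
    cross : (+ ν u ℤ.* + P) ℤ.* + suc (ℕ.pred (suc h * H)) ≡ + (ν u * P) ℤ.* + (suc h * suc (ℕ.pred H))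
    cross = trans (cong₂ ℤ._*_ (sym (ℤₚ.pos-* (ν u) P)) (cong +_ (suc-pred (ℕₚ.*-mono-≤ {1} {suc h} (s≤s z≤n) H-pos))))
      (cong (λ z → + (ν u * P) ℤ.* + (suc h * z)) (sym (suc-pred H-pos)))

  product-range1 : ∀ (h : ℕ → ℕ) k → product (map h (range1 k)) ≡ ∏ℕ k (λ j → h (suc j))
  product-range1 h zero = refl
  product-range1 h (suc k) =
    trans (cong (product ∘ map h) (range1-∷ʳ k))
      (trans (cong product (Listₚ.map-++ h (range1 k) [ suc k ]))
        (trans (product-++ (map h (range1 k)) [ h (suc k) ])
          (trans (cong₂ _*_ (product-range1 h k) (ℕₚ.*-identityʳ (h (suc k)))) (ℕₚ.*-comm _ (h (suc k))))))

  -- Rows a, a + 1, …, t of a rectangle, indexed from the bottom row s = 0.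
  product-rectangleCells : ∀ (g : Cell → ℕ) k t m a → a + m ≡ suc t →
    product (map g (cellsFrom a (replicate m k))) ≡ ∏ℕ m (λ s → ∏ℕ k (λ j → g (t ∸ s , suc j)))
  product-rectangleCells g k t zero a _ = refl
  product-rectangleCells g k t (suc m) a a+m≡
    rewrite cellsFrom-∷ a k (replicate m k)
          | Listₚ.map-++ g (map (a ,_) (range1 k)) (cellsFrom (suc a) (replicate m k))
          | product-++ (map g (map (a ,_) (range1 k))) (map g (cellsFrom (suc a) (replicate m k)))
          | product-rectangleCells g k t m (suc a) (trans (sym (ℕₚ.+-suc a m)) a+m≡) =
    cong (_* ∏ℕ m (λ s → ∏ℕ k (λ j → g (t ∸ s , suc j))))
      (trans (cong product (sym (Listₚ.map-∘ (range1 k))))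
        (trans (product-range1 (λ j → g (a , j)) k) (cong (λ z → ∏ℕ k (λ j → g (z , suc j))) a≡)))
    where
    a≡ : a ≡ t ∸ m
    a≡ = sym (trans (cong (_∸ m) (ℕₚ.suc-injective (trans (sym a+m≡) (ℕₚ.+-suc a m)))) (ℕₚ.m+n∸n≡m a m))

  part-replicate : ∀ t k i → 1 ≤ i → i ≤ t → part (replicate t k) i ≡ k
  part-replicate (suc t) k (suc zero) _ _ = refl
  part-replicate (suc t) k (suc (suc i)) _ (s≤s i≤t) = part-replicate t k (suc i) (s≤s z≤n) i≤t

  conj-replicate : ∀ t k j → j ≤ k → conj (replicate t k) j ≡ t
  conj-replicate zero k j _ = refl
  conj-replicate (suc t) k j j≤k with j ≤ᵇ k in eq
  ... | true = cong suc (conj-replicate t k j j≤k)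
  ... | false = ⊥-elim (subst T eq (ℕₚ.≤⇒≤ᵇ j≤k))

  ∏ℕ-ascending : ∀ c k → ∏ℕ k (λ j → c + suc j) * c ! ≡ (c + k) !
  ∏ℕ-ascending c zero = trans (ℕₚ.+-identityʳ (c !)) (cong _! (sym (ℕₚ.+-identityʳ c)))
  ∏ℕ-ascending c (suc k) =
    trans (ℕₚ.*-assoc (c + suc k) _ (c !)) (trans (cong ((c + suc k) *_) (∏ℕ-ascending c k)) (step c k))
    where
    step : ∀ c k → (c + suc k) * (c + k) ! ≡ (c + suc k) !
    step c k rewrite ℕₚ.+-suc c k = refl

  ∏ℕ-descending : ∀ c m → ∏ℕ m (λ j → (c + m) ∸ j) * c ! ≡ (c + m) !
  ∏ℕ-descending c zero = trans (ℕₚ.+-identityʳ (c !)) (cong _! (sym (ℕₚ.+-identityʳ c)))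
  ∏ℕ-descending c (suc m) =
    begin
      ((c + suc m) ∸ m) * ∏ℕ m (λ j → (c + suc m) ∸ j) * c !
    ≡⟨ cong₂ (λ x y → x * y * c !) top (∏ℕ-cong m (λ j _ → cong (_∸ j) (ℕₚ.+-suc c m))) ⟩
      suc c * ∏ℕ m (λ j → (suc c + m) ∸ j) * c !
    ≡⟨ exchange (suc c) (∏ℕ m (λ j → (suc c + m) ∸ j)) (c !) ⟩
      ∏ℕ m (λ j → (suc c + m) ∸ j) * suc c !
    ≡⟨ ∏ℕ-descending (suc c) m ⟩
      (suc c + m) !
    ≡⟨ cong _! (sym (ℕₚ.+-suc c m)) ⟩
      (c + suc m) !
    ∎
    where
    open ≡-Reasoning
    top : (c + suc m) ∸ m ≡ suc c
    top = trans (cong (_∸ m) (ℕₚ.+-suc c m)) (ℕₚ.m+n∸n≡m (suc c) m)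
    exchange : ∀ a p f → a * p * f ≡ p * (a * f)
    exchange = ℕ-Solver.solve-∀

  schur1-rect : ∀ k t n → schur1 (rect k t) (n + t) ≡ schurAtLength (paddedRectangle k t n)
  schur1-rect k t n =
    trans (cong (tableaux (cells (rect k t))) (ℕₚ.+-comm n t))
      (trans (cong (λ C → tableaux C (t + n)) (sym (cellsFrom-++-zeros 1 (replicate t k) n)))
        (cong (tableaux (cells (paddedRectangle k t n))) (sym (length-paddedRectangle k t n))))
    where
    tableaux : List Cell → ℕ → ℕ
    tableaux C N = count (λ vs → ssytOK (zip C vs)) (allAssign (length C) (range1 N))

  hook-rect : ∀ k t s j → s < t → j < k → hook (rect k t) (t ∸ s , suc j) ≡ (s + k) ∸ j
  hook-rect k t s j s<t j<k =
    trans (cong₂ (λ x y → suc ((x + y) ∸ ((t ∸ s) + suc j))) (part-replicate t k (t ∸ s) (ℕₚ.m<n⇒0<n∸m s<t) (ℕₚ.m∸n≤m t s))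
            (conj-replicate t k (suc j) j<k))
      (subst (λ z → suc ((k + z) ∸ ((t ∸ s) + suc j)) ≡ (s + k) ∸ j) (ℕₚ.m∸n+n≡m (ℕₚ.<⇒≤ s<t)) (arm+leg (t ∸ s)))
    where
    arm+leg : ∀ a → suc ((k + (a + s)) ∸ (a + suc j)) ≡ (s + k) ∸ j
    arm+leg a = trans (cong (λ z → suc (z ∸ (a + suc j))) (regroup a s k))
      (trans (cong suc (ℕₚ.[m+n]∸[m+o]≡n∸o a (k + s) (suc j)))
        (trans (sym (∸-suc (ℕₚ.<-≤-trans j<k (ℕₚ.m≤m+n k s)))) (cong (_∸ j) (ℕₚ.+-comm k s))))
      where
      regroup : ∀ a s k → k + (a + s) ≡ a + (k + s)
      regroup = ℕ-Solver.solve-∀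

  -- N + c(i, j) in ℕ; the subtraction does not truncate as long as i ≤ N + j.
  shiftedContent : ℕ → Cell → ℕ
  shiftedContent N (i , j) = N + j ∸ i

  shiftedContent-rect : ∀ t n s j → s < t → shiftedContent (n + t) (t ∸ s , suc j) ≡ (n + s) + suc j
  shiftedContent-rect t n s j s<t =
    subst (λ z → (n + z) + suc j ∸ (t ∸ s) ≡ (n + s) + suc j) (ℕₚ.m∸n+n≡m (ℕₚ.<⇒≤ s<t))
      (trans (cong (_∸ (t ∸ s)) (regroup n (t ∸ s) s (suc j))) (ℕₚ.m+n∸m≡n (t ∸ s) (n + s + suc j)))
    where
    regroup : ∀ n a s b → n + (a + s) + b ≡ a + (n + s + b)
    regroup = ℕ-Solver.solve-∀

  content≡shiftedContent : ∀ N i j → i ≤ N + j → + N ℤ.+ content (i , j) ≡ + shiftedContent N (i , j)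
  content≡shiftedContent N i j i≤ =
    trans (sym (ℤₚ.+-assoc (+ N) (+ j) (ℤ.- (+ i))))
      (trans (cong (ℤ._+ (ℤ.- (+ i))) (sym (ℤₚ.pos-+ N j))) (trans (ℤₚ.m-n≡m⊖n (N + j) i) (ℤₚ.⊖-≥ i≤)))

  hookContent-rect : ∀ k t n → ℕtoℚ (schur1 (rect k t) (n + t)) ≡ hookContent (rect k t) (n + t)
  hookContent-rect k t n =
    trans (cong ℕtoℚ (schur1-rect k t n))
      (trans (ℚₚ.fromℚᵘ-cong {mkℚᵘ (+ S) 0} {mkℚᵘ (+ numerator) (ℕ.pred denominator)} (*≡* cross))
        (sym (hookContentOver-fraction R (n + t) (shiftedContent (n + t)) (cells R) contents)))
    where
    R : Partition
    R = rect k t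
    S numerator denominator : ℕ
    S = schurAtLength (paddedRectangle k t n)
    numerator = product (map (shiftedContent (n + t)) (cells R))
    denominator = product (map (hook R) (cells R))
    contents : ∀ {u} → u ∈ cells R → + (n + t) ℤ.+ content u ≡ + shiftedContent (n + t) u
    contents {i , j} u∈ with ∈-cellsFrom⁻ 1 R u∈
    ... | 1≤i , 1≤j , j≤ =
      let i-1<t = subst (i ∸ 1 <_) (Listₚ.length-replicate t) (nth-pos⇒< R (ℕₚ.≤-trans 1≤j j≤)) in
      content≡shiftedContent (n + t) i j (ℕₚ.≤-trans (ℕₚ.≤-trans (ℕₚ.≤-reflexive (sym (ℕₚ.m+[n∸m]≡n 1≤i))) i-1<t)
        (ℕₚ.≤-trans (ℕₚ.m≤n+m t n) (ℕₚ.m≤m+n (n + t) j)))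
    D U : ℕ → ℕ
    D s = ∏ℕ k (λ j → (s + k) ∸ j)
    U s = ∏ℕ k (λ j → (n + s) + suc j)
    denominator≡ : denominator ≡ ∏ℕ t D
    denominator≡ = trans (product-rectangleCells (hook R) k t t 1 refl)
      (∏ℕ-cong t (λ s s<t → ∏ℕ-cong k (λ j j<k → hook-rect k t s j s<t j<k)))
    numerator≡ : numerator ≡ ∏ℕ t U
    numerator≡ = trans (product-rectangleCells (shiftedContent (n + t)) k t t 1 refl)
      (∏ℕ-cong t (λ s s<t → ∏ℕ-cong k (λ j _ → shiftedContent-rect t n s j s<t)))
    cross : + S ℤ.* + suc (ℕ.pred denominator) ≡ + numerator ℤ.* + 1
    cross =
      trans (cong (λ z → + S ℤ.* + z) (suc-pred (product-positive (hook R) (cells R) (λ _ → s≤s z≤n))))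
        (trans (sym (ℤₚ.pos-* S denominator))
          (trans (cong +_ (trans (cong (S *_) denominator≡)
                    (trans (schur-rectangle-rows k t n D U (λ s _ → ∏ℕ-descending s k) (λ s _ → ∏ℕ-ascending (n + s) k))
                      (sym numerator≡))))
            (sym (ℤₚ.*-identityʳ (+ numerator)))))

module OrderPolytope where

  open import Data.Bool using (Bool; true; false; T; _∨_; not)
  open import Data.Bool.Properties using (T-∧)
  open import Data.Nat as ℕ using (ℕ; zero; suc; z≤n; s≤s; _∸_; _+_; _≤_; _<_; _≤ᵇ_)
  import Data.Nat.Properties as ℕₚ
  open import Data.List using (List; []; _∷_; map; length; replicate; zip; upTo)
  import Data.List.Properties as Listₚ
  open import Data.List.Membership.Propositional using (_∈_)
  open import Data.List.Membership.Propositional.Properties using (∈-upTo⁺; ∈-upTo⁻)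
  open import Data.List.Relation.Unary.All as All using (All)
  open import Data.List.Relation.Unary.Any using (here; there)
  open import Data.List.Relation.Unary.Linked using ([]; [-]; _∷_)
  open import Data.List.Relation.Unary.Unique.Propositional using (Unique)
  import Data.List.Relation.Unary.Unique.Propositional.Properties as Uniqueₚ
  import Data.List.Relation.Unary.All.Properties as Allₚ
  open import Data.Product using (_×_; _,_; proj₁; proj₂)
  open import Data.Empty using (⊥-elim)
  open import Function using (Equivalence)
  open import Relation.Binary.PropositionalEquality
  open import Relation.Nullary using (yes; no)
  open import Defs
  open Enumeration
  open Shapes

  IsOrderPreserving : List ℕ → (Cell → ℕ) → Set
  IsOrderPreserving λs F = ∀ {i j i′ j′} → InShape λs (i , j) → InShape λs (i′ , j′) → i′ ≤ i → j′ ≤ j → F (i , j) ≤ F (i′ , j′)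

  orderᵇ : Cell × ℕ → Cell × ℕ → Bool
  orderᵇ (s , a) (s′ , b) = not (s ≺ᵇ s′) ∨ (a ≤ᵇ b)

  cellEqᵇ⇒≡ : ∀ i j i′ j′ → T (cellEqᵇ (i , j) (i′ , j′)) → (i , j) ≡ (i′ , j′)
  cellEqᵇ⇒≡ i j i′ j′ t = let (i≡ , j≡) = Equivalence.to T-∧ t in cong₂ _,_ (ℕₚ.≡ᵇ⇒≡ i i′ i≡) (ℕₚ.≡ᵇ⇒≡ j j′ j≡)

  orderᵇ⁻ : ∀ i j i′ j′ a b → T (orderᵇ ((i , j) , a) ((i′ , j′) , b)) → i′ ≤ i → j′ ≤ j → (i , j) ≢ (i′ , j′) → a ≤ b
  orderᵇ⁻ i j i′ j′ a b t i′≤i j′≤j c≢c′ with cellEqᵇ (i , j) (i′ , j′) in eq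
  ... | true = ⊥-elim (c≢c′ (cellEqᵇ⇒≡ i j i′ j′ (subst T (sym eq) _)))
  ... | false = ℕₚ.≤ᵇ⇒≤ a b (implies⁻ t (Equivalence.from T-∧ (Equivalence.from T-∧ (ℕₚ.≤⇒≤ᵇ i′≤i , ℕₚ.≤⇒≤ᵇ j′≤j) , _)))

  orderᵇ⁺ : ∀ i j i′ j′ a b → (i′ ≤ i → j′ ≤ j → a ≤ b) → T (orderᵇ ((i , j) , a) ((i′ , j′) , b))
  orderᵇ⁺ i j i′ j′ a b h = implies⁺ λ t →
    let (i′≤i , j′≤j) = Equivalence.to T-∧ (proj₁ (Equivalence.to T-∧ t)) in
    ℕₚ.≤⇒≤ᵇ (h (ℕₚ.≤ᵇ⇒≤ i′ i i′≤i) (ℕₚ.≤ᵇ⇒≤ j′ j j′≤j))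

  orderOK⇒IsOrderPreserving : ∀ λs vs → length vs ≡ length (cells λs) → T (orderOK (zip (cells λs) vs)) →
    IsOrderPreserving λs (valueAt (cells λs) vs)
  orderOK⇒IsOrderPreserving λs vs len t {i} {j} {i′} {j′} c c′ i′≤i j′≤j with (i , j) ≟ᶜ (i′ , j′)
  ... | yes refl = ℕₚ.≤-refl
  ... | no c≢c′ = orderᵇ⁻ i j i′ j′ _ _ (allPairs-zip⁻ (cells λs) vs orderᵇ len t (∈-cellsFrom⁺ 1 λs c) (∈-cellsFrom⁺ 1 λs c′)) i′≤i j′≤j c≢c′

  IsOrderPreserving⇒orderOK : ∀ λs vs → IsOrderPreserving λs (valueAt (cells λs) vs) → T (orderOK (zip (cells λs) vs))
  IsOrderPreserving⇒orderOK λs vs monotone = allPairs-zip⁺ (cells λs) vs orderᵇ (Unique-cellsFrom 1 λs) λ {(i , j)} {(i′ , j′)} c∈ c′∈ →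
    orderᵇ⁺ i j i′ j′ _ _ (monotone (∈-cellsFrom⁻ 1 λs c∈) (∈-cellsFrom⁻ 1 λs c′∈))

  reflectEntry : ℕ → Cell × ℕ → ℕ
  reflectEntry n ((i , j) , v) = n + i ∸ v

  reflect : ℕ → List Cell → List ℕ → List ℕ
  reflect n C vs = map (reflectEntry n) (zip C vs)

  length-reflect : ∀ n C vs → length vs ≡ length C → length (reflect n C vs) ≡ length C
  length-reflect n [] [] _ = refl
  length-reflect n (d ∷ C) (v ∷ vs) len = cong suc (length-reflect n C vs (ℕₚ.suc-injective len))

  valueAt-reflect : ∀ n C vs {c} → length vs ≡ length C → c ∈ C → valueAt C (reflect n C vs) c ≡ reflectEntry n (c , valueAt C vs c)
  valueAt-reflect n (d ∷ C) (v ∷ vs) {c} len c∈ with d ≟ᶜ c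
  ... | yes refl = refl
  valueAt-reflect n (d ∷ C) (v ∷ vs) len (here refl) | no d≢d = ⊥-elim (d≢d refl)
  valueAt-reflect n (d ∷ C) (v ∷ vs) len (there c∈) | no _ = valueAt-reflect n C vs (ℕₚ.suc-injective len) c∈

  All-reflect : ∀ {P : ℕ → Set} n C vs → Unique C →
    (∀ {c} → c ∈ C → P (reflectEntry n (c , valueAt C vs c))) → All P (reflect n C vs)
  All-reflect {P} n C vs u h = Allₚ.map⁺ (All.tabulate λ {(c , v)} cv∈ →
    subst (λ v → P (reflectEntry n (c , v))) (sym (∈-zip-valueAt C vs u cv∈)) (h (∈-zip⁻ˡ C vs cv∈)))

  reflect-involutive : ∀ n C vs → Unique C → length vs ≡ length C → (∀ {c} → c ∈ C → valueAt C vs c ≤ n + proj₁ c) →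
    reflect n C (reflect n C vs) ≡ vs
  reflect-involutive n C vs u len bounded =
    trans (sym (map-valueAt C (reflect n C (reflect n C vs)) u (length-reflect n C _ (length-reflect n C vs len))))
      (trans (Listₚ.map-cong-local (All.tabulate λ {c} c∈ →
          trans (valueAt-reflect n C (reflect n C vs) (length-reflect n C vs len) c∈)
            (trans (cong (λ z → reflectEntry n (c , z)) (valueAt-reflect n C vs len c∈)) (ℕₚ.m∸[m∸n]≡n (bounded c∈)))))
        (map-valueAt C vs u len))

  nth-replicate : ∀ t k {i} → i < t → nth (replicate t k) i ≡ k
  nth-replicate (suc t) k {zero} _ = refl
  nth-replicate (suc t) k {suc i} (s≤s i<t) = nth-replicate t k i<t

  replicate-decreasing : ∀ t k → Decreasing (replicate t k)
  replicate-decreasing zero k = []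
  replicate-decreasing (suc zero) k = [-]
  replicate-decreasing (suc (suc t)) k = ℕₚ.≤-refl ∷ replicate-decreasing (suc t) k

  InShape-rect⁻ : ∀ k t {i j} → InShape (replicate t k) (i , j) → i ≤ t × j ≤ k
  InShape-rect⁻ k t {suc i} {j} (_ , 1≤j , j≤) =
    let i<t = subst (i <_) (Listₚ.length-replicate t) (nth-pos⇒< (replicate t k) (ℕₚ.≤-trans 1≤j j≤)) in
    i<t , subst (j ≤_) (nth-replicate t k i<t) j≤

  InShape-rect⁺ : ∀ k t {i j} → 1 ≤ i → i ≤ t → 1 ≤ j → j ≤ k → InShape (replicate t k) (i , j)
  InShape-rect⁺ k t {suc i} {j} 1≤i i≤t 1≤j j≤k = 1≤i , 1≤j , subst (j ≤_) (sym (nth-replicate t k i≤t)) j≤k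

  module Reflection (k t n : ℕ) where
    R : List ℕ
    R = replicate t k
    C : List Cell
    C = cells R
    points : List (List ℕ)
    points = allAssign (length C) (upTo (suc n))
    tableaux : List (List ℕ)
    tableaux = allAssign (length C) (range1 (n + t))

    module Forward (x : List ℕ) (x∈ : x ∈ points) (ok : T (orderOK (zip C x))) where
      x-length : length x ≡ length C
      x-length = proj₁ (∈-allAssign⁻ (length C) (upTo (suc n)) x∈)
      X : Cell → ℕ
      X = valueAt C x
      X≤n : ∀ {c} → c ∈ C → X c ≤ n
      X≤n c∈ = ℕₚ.≤-pred (∈-upTo⁻ (All.lookup (proj₂ (∈-allAssign⁻ (length C) (upTo (suc n)) x∈)) (valueAt-∈ C x x-length c∈)))
      monotone : IsOrderPreserving R X
      monotone = orderOK⇒IsOrderPreserving R x x-length ok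
      y : List ℕ
      y = reflect n C x
      y-value : ∀ {i j} → InShape R (i , j) → valueAt C y (i , j) ≡ (n ∸ X (i , j)) + i
      y-value {i} c = let c∈ = ∈-cellsFrom⁺ 1 R c in trans (valueAt-reflect n C x x-length c∈) (ℕₚ.+-∸-comm i (X≤n c∈))
      reflect∈ : y ∈ tableaux
      reflect∈ = ∈-allAssign⁺ (length C) (range1 (n + t)) (length-reflect n C x x-length)
        (All-reflect n C x (Unique-cellsFrom 1 R) λ {(i , j)} c∈ →
          let c = ∈-cellsFrom⁻ 1 R c∈ in
          subst (_∈ range1 (n + t)) (sym (ℕₚ.+-∸-comm i (X≤n c∈)))
            (∈-range1⁺ (ℕₚ.≤-trans (proj₁ c) (ℕₚ.m≤n+m i (n ∸ X (i , j)))) (ℕₚ.+-mono-≤ (ℕₚ.m∸n≤m n (X (i , j))) (proj₁ (InShape-rect⁻ k t c)))))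
      reflect-ok : T (ssytOK (zip C y))
      reflect-ok = IsSSYT⇒ssytOK R y (IsSSYT-restrict {λs = R} {F = λ (i , j) → (n ∸ X (i , j)) + i} (λ c → c) (λ c → sym (y-value c)) (record
        { rows-weak = λ {i} c c′ j<j′ → ℕₚ.+-monoˡ-≤ i (ℕₚ.∸-monoʳ-≤ n (monotone c′ c ℕₚ.≤-refl (ℕₚ.<⇒≤ j<j′)))
        ; columns-strict = λ c c′ i<i′ → ℕₚ.+-mono-≤-< (ℕₚ.∸-monoʳ-≤ n (monotone c′ c (ℕₚ.<⇒≤ i<i′) ℕₚ.≤-refl)) i<i′ }))
      reflect-reflect : reflect n C y ≡ x
      reflect-reflect = reflect-involutive n C x (Unique-cellsFrom 1 R) x-length (λ {c} c∈ → ℕₚ.≤-trans (X≤n c∈) (ℕₚ.m≤m+n n (proj₁ c)))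

    module Backward (y : List ℕ) (y∈ : y ∈ tableaux) (ok : T (ssytOK (zip C y))) where
      y-length : length y ≡ length C
      y-length = proj₁ (∈-allAssign⁻ (length C) (range1 (n + t)) y∈)
      Y : Cell → ℕ
      Y = valueAt C y
      Y-bounds : ∀ {c} → InShape R c → 1 ≤ Y c × Y c ≤ n + t
      Y-bounds c = ∈-range1⁻ (All.lookup (proj₂ (∈-allAssign⁻ (length C) (range1 (n + t)) y∈)) (valueAt-∈ C y y-length (∈-cellsFrom⁺ 1 R c)))
      ssyt : IsSSYT R Y
      ssyt = ssytOK⇒IsSSYT R y y-length ok
      Y≥row : ∀ {i j} → InShape R (i , j) → i ≤ Y (i , j)
      Y≥row {i} {j} c@(1≤i , 1≤j , _) =
        let top = InShape-rect⁺ k t (s≤s z≤n) (ℕₚ.≤-trans 1≤i (proj₁ (InShape-rect⁻ k t c))) 1≤j (proj₂ (InShape-rect⁻ k t c)) in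
        subst (_≤ Y (i , j)) (ℕₚ.m+[n∸m]≡n 1≤i)
          (ℕₚ.≤-trans (ℕₚ.+-monoˡ-≤ (i ∸ 1) (proj₁ (Y-bounds top))) (ssyt-chain (replicate-decreasing t k) ssyt c (s≤s z≤n) 1≤i 1≤j ℕₚ.≤-refl))
      Y≤row : ∀ {i j} → InShape R (i , j) → Y (i , j) ≤ n + i
      Y≤row {i} {j} c@(1≤i , 1≤j , _) =
        let (i≤t , j≤k) = InShape-rect⁻ k t c
            bottom = InShape-rect⁺ k t (ℕₚ.≤-trans 1≤i i≤t) ℕₚ.≤-refl 1≤j j≤k
        in ℕₚ.+-cancelʳ-≤ (t ∸ i) (Y (i , j)) (n + i)
             (subst (Y (i , j) + (t ∸ i) ≤_) (sym (trans (ℕₚ.+-assoc n i (t ∸ i)) (cong (n +_) (ℕₚ.m+[n∸m]≡n i≤t))))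
               (ℕₚ.≤-trans (ssyt-chain (replicate-decreasing t k) ssyt bottom 1≤i i≤t 1≤j ℕₚ.≤-refl) (proj₂ (Y-bounds bottom))))
      x : List ℕ
      x = reflect n C y
      x-value : ∀ {c} → InShape R c → valueAt C x c ≡ n + proj₁ c ∸ Y c
      x-value c = valueAt-reflect n C y y-length (∈-cellsFrom⁺ 1 R c)
      reflect∈ : x ∈ points
      reflect∈ = ∈-allAssign⁺ (length C) (upTo (suc n)) (length-reflect n C y y-length)
        (All-reflect n C y (Unique-cellsFrom 1 R) λ {(i , j)} c∈ →
          ∈-upTo⁺ (s≤s (ℕₚ.≤-trans (ℕₚ.∸-monoʳ-≤ (n + i) (Y≥row (∈-cellsFrom⁻ 1 R c∈))) (ℕₚ.≤-reflexive (ℕₚ.m+n∸n≡m n i)))))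
      reflect-ok : T (orderOK (zip C x))
      reflect-ok = IsOrderPreserving⇒orderOK R x λ {i} {j} {i′} {j′} c c′ i′≤i j′≤j →
        subst₂ _≤_ (sym (x-value c)) (sym (x-value c′))
          (ℕₚ.≤-trans (ℕₚ.∸-monoʳ-≤ (n + i) (ssyt-chain (replicate-decreasing t k) ssyt c (proj₁ c′) i′≤i (proj₁ (proj₂ c′)) j′≤j))
            (ℕₚ.≤-reflexive (trans (cong (n + i ∸_) (ℕₚ.+-comm (Y (i′ , j′)) (i ∸ i′)))
              (trans (sym (ℕₚ.∸-+-assoc (n + i) (i ∸ i′) (Y (i′ , j′)))) (cong (_∸ Y (i′ , j′)) (drop-rows i′≤i))))))
        where
        drop-rows : ∀ {i i′} → i′ ≤ i → n + i ∸ (i ∸ i′) ≡ n + i′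
        drop-rows {i} {i′} i′≤i = trans (cong (λ z → n + z ∸ (i ∸ i′)) (sym (ℕₚ.m+[n∸m]≡n i′≤i)))
          (trans (cong (_∸ (i ∸ i′)) (sym (ℕₚ.+-assoc n i′ (i ∸ i′)))) (ℕₚ.m+n∸n≡m (n + i′) (i ∸ i′)))
      reflect-reflect : reflect n C x ≡ y
      reflect-reflect = reflect-involutive n C y (Unique-cellsFrom 1 R) y-length (λ c∈ → Y≤row (∈-cellsFrom⁻ 1 R c∈))

    points≃tableaux : count (λ x → orderOK (zip C x)) points ≡ count (λ y → ssytOK (zip C y)) tableaux
    points≃tableaux = count-bijection points tableaux _ _ (reflect n C) (reflect n C)
      (Unique-allAssign (length C) (Uniqueₚ.upTo⁺ (suc n))) (Unique-allAssign (length C) (Unique-range1 (n + t)))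
      (λ {x} x∈ ok → let open Forward x x∈ ok in reflect∈ , reflect-ok , reflect-reflect)
      (λ {y} y∈ ok → let open Backward y y∈ ok in reflect∈ , reflect-ok , reflect-reflect)

  ehrFerrers-rect : ∀ k t n → ehrFerrers (rect k t) n ≡ schur1 (rect k t) (n + t)
  ehrFerrers-rect = Reflection.points≃tableaux

open import Defs
open import Data.Nat using (ℕ; _+_; _≤_)
open import Data.List using (length)
open import Data.List.Properties using (length-replicate)
open import Data.Product using (_×_; _,_)
open import Relation.Binary.PropositionalEquality using (_≡_)
open OrderPolytope using (ehrFerrers-rect)
open HookContent using (hookContent-rect)

theorem5p11 : (k t : ℕ) → 1 ≤ k → 1 ≤ t → (n : ℕ) →
    (ehrFerrers (rect k t) n ≡ schur1 (rect k t) (n + length (rect k t)))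
    × (ℕtoℚ (schur1 (rect k t) (n + length (rect k t)))
       ≡ hookContent (rect k t) (n + length (rect k t)))
theorem5p11 k t _ _ n rewrite length-replicate t {k} = ehrFerrers-rect k t n , hookContent-rect k t n
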